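{- Let $\alpha$ be a fixed partition and $n\ge0$. For an $n\times n$ symmetric PPM $M$ with $j$ nonzero entries and $U\in\mathcal{D}(\alpha/\mu)$ with $\alpha/\mu\vdash2(n-j)$, one has $\Phi(U,U,M)=(P,P)$ for some SDT $P$; set $\Phi_{\rm sym}(U,M)=P$. Then $\Phi_{\rm sym}$ is a bijection $$\bigcup_{j\geq0}\Big(\bigcup_{\mu:\ \alpha/\mu\vdash 2(n-j)}\mathcal{D}(\alpha/\mu)\times\mathfrak{SM}_n^j\Big)\ \longrightarrow\ \bigcup_{\lambda:\ \lambda/\alpha\vdash 2n}\mathcal{D}(\lambda/\alpha),$$ where $\mathfrak{SM}_n^j$ is the set of symmetric $n\times n$ PPMs with $j$ nonzero entries.
   Context: Partitions are identified with Young diagrams; for $\mu\subseteq\lambda$, $\lambda/\mu$ is the set of cells of $\lambda$ not in $\mu$ and $\lambda/\mu\vdash n$ means it has $n$ cells. A standard domino tableau (SDT) of shape $\lambda/\mu\vdash2n$ is a standard Young tableau of that shape (bijection to $\{1,\dots,2n\}$ increasing along rows and columns) in which entries $2k-1,2k$ occupy a domino (two adjacent cells) for each $k$; viewed as dominoes labelled $1,\dots,n$. $\mathcal{D}(\lambda/\mu)$ denotes the set of these. An $n\times m$ PPM is a matrix with entries in $\{1,-1,0\}$ and at most one nonzero entry per row and column. $\mu<_{\rm d}\lambda$ means $\lambda/\mu$ is a domino; $\mu\le_{\rm d}\lambda$ means $\mu=\lambda$ or $\mu<_{\rm d}\lambda$. The map $\Phi(U,V,M)$ for $U\in\mathcal{D}(\beta/\mu)$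 ($\beta/\mu\vdash 2(m-j)$), $V\in\mathcal{D}(\alpha/\mu)$ ($\alpha/\mu\vdash2(n-j)$), $M$ an $n\times m$ PPM with $j$ nonzero entries: build partitions $\Gamma_{(i,k)}$, $0\le i\le n$, $0\le k\le m$; top row $\Gamma_{(0,\cdot)}$ is the $\le_{\rm d}$-multichain from $\mu$ to $\beta$ with a repetition $\Gamma_{(0,k-1)}=\Gamma_{(0,k)}$ exactly at columns $k$ of $M$ containing a nonzero entry, nonempty differences being the dominoes of $U$ in label order; left column $\Gamma_{(\cdot,0)}$ is the multichain from $\mu$ to $\alpha$ with repetitions exactly at rows $i$ of $M$ containing a nonzero entry, differences the dominoes of $V$ in order. For $i,k\ge1$, with $\nu=\Gamma_{(i-1,k-1)},\kappa=\Gamma_{(i-1,k)},\rho=\Gamma_{(i,k-1)}$, $\Gamma_{(i,k)}$ is: if $M(i,k)=1$, $\kappa$ plus a horizontal domino in row 1; if $M(i,k)=-1$, $\kappa$ plus a vertical domino in column 1; if $M(i,k)=0$: if $\nu=\kappa$ or $\nu=\rho$, the largest of the three; if $\nu<_{\rm d}\kappa,\rho$, $\kappa\ne\rho$ with disjoint $\kappa/\nu,\rho/\nu$, $\kappa\cup\rho$; if $\nu<_{\rm d}\kappa,\rho$, $\kappa\neq\rho$ sharing cell $(p,q)$, $\kappa\cup\rho$ plus cell $(p+1,q+1)$; if $\nu<_{\rm d}\kappa=\rho$ with horizontal domino $\kappa/\nu$ in row $r$, $\kappa$ plus a horizontal domino in row $r+1$; if $\nu<_{\rm d}\kappa=\rho$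 with vertical domino $\kappa/\nu$ in column $c$, $\kappa$ plus a vertical domino in column $c+1$. With $\lambda=\Gamma_{(n,m)}$: $P\in\mathcal{D}(\lambda/\alpha)$ has domino $k$ equal to $\Gamma_{(n,k)}/\Gamma_{(n,k-1)}$, $Q\in\mathcal{D}(\lambda/\beta)$ has domino $i$ equal to $\Gamma_{(i,m)}/\Gamma_{(i-1,m)}$, and $\Phi(U,V,M)=(P,Q)$. -}

module Defs where

open import Data.Nat using (ℕ; zero; suc; _+_; _∸_; _<_; _≤_; _≥_; _⊔_; _≡ᵇ_; _≤ᵇ_)
open import Data.Nat.Properties using () renaming (_≟_ to _≟ℕ_)
open import Data.Bool using (Bool; true; false; if_then_else_; not; _∨_; _∧_)
open import Data.List using (List; []; _∷_; length; map; upTo; foldr)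
open import Data.Nat.ListAction using (sum)
open import Data.List.Properties using (≡-dec)
open import Data.List.Relation.Unary.All using (All)
open import Data.List.Relation.Unary.Linked using (Linked)
open import Data.Maybe using (Maybe; just; nothing)
import Data.Vec
open import Data.Vec using (Vec; lookup; toList; transpose)
open import Data.Fin using (Fin)
open import Data.Product using (Σ; _×_; _,_; proj₁; proj₂)
open import Data.Sum using (_⊎_)
open import Relation.Nullary using (¬_; yes; no)
open import Relation.Binary.PropositionalEquality using (_≡_)

-- A partition is a list of its (positive, weakly decreasing) row
-- lengths.  Rows and columns are indexed from 0 internally: the cell
-- (r , c) (0-indexed) is the cell in row r+1, column c+1 of the paper.

Part : Set
Part = List ℕ

IsPartition : Part → Set
IsPartition λ' = All (0 <_) λ' × Linked _≥_ λ'

rowLen : Part → ℕ → ℕ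
rowLen []       _       = 0
rowLen (x ∷ _)  zero    = x
rowLen (_ ∷ xs) (suc r) = rowLen xs r

InDiag : Part → ℕ → ℕ → Set
InDiag λ' r c = c < rowLen λ' r

_⊆_ : Part → Part → Set
μ ⊆ λ' = ∀ r c → InDiag μ r c → InDiag λ' r c

SkewIsPair : Part → Part → ℕ → ℕ → ℕ → ℕ → Set
SkewIsPair μ λ' r c r' c' =
  ∀ x y → ((InDiag λ' x y × ¬ InDiag μ x y) → ((x ≡ r × y ≡ c) ⊎ (x ≡ r' × y ≡ c')))
        × (((x ≡ r × y ≡ c) ⊎ (x ≡ r' × y ≡ c')) → (InDiag λ' x y × ¬ InDiag μ x y))

_<d_ : Part → Part → Set
μ <d λ' = IsPartition μ × IsPartition λ' × μ ⊆ λ' ×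
  Σ ℕ λ r → Σ ℕ λ c → SkewIsPair μ λ' r c r (suc c) ⊎ SkewIsPair μ λ' r c (suc r) c

-- An SDT of shape λ/μ with k dominoes is recorded by the chain of
-- shapes  μ = γ₀ <_d γ₁ <_d ... <_d γₖ = λ, where γᵢ/γᵢ₋₁ is the domino
-- labelled i (cells 2i-1, 2i of the standard Young tableau).  The list
-- stored is [γ₁ , ... , γₖ].

DominoChain : Part → List Part → Part → Set
DominoChain μ []       λ' = μ ≡ λ'
DominoChain μ (γ ∷ γs) λ' = μ <d γ × DominoChain γ γs λ'

-- T ∈ 𝒟(λ/μ)  (the number of dominoes is length T, so λ/μ ⊢ 2·length T)
IsSDT : Part → Part → List Part → Set
IsSDT μ λ' T = IsPartition μ × DominoChain μ T λ'

data Entry : Set where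
  one  : Entry
  mone : Entry
  zer  : Entry

isNZ : Entry → Bool
isNZ zer = false
isNZ _   = true

Mat : ℕ → ℕ → Set
Mat n m = Vec (Vec Entry m) n       -- n rows, m columns

entry : ∀ {n m} → Mat n m → Fin n → Fin m → Entry
entry M i k = lookup (lookup M i) k

IsPPM : ∀ {n m} → Mat n m → Set
IsPPM {n} {m} M =
  (∀ (i : Fin n) (k k' : Fin m) → isNZ (entry M i k) ≡ true → isNZ (entry M i k') ≡ true → k ≡ k')
  × (∀ (i i' : Fin n) (k : Fin m) → isNZ (entry M i k) ≡ true → isNZ (entry M i' k) ≡ true → i ≡ i')

IsSymmetric : ∀ {n} → Mat n n → Set
IsSymmetric {n} M = ∀ (i k : Fin n) → entry M i k ≡ entry M k i

countNZ : List Entry → ℕ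
countNZ es = sum (map (λ e → if isNZ e then 1 else 0) es)

nzCount : ∀ {n m} → Mat n m → ℕ
nzCount M = sum (map (λ row → countNZ (toList row)) (toList M))

anyNZ : ∀ {m} → Vec Entry m → Bool
anyNZ row = foldr _∨_ false (map isNZ (toList row))

raiseRow : ℕ → ℕ → Part → Part
raiseRow zero    v []       = v ∷ []
raiseRow zero    v (x ∷ xs) = (x ⊔ v) ∷ xs
raiseRow (suc r) v []       = 0 ∷ raiseRow r v []
raiseRow (suc r) v (x ∷ xs) = x ∷ raiseRow r v xs

addCell : ℕ → ℕ → Part → Part
addCell r c λ' = raiseRow r (suc c) λ'

addH : ℕ → Part → Part
addH r λ' = raiseRow r (rowLen λ' r + 2) λ'

colHeight : ℕ → Part → ℕ
colHeight c λ' = sum (map (λ x → if suc c ≤ᵇ x then 1 else 0) λ')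

-- λ plus a vertical domino in column c (0-indexed): the two cells
-- below the bottom of column c
addV : ℕ → Part → Part
addV c λ' = addCell (suc (colHeight c λ')) c (addCell (colHeight c λ') c λ')

union : Part → Part → Part
union []       ys       = ys
union xs       []       = xs
union (x ∷ xs) (y ∷ ys) = (x ⊔ y) ∷ union xs ys

firstWhere : (ℕ → Bool) → List ℕ → Maybe ℕ
firstWhere p []       = nothing
firstWhere p (r ∷ rs) = if p r then just r else firstWhere p rs

_≟P_ = ≡-dec _≟ℕ_

_<ᵇ_ : ℕ → ℕ → Bool
a <ᵇ b = suc a ≤ᵇ b

firstDiff : Part → Part → ℕ
firstDiff ν κ with firstWhere (λ r → not (rowLen ν r ≡ᵇ rowLen κ r)) (upTo (length ν ⊔ length κ))
... | just r  = r
... | nothing = 0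

-- the row containing a cell common to κ/ν and ρ/ν, if any
-- (a cell of row r lies in κ/ν and in ρ/ν iff it is (r , rowLen ν r),
-- i.e. iff both κ and ρ are longer than ν in row r)
sharedRow : Part → Part → Part → Maybe ℕ
sharedRow ν κ ρ =
  firstWhere (λ r → (rowLen ν r <ᵇ rowLen κ r) ∧ (rowLen ν r <ᵇ rowLen ρ r))
             (upTo (length κ ⊔ length ρ))

-- κ ∪ ρ, plus the cell diagonally below-right of the shared cell
unionPlus : Part → Part → Part → Maybe ℕ → Part
unionPlus ν κ ρ nothing  = union κ ρ
unionPlus ν κ ρ (just p) = addCell (suc p) (suc (rowLen ν p)) (union κ ρ)

-- κ = ρ, ν <_d κ: horizontal domino κ/ν in row r gives κ plus a
-- horizontal domino in row r+1; vertical domino κ/ν in column c gives κ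
-- plus a vertical domino in column c+1.
sameRule : Part → Part → Part
sameRule ν κ =
  let r = firstDiff ν κ in
  if rowLen κ r ≡ᵇ rowLen ν r + 2
  then addH (suc r) κ
  else addV (rowLen κ r) κ                  -- vertical, in column (rowLen κ r ∸ 1); next column is rowLen κ r

-- Local rule for M(i,k) = 0, with ν = Γ(i-1,k-1), κ = Γ(i-1,k), ρ = Γ(i,k-1).
localZero : Part → Part → Part → Part
localZero ν κ ρ with ν ≟P κ | ν ≟P ρ | κ ≟P ρ
... | yes _ | _     | _     = ρ
... | no _  | yes _ | _     = κ
... | no _  | no _  | no _  = unionPlus ν κ ρ (sharedRow ν κ ρ)
... | no _  | no _  | yes _ = sameRule ν κ

local : Entry → Part → Part → Part → Part
local one  ν κ ρ = addH 0 κ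
local mone ν κ ρ = addV 0 κ
local zer  ν κ ρ = localZero ν κ ρ

-- multichain γ₀ ≤_d γ₁ ≤_d ...: a repetition at each position flagged
-- true, otherwise the next shape of the given domino chain.
multichain : Part → List Part → List Bool → List Part
multichain γ ss       []           = γ ∷ []
multichain γ ss       (true ∷ fs)  = γ ∷ multichain γ ss fs
multichain γ []       (false ∷ fs) = γ ∷ multichain γ [] fs
multichain γ (s ∷ ss) (false ∷ fs) = γ ∷ multichain s ss fs

-- given row i-1 (Γ(i-1,0..m)), Γ(i,0) and row i of M, compute Γ(i,1..m)
nextRow : List Part → Part → List Entry → List Part
nextRow (ν ∷ κ ∷ rest) ρ (e ∷ es) = let λ' = local e ν κ ρ in λ' ∷ nextRow (κ ∷ rest) λ' es
nextRow _              _ _        = []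

-- all rows Γ(i,·), from the current row, the remaining left-column
-- shapes Γ(i+1,0), Γ(i+2,0), ..., and the remaining rows of M
gridRows : List Part → List Part → List (List Entry) → List (List Part)
gridRows cur (ρ ∷ ls) (r ∷ rs) = cur ∷ gridRows (ρ ∷ nextRow cur ρ r) ls rs
gridRows cur _        _        = cur ∷ []

lastOr : {A : Set} → A → List A → A
lastOr d []       = d
lastOr d (x ∷ xs) = lastOr x xs

tailL : {A : Set} → List A → List A
tailL []       = []
tailL (_ ∷ xs) = xs

-- Φ(U,V,M) = (P,Q), for U ∈ 𝒟(β/μ), V ∈ 𝒟(α/μ) given as chains from μ.
Φ : ∀ {n m} → Part → List Part → List Part → Mat n m → List Part × List Part
Φ {n} {m} μ U V M =
  let colFlags = toList (Data.Vec.map anyNZ (transpose M))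
      rowFlags = toList (Data.Vec.map anyNZ M)
      top      = multichain μ U colFlags     -- Γ(0,0..m)
      left     = multichain μ V rowFlags     -- Γ(0..n,0)
      rows     = gridRows top (tailL left) (toList (Data.Vec.map toList M))
      lastRow  = lastOr [] rows              -- Γ(n,0..m)
      P        = tailL lastRow               -- [Γ(n,1), ..., Γ(n,m)]
      Q        = tailL (map (lastOr []) rows) -- [Γ(1,m), ..., Γ(n,m)]
  in P , Q

Dom : ℕ → Set
Dom n = Part × List Part × Mat n n

-- (μ,U,M) lies in ⋃_j ⋃_{μ : α/μ ⊢ 2(n-j)} 𝒟(α/μ) × 𝔖𝔐ₙʲ, with j = number
-- of nonzero entries of M.
InDom : Part → (n : ℕ) → Dom n → Set
InDom α n (μ , U , M) =
  IsSDT μ α U × length U ≡ n ∸ nzCount M × IsPPM M × IsSymmetric M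

InCod : Part → ℕ → List Part → Set
InCod α n P = Σ Part λ λ' → IsSDT α λ' P × length P ≡ n

ΦU : ∀ {n} → Dom n → List Part × List Part
ΦU (μ , U , M) = Φ μ U U M

Φsym : ∀ {n} → Dom n → List Part
Φsym d = proj₁ (ΦU d)

module Submission where

-- Everything rests on two properties of one cell λ = local e ν κ ρ of the
-- growth diagram, established first:
--   * forward: if κ and ρ are ν or ν plus a domino (and e ≠ 0 only when
--     ν = κ = ρ), then λ is a partition and κ, ρ ≤_d λ; moreover λ falls
--     into exactly one of the shapes listed in RuleCase (rule-case);
--   * backward: for partitions κ, ρ ≤_d λ there is exactly one pair (ν , e)
--     with local e ν κ ρ = λ (local-surjective, local-cancel).
-- Propagating the forward property cell by cell (Growth.Forward) shows that
-- every shape of the grid is a partition and that an edge is a repetition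
-- exactly when a nonzero entry of M lies beyond it; hence the last row and
-- column of the grid are standard domino tableaux.  A symmetric M with equal
-- top and left boundaries gives a symmetric grid (SymmetricGrowth), so
-- P = Q.  Injectivity: the last row and column determine the whole grid and
-- M by backward induction (BoundaryDetermines).  Surjectivity: from P we grow
-- a grid backwards from the bottom-right corner (Backward), show it is
-- symmetric and comes from a symmetric PPM, and read off (μ , U).

open import Defs
open import Data.Nat hiding (_<ᵇ_)
open import Data.Nat.Properties
open import Data.Nat.ListAction using (sum)
open import Data.Bool using (Bool; true; false; if_then_else_; not; _∨_; _∧_)
import Data.Bool as Bool
open import Data.Bool.Properties using (∧-comm; ∧-zeroʳ; ∨-zeroʳ)
open import Data.List using (List; []; _∷_; length; map; upTo; foldr; applyUpTo)
open import Data.List.Properties using (length-applyUpTo; map-applyUpTo; ∷-injective)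
open import Data.List.Relation.Unary.All using (All; []; _∷_)
open import Data.List.Relation.Unary.Linked using (Linked; []; [-]; _∷_)
open import Data.Maybe using (just; nothing)
import Data.Vec
open import Data.Vec using (Vec; lookup; toList; transpose; tabulate; replicate; _⊛_)
open import Data.Vec.Properties using (toList-map; lookup-map; length-toList; lookup-⊛; lookup-replicate; lookup∘tabulate; tabulate∘lookup; tabulate-cong)
open import Data.Fin using (Fin; toℕ; fromℕ<) renaming (zero to fzero; suc to fsuc)
open import Data.Fin.Properties using (toℕ<n; toℕ-fromℕ<; toℕ-injective)
open import Data.Product using (Σ; _×_; _,_; proj₁; proj₂; ∃)
open import Data.Sum using (_⊎_; inj₁; inj₂)
open import Data.Empty using (⊥; ⊥-elim)
open import Data.Unit using (⊤; tt)
open import Relation.Nullary using (¬_; yes; no; Dec)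
open import Relation.Binary.Definitions using (tri<; tri≈; tri>)
open import Relation.Binary.PropositionalEquality

-- Partitions through their row lengths.  A list-partition is determined by
-- the function x ↦ λ ! x; most reasoning below is row by row.

t≢f : true ≢ false
t≢f ()

infixl 9 _!_
_!_ : Part → ℕ → ℕ
l ! x = rowLen l x

rowLen-ext : ∀ {a b} → All (0 <_) a → All (0 <_) b → (∀ x → a ! x ≡ b ! x) → a ≡ b
rowLen-ext [] [] h = refl
rowLen-ext [] (p ∷ pb) h = ⊥-elim (<⇒≢ p (h 0))
rowLen-ext (p ∷ pa) [] h = ⊥-elim (<⇒≢ p (sym (h 0)))
rowLen-ext {x ∷ xs} {y ∷ ys} (p ∷ pa) (q ∷ pb) h = cong₂ _∷_ (h 0) (rowLen-ext pa pb (λ z → h (suc z)))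

record Decreasing (l : Part) : Set where
  constructor mkDecr
  field decr : ∀ x → l ! suc x ≤ l ! x
open Decreasing public

linked→decr′ : ∀ {l} → Linked _≥_ l → ∀ x → l ! suc x ≤ l ! x
linked→decr′ [] x = z≤n
linked→decr′ [-] zero = z≤n
linked→decr′ [-] (suc x) = z≤n
linked→decr′ (p ∷ q) zero = p
linked→decr′ (p ∷ q) (suc x) = linked→decr′ q x

linked→decr : ∀ {l} → Linked _≥_ l → Decreasing l
linked→decr q = mkDecr (linked→decr′ q)

decr→linked : ∀ {l} → Decreasing l → Linked _≥_ l
decr→linked {[]} a = []
decr→linked {x ∷ []} a = [-]
decr→linked {x ∷ y ∷ l} a = decr a 0 ∷ decr→linked (mkDecr (λ z → decr a (suc z)))

raiseRow-here : ∀ r v l → raiseRow r v l ! r ≡ l ! r ⊔ v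
raiseRow-here zero v [] = refl
raiseRow-here zero v (x ∷ l) = refl
raiseRow-here (suc r) v [] = raiseRow-here r v []
raiseRow-here (suc r) v (x ∷ l) = raiseRow-here r v l

raiseRow-elsewhere : ∀ r v l x → x ≢ r → raiseRow r v l ! x ≡ l ! x
raiseRow-elsewhere zero v [] zero ne = ⊥-elim (ne refl)
raiseRow-elsewhere zero v [] (suc x) ne = refl
raiseRow-elsewhere zero v (y ∷ l) zero ne = ⊥-elim (ne refl)
raiseRow-elsewhere zero v (y ∷ l) (suc x) ne = refl
raiseRow-elsewhere (suc r) v [] zero ne = refl
raiseRow-elsewhere (suc r) v [] (suc x) ne = trans (raiseRow-elsewhere r v [] x (λ e → ne (cong suc e))) refl
raiseRow-elsewhere (suc r) v (y ∷ l) zero ne = refl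
raiseRow-elsewhere (suc r) v (y ∷ l) (suc x) ne = raiseRow-elsewhere r v l x (λ e → ne (cong suc e))

union-row : ∀ a b x → union a b ! x ≡ a ! x ⊔ b ! x
union-row [] b x = refl
union-row (y ∷ a) [] zero = sym (⊔-identityʳ y)
union-row (y ∷ a) [] (suc x) = sym (⊔-identityʳ _)
union-row (y ∷ a) (z ∷ b) zero = refl
union-row (y ∷ a) (z ∷ b) (suc x) = union-row a b x

row-positive : ∀ {l} → All (0 <_) l → ∀ x → x < length l → 0 < l ! x
row-positive (p ∷ ps) zero h = p
row-positive (p ∷ ps) (suc x) (s≤s h) = row-positive ps x h

row-beyond : ∀ l x → length l ≤ x → l ! x ≡ 0
row-beyond [] x h = refl
row-beyond (y ∷ l) (suc x) (s≤s h) = row-beyond l x h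

row-inside : ∀ l x → 0 < l ! x → x < length l
row-inside l x p with x <? length l
... | yes q = q
... | no q = ⊥-elim (<⇒≢ p (sym (row-beyond l x (≮⇒≥ q))))

raiseRow-positive : ∀ {l} r v → All (0 <_) l → 0 < v → r ≤ length l → All (0 <_) (raiseRow r v l)
raiseRow-positive {[]} zero v a p h = p ∷ []
raiseRow-positive {y ∷ l} zero v (q ∷ a) p h = <-≤-trans q (m≤m⊔n y v) ∷ a
raiseRow-positive {y ∷ l} (suc r) v (q ∷ a) p (s≤s h) = q ∷ raiseRow-positive r v a p h

union-positive : ∀ {a b} → All (0 <_) a → All (0 <_) b → All (0 <_) (union a b)
union-positive {[]} pa pb = pb
union-positive {x ∷ a} {[]} pa pb = pa
union-positive {x ∷ a} {y ∷ b} (p ∷ pa) (q ∷ pb) = <-≤-trans p (m≤m⊔n x y) ∷ union-positive pa pb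

-- Domino steps: a row-wise description of ν <_d κ, which Defs states in
-- terms of the cells of κ/ν.

record HStep (ν κ : Part) (r : ℕ) : Set where
  constructor mkH
  field
    hs1 : κ ! r ≡ ν ! r + 2
    hs2 : ∀ x → x ≢ r → κ ! x ≡ ν ! x

record VStep (ν κ : Part) (r : ℕ) : Set where
  constructor mkV
  field
    vs0 : ν ! suc r ≡ ν ! r
    vs1 : κ ! r ≡ suc (ν ! r)
    vs2 : κ ! suc r ≡ suc (ν ! r)
    vs3 : ∀ x → x ≢ r → x ≢ suc r → κ ! x ≡ ν ! x

Step : Part → Part → Set
Step ν κ = IsPartition ν × IsPartition κ × (Σ ℕ (HStep ν κ) ⊎ Σ ℕ (VStep ν κ))

row-unchanged : ∀ a b → a ≤ b → (∀ y → y < b → ¬ y < a → ⊥) → b ≡ a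
row-unchanged a b le h with a <? b
... | yes p = ⊥-elim (h a p (n≮n a))
... | no p = ≤-antisym (≮⇒≥ p) le

row-gains-one : ∀ a b c → a ≤ b → (∀ y → y < b → ¬ y < a → y ≡ c) → c < b → ¬ c < a → (a ≡ c) × (b ≡ suc c)
row-gains-one a b c le h cb ca = ac , bc
  where
  ac : a ≡ c
  ac with a <? c
  ... | yes p = h a (<-≤-trans p (<⇒≤ cb)) (n≮n a)
  ... | no p = ≤-antisym (≮⇒≥ ca) (≮⇒≥ p)
  bc : b ≡ suc c
  bc with suc c <? b
  ... | yes p = ⊥-elim (1+n≢n (h (suc c) p (λ q → ca (<-trans (n<1+n c) q))))
  ... | no p = ≤-antisym (≮⇒≥ p) cb

row-gains-two : ∀ a b c → a ≤ b → (∀ y → y < b → ¬ y < a → (y ≡ c ⊎ y ≡ suc c)) → suc c < b → ¬ c < a → (a ≡ c) × (b ≡ suc (suc c))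
row-gains-two a b c le h cb ca = ac , bc
  where
  ac : a ≡ c
  ac with a <? c
  ... | yes p with h a (<-trans p (<-trans (n<1+n c) cb)) (n≮n a)
  ... | inj₁ e = e
  ... | inj₂ e = ⊥-elim (<-asym (subst (_< c) e p) (n<1+n c))
  ac | no p = ≤-antisym (≮⇒≥ ca) (≮⇒≥ p)
  bc : b ≡ suc (suc c)
  bc with suc (suc c) <? b
  ... | yes p with h (suc (suc c)) p (λ q → ca (<-trans (<-trans (n<1+n c) (n<1+n (suc c))) q))
  ... | inj₁ e = ⊥-elim (<⇒≢ (<-trans (n<1+n c) (n<1+n (suc c))) (sym e))
  ... | inj₂ e = ⊥-elim (1+n≢n e)
  bc | no p = ≤-antisym (≮⇒≥ p) cb

⊆⇒rows-≤ : ∀ {ν κ} → ν ⊆ κ → ∀ x → ν ! x ≤ κ ! x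
⊆⇒rows-≤ {ν} {κ} sub x with ν ! x ≤? κ ! x
... | yes p = p
... | no p = ⊥-elim (n≮n (κ ! x) (sub x (κ ! x) (≰⇒> p)))

skew⇒HStep : ∀ {ν κ r c} → ν ⊆ κ → SkewIsPair ν κ r c r (suc c) → HStep ν κ r
skew⇒HStep {ν} {κ} {r} {c} sub sk = mkH hr oth
  where
  le : ∀ x → ν ! x ≤ κ ! x
  le = ⊆⇒rows-≤ {ν} {κ} sub
  rr : (ν ! r ≡ c) × (κ ! r ≡ suc (suc c))
  rr = row-gains-two (ν ! r) (κ ! r) c (le r)
        (λ y yb ya → f y (proj₁ (sk r y) (yb , ya)))
        (proj₁ (proj₂ (sk r (suc c)) (inj₂ (refl , refl))))
        (proj₂ (proj₂ (sk r c) (inj₁ (refl , refl))))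
    where
    f : ∀ y → (r ≡ r × y ≡ c) ⊎ (r ≡ r × y ≡ suc c) → y ≡ c ⊎ y ≡ suc c
    f y (inj₁ (_ , e)) = inj₁ e
    f y (inj₂ (_ , e)) = inj₂ e
  hr : κ ! r ≡ ν ! r + 2
  hr = trans (proj₂ rr) (trans (cong (λ z → suc (suc z)) (sym (proj₁ rr))) (+-comm 2 (ν ! r)))
  oth : ∀ x → x ≢ r → κ ! x ≡ ν ! x
  oth x ne = row-unchanged (ν ! x) (κ ! x) (le x) (λ y yb ya → g y (proj₁ (sk x y) (yb , ya)))
    where
    g : ∀ y → (x ≡ r × y ≡ c) ⊎ (x ≡ r × y ≡ suc c) → ⊥
    g y (inj₁ (e , _)) = ne e
    g y (inj₂ (e , _)) = ne e

skew⇒VStep : ∀ {ν κ r c} → ν ⊆ κ → SkewIsPair ν κ r c (suc r) c → VStep ν κ r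
skew⇒VStep {ν} {κ} {r} {c} sub sk = mkV e1 e2 e3 oth
  where
  le : ∀ x → ν ! x ≤ κ ! x
  le = ⊆⇒rows-≤ {ν} {κ} sub
  f0 : ∀ y → (r ≡ r × y ≡ c) ⊎ (r ≡ suc r × y ≡ c) → y ≡ c
  f0 y (inj₁ (_ , e)) = e
  f0 y (inj₂ (e , _)) = ⊥-elim (1+n≢n (sym e))
  f1 : ∀ y → (suc r ≡ r × y ≡ c) ⊎ (suc r ≡ suc r × y ≡ c) → y ≡ c
  f1 y (inj₁ (e , _)) = ⊥-elim (1+n≢n e)
  f1 y (inj₂ (_ , e)) = e
  rr : (ν ! r ≡ c) × (κ ! r ≡ suc c)
  rr = row-gains-one (ν ! r) (κ ! r) c (le r) (λ y yb ya → f0 y (proj₁ (sk r y) (yb , ya)))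
        (proj₁ (proj₂ (sk r c) (inj₁ (refl , refl)))) (proj₂ (proj₂ (sk r c) (inj₁ (refl , refl))))
  rs : (ν ! suc r ≡ c) × (κ ! suc r ≡ suc c)
  rs = row-gains-one (ν ! suc r) (κ ! suc r) c (le (suc r)) (λ y yb ya → f1 y (proj₁ (sk (suc r) y) (yb , ya)))
        (proj₁ (proj₂ (sk (suc r) c) (inj₂ (refl , refl)))) (proj₂ (proj₂ (sk (suc r) c) (inj₂ (refl , refl))))
  e1 : ν ! suc r ≡ ν ! r
  e1 = trans (proj₁ rs) (sym (proj₁ rr))
  e2 : κ ! r ≡ suc (ν ! r)
  e2 = trans (proj₂ rr) (cong suc (sym (proj₁ rr)))
  e3 : κ ! suc r ≡ suc (ν ! r)
  e3 = trans (proj₂ rs) (cong suc (sym (proj₁ rr)))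
  oth : ∀ x → x ≢ r → x ≢ suc r → κ ! x ≡ ν ! x
  oth x n1 n2 = row-unchanged (ν ! x) (κ ! x) (le x) (λ y yb ya → g y (proj₁ (sk x y) (yb , ya)))
    where
    g : ∀ y → (x ≡ r × y ≡ c) ⊎ (x ≡ suc r × y ≡ c) → ⊥
    g y (inj₁ (e , _)) = n1 e
    g y (inj₂ (e , _)) = n2 e

<d⇒Step : ∀ {ν κ} → ν <d κ → Step ν κ
<d⇒Step (pν , pκ , sub , r , c , inj₁ sk) = pν , pκ , inj₁ (r , skew⇒HStep sub sk)
<d⇒Step (pν , pκ , sub , r , c , inj₂ sk) = pν , pκ , inj₂ (r , skew⇒VStep sub sk)

HStep⇒skew : ∀ {ν κ r} → HStep ν κ r → ν ⊆ κ × SkewIsPair ν κ r (ν ! r) r (suc (ν ! r))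
HStep⇒skew {ν} {κ} {r} (mkH hr oth) = sub , sk
  where
  sub : ν ⊆ κ
  sub x y h with x ≟ r
  ... | yes refl = <-≤-trans h (subst (ν ! r ≤_) (sym hr) (m≤m+n (ν ! r) 2))
  ... | no ne = subst (y <_) (sym (oth x ne)) h
  sk : SkewIsPair ν κ r (ν ! r) r (suc (ν ! r))
  sk x y = outside , inside
    where
    outside : InDiag κ x y × ¬ InDiag ν x y → (x ≡ r × y ≡ ν ! r) ⊎ (x ≡ r × y ≡ suc (ν ! r))
    outside (a , b) with x ≟ r
    ... | no ne = ⊥-elim (b (subst (y <_) (oth x ne) a))
    ... | yes refl with y ≟ ν ! r
    ... | yes e = inj₁ (refl , e)
    ... | no ne2 = inj₂ (refl , ≤-antisym (≤-pred (subst (suc y ≤_) (trans hr (+-comm (ν ! r) 2)) a)) (≤∧≢⇒< (≮⇒≥ b) (λ e → ne2 (sym e))))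
    inside : (x ≡ r × y ≡ ν ! r) ⊎ (x ≡ r × y ≡ suc (ν ! r)) → InDiag κ x y × ¬ InDiag ν x y
    inside (inj₁ (refl , refl)) = subst (ν ! r <_) (sym (trans hr (+-comm (ν ! r) 2))) (m≤n⇒m≤1+n (n<1+n _)) , n≮n _
    inside (inj₂ (refl , refl)) = subst (suc (ν ! r) <_) (sym (trans hr (+-comm (ν ! r) 2))) (n<1+n _) , (λ q → n≮n _ (<-trans (n<1+n _) q))

VStep⇒skew : ∀ {ν κ r} → VStep ν κ r → ν ⊆ κ × SkewIsPair ν κ r (ν ! r) (suc r) (ν ! r)
VStep⇒skew {ν} {κ} {r} (mkV e1 e2 e3 oth) = sub , sk
  where
  sub : ν ⊆ κ
  sub x y h with x ≟ r | x ≟ suc r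
  ... | yes refl | _ = <-trans h (subst (ν ! r <_) (sym e2) (n<1+n _))
  ... | no _ | yes refl = <-trans h (subst (ν ! suc r <_) (sym (trans e3 (cong suc (sym e1)))) (n<1+n _))
  ... | no n1 | no n2 = subst (y <_) (sym (oth x n1 n2)) h
  sk : SkewIsPair ν κ r (ν ! r) (suc r) (ν ! r)
  sk x y = outside , inside
    where
    outside : InDiag κ x y × ¬ InDiag ν x y → (x ≡ r × y ≡ ν ! r) ⊎ (x ≡ suc r × y ≡ ν ! r)
    outside (a , b) with x ≟ r | x ≟ suc r
    ... | yes refl | _ = inj₁ (refl , ≤-antisym (≤-pred (subst (suc y ≤_) e2 a)) (≮⇒≥ b))
    ... | no _ | yes refl = inj₂ (refl , ≤-antisym (≤-pred (subst (suc y ≤_) e3 a)) (subst (_≤ y) e1 (≮⇒≥ b)))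
    ... | no n1 | no n2 = ⊥-elim (b (subst (y <_) (oth x n1 n2) a))
    inside : (x ≡ r × y ≡ ν ! r) ⊎ (x ≡ suc r × y ≡ ν ! r) → InDiag κ x y × ¬ InDiag ν x y
    inside (inj₁ (refl , refl)) = subst (ν ! r <_) (sym e2) (n<1+n _) , n≮n _
    inside (inj₂ (refl , refl)) = subst (ν ! r <_) (sym e3) (n<1+n _) , (λ q → n≮n _ (subst (ν ! r <_) e1 q))

Step⇒<d : ∀ {ν κ} → Step ν κ → ν <d κ
Step⇒<d {ν} (pν , pκ , inj₁ (r , h)) = pν , pκ , proj₁ (HStep⇒skew h) , r , ν ! r , inj₁ (proj₂ (HStep⇒skew h))
Step⇒<d {ν} (pν , pκ , inj₂ (r , v)) = pν , pκ , proj₁ (VStep⇒skew v) , r , ν ! r , inj₂ (proj₂ (VStep⇒skew v))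

decr-antitone : ∀ {l} → Decreasing l → ∀ {x y} → x ≤ y → l ! y ≤ l ! x
decr-antitone {l} a {x} {y} le with m≤n⇒∃[o]m+o≡n le
... | o , refl = go x o
  where
  go : ∀ x o → l ! (x + o) ≤ l ! x
  go x zero = ≤-reflexive (cong (l !_) (+-identityʳ x))
  go x (suc o) = ≤-trans (≤-reflexive (cong (l !_) (+-suc x o))) (≤-trans (decr a (x + o)) (go x o))

n≢1+n : ∀ n → n ≢ suc n
n≢1+n n e = 1+n≢n (sym e)

n≢2+n : ∀ n → n ≢ suc (suc n)
n≢2+n n e = <⇒≢ (<-trans (n<1+n n) (n<1+n (suc n))) e

HStep-decr : ∀ {κ λ' r} → Decreasing κ → HStep κ λ' r → (∀ r' → r ≡ suc r' → λ' ! r ≤ κ ! r') → Decreasing λ'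
HStep-decr {κ} {λ'} {r} a (mkH h1 h2) c = mkDecr f
  where
  f : ∀ x → λ' ! suc x ≤ λ' ! x
  f x with suc x ≟ r | x ≟ r
  ... | yes refl | _ = ≤-trans (c x refl) (≤-reflexive (sym (h2 x (λ e → 1+n≢n (sym e)))))
  ... | no _ | yes refl = ≤-trans (≤-reflexive (h2 (suc x) (λ e → 1+n≢n e))) (≤-trans (decr a x) (≤-trans (m≤m+n _ 2) (≤-reflexive (sym h1))))
  ... | no n1 | no n2 = ≤-trans (≤-reflexive (h2 (suc x) n1)) (≤-trans (decr a x) (≤-reflexive (sym (h2 x n2))))

VStep-decr : ∀ {κ λ' r} → Decreasing κ → VStep κ λ' r → (∀ r' → r ≡ suc r' → λ' ! r ≤ κ ! r') → Decreasing λ'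
VStep-decr {κ} {λ'} {r} a (mkV h0 h1 h2 h3) c = mkDecr f
  where
  f : ∀ x → λ' ! suc x ≤ λ' ! x
  f x with suc x ≟ r | x ≟ r | x ≟ suc r
  ... | yes refl | _ | _ = ≤-trans (c x refl) (≤-reflexive (sym (h3 x (n≢1+n x) (n≢2+n x))))
  ... | no _ | yes refl | _ = ≤-reflexive (trans h2 (sym h1))
  ... | no _ | no _ | yes refl = ≤-trans (≤-reflexive (h3 (suc (suc r)) (λ e → n≢2+n r (sym e)) (λ e → n≢1+n (suc r) (sym e)))) (≤-trans (decr a (suc r)) (≤-trans (≤-reflexive h0) (≤-trans (n≤1+n _) (≤-reflexive (sym h2)))))
  ... | no n1 | no n2 | no n3 = ≤-trans (≤-reflexive (h3 (suc x) n1 (λ e → n2 (suc-injective e)))) (≤-trans (decr a x) (≤-reflexive (sym (h3 x n2 n3))))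

raiseRow-positive′ : ∀ {l} r v → All (0 <_) l → 0 < v → (∀ r' → r ≡ suc r' → 0 < l ! r') → All (0 <_) (raiseRow r v l)
raiseRow-positive′ zero v a p h = raiseRow-positive zero v a p z≤n
raiseRow-positive′ {l} (suc r) v a p h = raiseRow-positive (suc r) v a p (row-inside l r (h r refl))

colHeight-spec : ∀ c l → Linked _≥_ l → (∀ y → y < colHeight c l → c < l ! y) × (l ! colHeight c l ≤ c)
colHeight-spec c [] lk = (λ y ()) , z≤n
colHeight-spec c (x ∷ l) lk = aux (suc c ≤ᵇ x) refl
  where
  aux : (b : Bool) → (suc c ≤ᵇ x) ≡ b → (∀ y → y < colHeight c (x ∷ l) → c < (x ∷ l) ! y) × ((x ∷ l) ! colHeight c (x ∷ l) ≤ c)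
  aux true eq = (λ y q → f y (subst (y <_) hs q)) , subst (λ z → (x ∷ l) ! z ≤ c) (sym hs) (proj₂ (colHeight-spec c l (tl lk)))
    where
    tl : ∀ {x l} → Linked _≥_ (x ∷ l) → Linked _≥_ l
    tl [-] = []
    tl (_ ∷ q) = q
    hs : colHeight c (x ∷ l) ≡ suc (colHeight c l)
    hs = cong (λ b → (if b then 1 else 0) + colHeight c l) eq
    f : ∀ y → y < suc (colHeight c l) → c < (x ∷ l) ! y
    f zero _ = ≤ᵇ⇒≤ (suc c) x (subst Bool.T (sym eq) tt)
    f (suc y) (s≤s q) = proj₁ (colHeight-spec c l (tl lk)) y q
  aux false eq = (λ y q → ⊥-elim (n≮0 (subst (y <_) zh q))) , subst (λ z → (x ∷ l) ! z ≤ c) (sym zh) xc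
    where
    xc : x ≤ c
    xc with x ≤? c
    ... | yes q = q
    ... | no q = ⊥-elim (subst Bool.T eq (≤⇒≤ᵇ (≰⇒> q)))
    allle : ∀ {l} → Linked _≥_ (x ∷ l) → colHeight c l ≡ 0
    allle {[]} _ = refl
    allle {y ∷ l} (q ∷ lk) with suc c ≤ᵇ y in eq2
    ... | true = ⊥-elim (<⇒≱ (≤ᵇ⇒≤ (suc c) y (subst Bool.T (sym eq2) tt)) (≤-trans q xc))
    ... | false = allle {l} (lk' q lk)
      where
      lk' : x ≥ y → Linked _≥_ (y ∷ l) → Linked _≥_ (x ∷ l)
      lk' q [-] = [-]
      lk' q (q2 ∷ r) = ≤-trans q2 q ∷ r
    zh : colHeight c (x ∷ l) ≡ 0
    zh = trans (cong (λ b → (if b then 1 else 0) + colHeight c l) eq) (allle lk)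

colHeight-unique : ∀ c l h → Decreasing l → (∀ y → y < h → c < l ! y) → l ! h ≤ c → h ≡ colHeight c l
colHeight-unique c l h a p q with colHeight-spec c l (decr→linked a)
... | p' , q' with <-cmp h (colHeight c l)
... | tri< lt _ _ = ⊥-elim (<⇒≱ (p' h lt) q)
... | tri≈ _ e _ = e
... | tri> _ _ gt = ⊥-elim (<⇒≱ (p _ gt) q')

fw-just : ∀ (p : ℕ → Bool) (f : ℕ → ℕ) N r → r < N → p (f r) ≡ true → (∀ y → y < r → p (f y) ≡ false)
        → firstWhere p (applyUpTo f N) ≡ just (f r)
fw-just p f (suc N) zero lt pr py with p (f 0) in eq
... | true = refl
... | false = ⊥-elim (t≢f (sym pr))
fw-just p f (suc N) (suc r) (s≤s lt) pr py with p (f 0) in eq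
... | true = ⊥-elim (t≢f (trans (sym eq) (py 0 z<s)))
... | false = fw-just p (λ z → f (suc z)) N r lt pr (λ y q → py (suc y) (s≤s q))

fw-nothing : ∀ (p : ℕ → Bool) (f : ℕ → ℕ) N → (∀ y → y < N → p (f y) ≡ false) → firstWhere p (applyUpTo f N) ≡ nothing
fw-nothing p f zero h = refl
fw-nothing p f (suc N) h with p (f 0) in eq
... | true = ⊥-elim (t≢f (trans (sym eq) (h 0 z<s)))
... | false = fw-nothing p (λ z → f (suc z)) N (λ y q → h (suc y) (s≤s q))

fw-just-inv : ∀ (p : ℕ → Bool) (f : ℕ → ℕ) N r → firstWhere p (applyUpTo f N) ≡ just r
            → Σ ℕ λ i → (r ≡ f i) × (i < N) × (p (f i) ≡ true) × (∀ y → y < i → p (f y) ≡ false)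
fw-just-inv p f (suc N) r h with p (f 0) in eq
fw-just-inv p f (suc N) r refl | true = 0 , refl , z<s , eq , (λ y ())
... | false with fw-just-inv p (λ z → f (suc z)) N r h
... | i , e1 , e2 , e3 , e4 = suc i , e1 , s≤s e2 , e3 , λ { zero _ → eq ; (suc y) (s≤s q) → e4 y q }

fw-nothing-inv : ∀ (p : ℕ → Bool) (f : ℕ → ℕ) N → firstWhere p (applyUpTo f N) ≡ nothing → ∀ y → y < N → p (f y) ≡ false
fw-nothing-inv p f (suc N) h y lt with p (f 0) in eq
fw-nothing-inv p f (suc N) () y lt | true
fw-nothing-inv p f (suc N) h zero lt | false = eq
fw-nothing-inv p f (suc N) h (suc y) (s≤s lt) | false = fw-nothing-inv p (λ z → f (suc z)) N h y lt

fw-cong : ∀ (p q : ℕ → Bool) xs → (∀ x → p x ≡ q x) → firstWhere p xs ≡ firstWhere q xs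
fw-cong p q [] h = refl
fw-cong p q (x ∷ xs) h rewrite h x with q x
... | true = refl
... | false = fw-cong p q xs h

fromFun : (ℕ → ℕ) → ℕ → Part
fromFun f zero = []
fromFun f (suc n) = if f 0 ≡ᵇ 0 then [] else f 0 ∷ fromFun (λ z → f (suc z)) n

fromFun-spec : ∀ f n → (∀ x → f (suc x) ≤ f x) → (∀ x → n ≤ x → f x ≡ 0)
             → (∀ x → fromFun f n ! x ≡ f x) × All (0 <_) (fromFun f n)
fromFun-spec f zero a z = (λ x → sym (z x z≤n)) , []
fromFun-spec f (suc n) a z with f 0 in eq
... | zero = (λ x → sym (allz x)) , []
  where
  allz : ∀ x → f x ≡ 0
  allz zero = eq
  allz (suc x) = n≤0⇒n≡0 (subst (f (suc x) ≤_) (allz x) (a x))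
... | suc k with fromFun-spec (λ w → f (suc w)) n (λ x → a (suc x)) (λ x q → z (suc x) (s≤s q))
... | h1 , h2 = (λ { zero → sym eq ; (suc x) → h1 x }) , (s≤s z≤n ∷ h2)

fromFun-part : ∀ f n → (∀ x → f (suc x) ≤ f x) → (∀ x → n ≤ x → f x ≡ 0) → IsPartition (fromFun f n)
fromFun-part f n a z = proj₂ (fromFun-spec f n a z) , decr→linked (mkDecr (λ x → subst₂ _≤_ (sym (proj₁ (fromFun-spec f n a z) (suc x))) (sym (proj₁ (fromFun-spec f n a z) x)) (a x)))

union-comm : ∀ a b → union a b ≡ union b a
union-comm [] [] = refl
union-comm [] (x ∷ b) = refl
union-comm (x ∷ a) [] = refl
union-comm (x ∷ a) (y ∷ b) = cong₂ _∷_ (⊔-comm x y) (union-comm a b)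

sharedRow-comm : ∀ ν κ ρ → sharedRow ν κ ρ ≡ sharedRow ν ρ κ
sharedRow-comm ν κ ρ = trans (cong (firstWhere (λ r → (rowLen ν r <ᵇ rowLen κ r) ∧ (rowLen ν r <ᵇ rowLen ρ r))) (cong upTo (⊔-comm (length κ) (length ρ))))
  (fw-cong _ _ (upTo (length ρ ⊔ length κ)) (λ r → ∧-comm (rowLen ν r <ᵇ rowLen κ r) (rowLen ν r <ᵇ rowLen ρ r)))

localZero-comm : ∀ ν κ ρ → localZero ν κ ρ ≡ localZero ν ρ κ
localZero-comm ν κ ρ with ν ≟P κ | ν ≟P ρ | κ ≟P ρ | ρ ≟P κ
... | yes refl | yes refl | _ | _ = refl
... | yes refl | no _ | _ | _ = refl
... | no _ | yes refl | _ | _ = refl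
... | no _ | no _ | yes refl | yes _ = refl
... | no _ | no _ | yes refl | no q = ⊥-elim (q refl)
... | no _ | no _ | no q | yes refl = ⊥-elim (q refl)
... | no _ | no _ | no _ | no _ = trans (cong (unionPlus ν κ ρ) (sharedRow-comm ν κ ρ)) (up-comm (sharedRow ν ρ κ))
  where
  up-comm : ∀ s → unionPlus ν κ ρ s ≡ unionPlus ν ρ κ s
  up-comm nothing = union-comm κ ρ
  up-comm (just p) = cong (addCell _ _) (union-comm κ ρ)

partition-decr : ∀ {l} → IsPartition l → Decreasing l
partition-decr p = linked→decr (proj₂ p)

HStep-le : ∀ {a b r} → HStep a b r → ∀ x → a ! x ≤ b ! x
HStep-le {a} {b} {r} (mkH h1 h2) x with x ≟ r
... | yes refl = ≤-trans (m≤m+n _ 2) (≤-reflexive (sym h1))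
... | no ne = ≤-reflexive (sym (h2 x ne))

VStep-le : ∀ {a b r} → VStep a b r → ∀ x → a ! x ≤ b ! x
VStep-le {a} {b} {r} (mkV h0 h1 h2 h3) x with x ≟ r | x ≟ suc r
... | yes refl | _ = ≤-trans (n≤1+n _) (≤-reflexive (sym h1))
... | no _ | yes refl = ≤-trans (≤-reflexive h0) (≤-trans (n≤1+n _) (≤-reflexive (sym h2)))
... | no n1 | no n2 = ≤-reflexive (sym (h3 x n1 n2))

Step-le : ∀ {a b} → Step a b → ∀ x → a ! x ≤ b ! x
Step-le (_ , _ , inj₁ (r , h)) = HStep-le h
Step-le (_ , _ , inj₂ (r , h)) = VStep-le h

HStep-ne : ∀ {a b r} → HStep a b r → a ≢ b
HStep-ne {a} {r = r} (mkH h1 _) refl = <⇒≢ (m<m+n (a ! r) {2} z<s) h1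

VStep-ne : ∀ {a b r} → VStep a b r → a ≢ b
VStep-ne {a} {r = r} (mkV _ h1 _ _) refl = 1+n≢n (sym h1)

Step-ne : ∀ {a b} → Step a b → a ≢ b
Step-ne (_ , _ , inj₁ (r , h)) = HStep-ne h
Step-ne (_ , _ , inj₂ (r , h)) = VStep-ne h

HStep-transfer : ∀ {a b c d r} → HStep a b r → (∀ x → a ! x < b ! x → (c ! x ≡ a ! x) × (d ! x ≡ b ! x))
        → (∀ x → ¬ (a ! x < b ! x) → d ! x ≡ c ! x) → HStep c d r
HStep-transfer {a} {b} {c} {d} {r} (mkH h1 h2) p q = mkH e1 e2
  where
  lt : a ! r < b ! r
  lt = subst (a ! r <_) (sym h1) (m<m+n (a ! r) {2} z<s)
  e1 : d ! r ≡ c ! r + 2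
  e1 = trans (proj₂ (p r lt)) (trans h1 (cong (_+ 2) (sym (proj₁ (p r lt)))))
  e2 : ∀ x → x ≢ r → d ! x ≡ c ! x
  e2 x ne = q x (λ l → <⇒≢ l (sym (h2 x ne)))

VStep-transfer : ∀ {a b c d r} → VStep a b r → (∀ x → a ! x < b ! x → (c ! x ≡ a ! x) × (d ! x ≡ b ! x))
        → (∀ x → ¬ (a ! x < b ! x) → d ! x ≡ c ! x) → VStep c d r
VStep-transfer {a} {b} {c} {d} {r} (mkV h0 h1 h2 h3) p q = mkV e0 e1 e2 e3
  where
  lt0 : a ! r < b ! r
  lt0 = subst (a ! r <_) (sym h1) (n<1+n _)
  lt1 : a ! suc r < b ! suc r
  lt1 = subst₂ _<_ (sym h0) (sym h2) (n<1+n _)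
  e0 : c ! suc r ≡ c ! r
  e0 = trans (proj₁ (p (suc r) lt1)) (trans h0 (sym (proj₁ (p r lt0))))
  e1 : d ! r ≡ suc (c ! r)
  e1 = trans (proj₂ (p r lt0)) (trans h1 (cong suc (sym (proj₁ (p r lt0)))))
  e2 : d ! suc r ≡ suc (c ! r)
  e2 = trans (proj₂ (p (suc r) lt1)) (trans h2 (cong suc (sym (proj₁ (p r lt0)))))
  e3 : ∀ x → x ≢ r → x ≢ suc r → d ! x ≡ c ! x
  e3 x n1 n2 = q x (λ l → <⇒≢ l (sym (h3 x n1 n2)))

Step-transfer : ∀ {a b c d} → Step a b → IsPartition c → IsPartition d → (∀ x → a ! x < b ! x → (c ! x ≡ a ! x) × (d ! x ≡ b ! x))
        → (∀ x → ¬ (a ! x < b ! x) → d ! x ≡ c ! x) → Step c d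
Step-transfer (_ , _ , inj₁ (r , h)) pc pd p q = pc , pd , inj₁ (r , HStep-transfer h p q)
Step-transfer (_ , _ , inj₂ (r , h)) pc pd p q = pc , pd , inj₂ (r , VStep-transfer h p q)

HStep-rows : ∀ {a b r} → HStep a b r → ∀ x → a ! x < b ! x → x ≡ r
HStep-rows {r = r} (mkH h1 h2) x l with x ≟ r
... | yes e = e
... | no ne = ⊥-elim (<⇒≢ l (sym (h2 x ne)))

VStep-rows : ∀ {a b r} → VStep a b r → ∀ x → a ! x < b ! x → x ≡ r ⊎ x ≡ suc r
VStep-rows {r = r} (mkV h0 h1 h2 h3) x l with x ≟ r | x ≟ suc r
... | yes e | _ = inj₁ e
... | no _ | yes e = inj₂ e
... | no n1 | no n2 = ⊥-elim (<⇒≢ l (sym (h3 x n1 n2)))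

union-part : ∀ {a b} → IsPartition a → IsPartition b → IsPartition (union a b)
union-part {a} {b} pa pb = union-positive (proj₁ pa) (proj₁ pb) , decr→linked anU
  where
  anU : Decreasing (union a b)
  anU = mkDecr λ x → subst₂ _≤_ (sym (union-row a b (suc x))) (sym (union-row a b x)) (⊔-mono-≤ (Decreasing.decr (partition-decr pa) x) (Decreasing.decr (partition-decr pb) x))

partition-ext : ∀ {a b} → IsPartition a → IsPartition b → (∀ x → a ! x ≡ b ! x) → a ≡ b
partition-ext pa pb = rowLen-ext (proj₁ pa) (proj₁ pb)

addH-spec : ∀ κ r → IsPartition κ → (∀ r' → r ≡ suc r' → κ ! r + 2 ≤ κ ! r') → Step κ (addH r κ) × HStep κ (addH r κ) r
addH-spec κ r pκ c = (pκ , pλ , inj₁ (r , hs)) , hs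
  where
  e1 : addH r κ ! r ≡ κ ! r + 2
  e1 = trans (raiseRow-here r (κ ! r + 2) κ) (m≤n⇒m⊔n≡n (m≤m+n _ 2))
  hs : HStep κ (addH r κ) r
  hs = mkH e1 (λ x ne → raiseRow-elsewhere r _ κ x ne)
  pλ : IsPartition (addH r κ)
  pλ = raiseRow-positive′ r _ (proj₁ pκ) (≤-trans (s≤s z≤n) (m≤n+m 2 (κ ! r)))
         (λ r' e → <-≤-trans (≤-trans (s≤s z≤n) (m≤n+m 2 (κ ! r))) (c r' e))
       , decr→linked (HStep-decr (partition-decr pκ) hs (λ r' e → ≤-trans (≤-reflexive e1) (c r' e)))

addV-spec : ∀ κ c → IsPartition κ → κ ! colHeight c κ ≡ c → κ ! suc (colHeight c κ) ≡ c
          → Step κ (addV c κ) × VStep κ (addV c κ) (colHeight c κ)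
addV-spec κ c pκ e0 e1 = (pκ , pλ , inj₂ (h , vs)) , vs
  where
  h = colHeight c κ
  sp = colHeight-spec c κ (proj₂ pκ)
  μ1 = addCell h c κ
  m1h : μ1 ! h ≡ suc c
  m1h = trans (raiseRow-here h (suc c) κ) (trans (cong (_⊔ suc c) e0) (m≤n⇒m⊔n≡n (n≤1+n c)))
  lh : addV c κ ! h ≡ suc (κ ! h)
  lh = trans (raiseRow-elsewhere (suc h) (suc c) μ1 h (n≢1+n h)) (trans m1h (cong suc (sym e0)))
  lh1 : addV c κ ! suc h ≡ suc (κ ! h)
  lh1 = trans (raiseRow-here (suc h) (suc c) μ1) (trans (cong (_⊔ suc c) (trans (raiseRow-elsewhere h (suc c) κ (suc h) (1+n≢n)) e1)) (trans (m≤n⇒m⊔n≡n (n≤1+n c)) (cong suc (sym e0))))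
  vs : VStep κ (addV c κ) h
  vs = mkV (trans e1 (sym e0)) lh lh1 (λ x n1 n2 → trans (raiseRow-elsewhere (suc h) (suc c) μ1 x n2) (raiseRow-elsewhere h (suc c) κ x n1))
  pλ : IsPartition (addV c κ)
  pλ = raiseRow-positive′ (suc h) (suc c) (raiseRow-positive′ h (suc c) (proj₁ pκ) (s≤s z≤n) (λ r' e → ≤-trans (s≤s z≤n) (proj₁ sp r' (subst (r' <_) (sym e) (n<1+n r')))))
         (s≤s z≤n) (λ r' e → subst (λ z → 0 < μ1 ! z) (suc-injective e) (subst (0 <_) (sym m1h) (s≤s z≤n)))
       , decr→linked (VStep-decr (partition-decr pκ) vs (λ r' e → ≤-trans (≤-reflexive (trans lh (cong suc e0))) (proj₁ sp r' (subst (r' <_) (sym e) (n<1+n r')))))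

+2≡suc-suc : ∀ n → n + 2 ≡ suc (suc n)
+2≡suc-suc n = +-comm n 2

≡ᵇ-true : ∀ m n → m ≡ n → (m ≡ᵇ n) ≡ true
≡ᵇ-true zero zero _ = refl
≡ᵇ-true (suc m) (suc n) e = ≡ᵇ-true m n (suc-injective e)
≡ᵇ-true zero (suc n) ()
≡ᵇ-true (suc m) zero ()

≡ᵇ-false : ∀ m n → m ≢ n → (m ≡ᵇ n) ≡ false
≡ᵇ-false zero zero ne = ⊥-elim (ne refl)
≡ᵇ-false zero (suc n) ne = refl
≡ᵇ-false (suc m) zero ne = refl
≡ᵇ-false (suc m) (suc n) ne = ≡ᵇ-false m n (λ e → ne (cong suc e))

<ᵇ-true : ∀ m n → m < n → (m <ᵇ n) ≡ true
<ᵇ-true zero (suc n) _ = refl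
<ᵇ-true (suc m) (suc n) (s≤s l) = <ᵇ-true m n l

<ᵇ-false : ∀ m n → ¬ m < n → (m <ᵇ n) ≡ false
<ᵇ-false m zero _ = refl
<ᵇ-false zero (suc n) h = ⊥-elim (h z<s)
<ᵇ-false (suc m) (suc n) h = <ᵇ-false m n (λ l → h (s≤s l))

<ᵇ-sound : ∀ m n → (m <ᵇ n) ≡ true → m < n
<ᵇ-sound zero (suc n) _ = z<s
<ᵇ-sound (suc m) (suc n) e = s≤s (<ᵇ-sound m n e)
<ᵇ-sound m zero ()

∧-true : ∀ a b → (a ∧ b) ≡ true → (a ≡ true) × (b ≡ true)
∧-true true true _ = refl , refl
∧-true false b ()
∧-true true false ()

∧-false : ∀ a b → (a ∧ b) ≡ false → (a ≡ false) ⊎ (b ≡ false)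
∧-false false b _ = inj₁ refl
∧-false true b e = inj₂ e

firstDiff-lem : ∀ ν κ a → firstWhere (λ r → not (rowLen ν r ≡ᵇ rowLen κ r)) (upTo (length ν ⊔ length κ)) ≡ just a → firstDiff ν κ ≡ a
firstDiff-lem ν κ a e with firstWhere (λ r → not (rowLen ν r ≡ᵇ rowLen κ r)) (upTo (length ν ⊔ length κ))
firstDiff-lem ν κ a refl | just r = refl

firstDiff-at : ∀ ν κ a → 0 < κ ! a → ν ! a ≢ κ ! a → (∀ y → y < a → ν ! y ≡ κ ! y) → firstDiff ν κ ≡ a
firstDiff-at ν κ a pos ne eqs = firstDiff-lem ν κ a
  (fw-just _ (λ z → z) (length ν ⊔ length κ) a
     (<-≤-trans (row-inside κ a pos) (m≤n⊔m (length ν) (length κ)))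
     (cong not (≡ᵇ-false _ _ ne))
     (λ y l → cong not (≡ᵇ-true _ _ (eqs y l))))

HStep-first : ∀ {a b r} → HStep a b r → ∀ y → y < r → a ! y ≡ b ! y
HStep-first (mkH _ h2) y l = sym (h2 y (<⇒≢ l))

VStep-first : ∀ {a b r} → VStep a b r → ∀ y → y < r → a ! y ≡ b ! y
VStep-first (mkV _ _ _ h3) y l = sym (h3 y (<⇒≢ l) (<⇒≢ (m<n⇒m<1+n l)))

sameRule-horizontal : ∀ ν κ a → HStep ν κ a → sameRule ν κ ≡ addH (suc a) κ
sameRule-horizontal ν κ a h with firstDiff-at ν κ a (subst (0 <_) (sym (HStep.hs1 h)) (subst (0 <_) (sym (+2≡suc-suc _)) z<s)) (λ e → <⇒≢ (m<m+n (ν ! a) {2} z<s) (trans e (HStep.hs1 h))) (HStep-first h)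
... | fd rewrite fd | ≡ᵇ-true (κ ! a) (ν ! a + 2) (HStep.hs1 h) = refl

sameRule-vertical : ∀ ν κ a → VStep ν κ a → sameRule ν κ ≡ addV (κ ! a) κ
sameRule-vertical ν κ a v with firstDiff-at ν κ a (subst (0 <_) (sym (VStep.vs1 v)) z<s) (λ e → 1+n≢n (sym (trans e (VStep.vs1 v)))) (VStep-first v)
... | fd rewrite fd | ≡ᵇ-false (κ ! a) (ν ! a + 2) (λ e → 1+n≢n (sym (trans (trans (sym (VStep.vs1 v)) e) (+2≡suc-suc _)))) = refl

colHeight-at : ∀ κ a c → IsPartition κ → κ ! a ≡ c → κ ! suc a ≡ c → (κ ! colHeight c κ ≡ c) × (κ ! suc (colHeight c κ) ≡ c)
colHeight-at κ a c pκ e1 e2 = q1 , q2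
  where
  sp = colHeight-spec c κ (proj₂ pκ)
  h = colHeight c κ
  ha : h ≤ a
  ha with h ≤? a
  ... | yes q = q
  ... | no q = ⊥-elim (<⇒≢ (proj₁ sp a (≰⇒> q)) (sym e1))
  q1 : κ ! h ≡ c
  q1 = ≤-antisym (proj₂ sp) (subst (_≤ κ ! h) e1 (decr-antitone (partition-decr pκ) ha))
  q2 : κ ! suc h ≡ c
  q2 = ≤-antisym (≤-trans (decr (partition-decr pκ) h) (proj₂ sp)) (subst (_≤ κ ! suc h) e2 (decr-antitone (partition-decr pκ) (s≤s ha)))

colHeight-zero : ∀ κ → IsPartition κ → (κ ! colHeight 0 κ ≡ 0) × (κ ! suc (colHeight 0 κ) ≡ 0)
colHeight-zero κ pκ = n≤0⇒n≡0 (proj₂ sp) , n≤0⇒n≡0 (≤-trans (decr (partition-decr pκ) _) (proj₂ sp))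
  where sp = colHeight-spec 0 κ (proj₂ pκ)

-- Valid e ν κ ρ is the situation of a cell of the
-- growth diagram; RuleCase lists the possible outcomes λ, each with the
-- facts about (ν, κ, ρ, λ) that are later used to invert the rule.

LeD : Part → Part → Set
LeD ν κ = ν ≡ κ ⊎ Step ν κ

Valid : Entry → Part → Part → Part → Set
Valid e ν κ ρ = IsPartition ν × IsPartition κ × IsPartition ρ × LeD ν κ × LeD ν ρ × (e ≡ zer ⊎ (ν ≡ κ × ν ≡ ρ))

-- The outcome when κ/ν (horizontal, row p) and ρ/ν (vertical, rows p, p+1)
-- share a cell: λ is ν with rows p and p+1 extended to length ν ! p + 2.
record SharedCell (ν κ ρ λ' : Part) : Set where
  constructor mkSh
  field
    sκ : Step κ λ'
    sρ : Step ρ λ'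
    p : ℕ
    o1 : κ ! suc p < λ' ! suc p
    o2 : ρ ! suc p < λ' ! suc p
    ou : ∀ x → κ ! x < λ' ! x → ρ ! x < λ' ! x → x ≡ suc p
    f1 : ∀ x → x ≢ p → x ≢ suc p → ν ! x ≡ λ' ! x
    f2 : ν ! p ≡ λ' ! p ∸ 2
    f3 : ν ! suc p ≡ λ' ! p ∸ 2

SharedCell-swap : ∀ {ν κ ρ λ'} → SharedCell ν κ ρ λ' → SharedCell ν ρ κ λ'
SharedCell-swap (mkSh sκ sρ p o1 o2 ou f1 f2 f3) = mkSh sρ sκ p o2 o1 (λ x a b → ou x b a) f1 f2 f3

data RuleCase (e : Entry) (ν κ ρ λ' : Part) : Set where
  c-eqκ : e ≡ zer → ν ≡ κ → λ' ≡ ρ → RuleCase e ν κ ρ λ'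
  c-eqρ : e ≡ zer → ν ≡ ρ → ν ≢ κ → λ' ≡ κ → RuleCase e ν κ ρ λ'
  c-union : e ≡ zer → κ ≢ ρ → Step ν κ → Step ν ρ → Step κ λ' → Step ρ λ'
          → (∀ x → ν ! x ≡ κ ! x ⊓ ρ ! x) → (∀ x → κ ! x < λ' ! x → ρ ! x < λ' ! x → ⊥) → RuleCase e ν κ ρ λ'
  c-shared : e ≡ zer → κ ≢ ρ → Step ν κ → Step ν ρ → SharedCell ν κ ρ λ' → RuleCase e ν κ ρ λ'
  c-sameH : e ≡ zer → κ ≡ ρ → (r : ℕ) → Step ν κ → HStep ν κ r → Step κ λ' → HStep κ λ' (suc r) → RuleCase e ν κ ρ λ'
  c-sameV : e ≡ zer → κ ≡ ρ → (a h : ℕ) → Step ν κ → VStep ν κ a → Step κ λ' → VStep κ λ' h → κ ! h ≡ κ ! a → RuleCase e ν κ ρ λ'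
  c-one : e ≡ one → ν ≡ κ → ν ≡ ρ → Step κ λ' → HStep κ λ' 0 → RuleCase e ν κ ρ λ'
  c-mone : e ≡ mone → ν ≡ κ → ν ≡ ρ → (h : ℕ) → Step κ λ' → VStep κ λ' h → κ ! h ≡ 0 → RuleCase e ν κ ρ λ'

sharedCell-rule : ∀ ν κ ρ p → IsPartition ν → Step ν κ → Step ν ρ → HStep ν κ p → VStep ν ρ p
         → SharedCell ν κ ρ (addCell (suc p) (suc (ν ! p)) (union κ ρ))
sharedCell-rule ν κ ρ p pν sκ sρ (mkH h1 h2) (mkV v0 v1 v2 v3) = mkSh stκ stρ p o1 o2 ou f1 f2 f3
  where
  pκ = proj₁ (proj₂ sκ)
  pρ = proj₁ (proj₂ sρ)
  u = union κ ρ
  λ' = addCell (suc p) (suc (ν ! p)) u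
  n = ν ! p
  lam-oth : ∀ x → x ≢ p → x ≢ suc p → λ' ! x ≡ ν ! x
  lam-oth x n1 n2 = trans (raiseRow-elsewhere (suc p) _ u x n2) (trans (union-row κ ρ x) (trans (cong₂ _⊔_ (h2 x n1) (v3 x n1 n2)) (⊔-idem _)))
  lam-p : λ' ! p ≡ n + 2
  lam-p = trans (raiseRow-elsewhere (suc p) _ u p (n≢1+n p)) (trans (union-row κ ρ p) (trans (cong₂ _⊔_ h1 v1) (m≥n⇒m⊔n≡m (≤-trans (n≤1+n (suc n)) (≤-reflexive (sym (+2≡suc-suc n)))))))
  u1 : u ! suc p ≡ suc n
  u1 = trans (union-row κ ρ (suc p)) (trans (cong₂ _⊔_ (trans (h2 (suc p) (1+n≢n)) v0) v2) (m≤n⇒m⊔n≡n (n≤1+n n)))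
  lam-p1 : λ' ! suc p ≡ n + 2
  lam-p1 = trans (raiseRow-here (suc p) _ u) (trans (cong (_⊔ suc (suc n)) u1) (trans (m≤n⇒m⊔n≡n (n≤1+n (suc n))) (sym (+2≡suc-suc n))))
  κp1 : κ ! suc p ≡ n
  κp1 = trans (h2 (suc p) 1+n≢n) v0
  hsκ : HStep κ λ' (suc p)
  hsκ = mkH (trans lam-p1 (cong (_+ 2) (sym κp1))) g
    where
    g : ∀ x → x ≢ suc p → λ' ! x ≡ κ ! x
    g x ne with x ≟ p
    ... | yes refl = trans lam-p (sym h1)
    ... | no n1 = trans (lam-oth x n1 ne) (sym (h2 x n1))
  vsρ : VStep ρ λ' p
  vsρ = mkV (trans v2 (sym v1)) (trans lam-p (trans (+2≡suc-suc n) (cong suc (sym v1)))) (trans lam-p1 (trans (+2≡suc-suc n) (cong suc (sym v1))))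
            (λ x n1 n2 → trans (lam-oth x n1 n2) (sym (v3 x n1 n2)))
  pλ : IsPartition λ'
  pλ = raiseRow-positive′ (suc p) _ (union-positive (proj₁ pκ) (proj₁ pρ)) z<s
         (λ r' e → subst (λ z → 0 < u ! z) (suc-injective e) (subst (0 <_) (sym (trans (union-row κ ρ p) (cong (_⊔ ρ ! p) h1))) (<-≤-trans (subst (0 <_) (sym (+2≡suc-suc n)) z<s) (m≤m⊔n (n + 2) (ρ ! p)))))
       , decr→linked (HStep-decr (partition-decr pκ) hsκ (λ r' e → subst (λ z → λ' ! suc p ≤ κ ! z) (suc-injective e) (≤-reflexive (trans lam-p1 (sym h1)))))
  stκ : Step κ λ'
  stκ = pκ , pλ , inj₁ (suc p , hsκ)
  stρ : Step ρ λ'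
  stρ = pρ , pλ , inj₂ (p , vsρ)
  o1 : κ ! suc p < λ' ! suc p
  o1 = subst₂ _<_ (sym κp1) (sym lam-p1) (subst (n <_) (sym (+2≡suc-suc n)) (≤-trans (n<1+n n) (n≤1+n (suc n))))
  o2 : ρ ! suc p < λ' ! suc p
  o2 = subst₂ _<_ (sym v2) (sym lam-p1) (subst (suc n <_) (sym (+2≡suc-suc n)) (n<1+n (suc n)))
  ou : ∀ x → κ ! x < λ' ! x → ρ ! x < λ' ! x → x ≡ suc p
  ou x l _ = HStep-rows hsκ x l
  f1 : ∀ x → x ≢ p → x ≢ suc p → ν ! x ≡ λ' ! x
  f1 x n1 n2 = sym (lam-oth x n1 n2)
  f2 : ν ! p ≡ λ' ! p ∸ 2
  f2 = sym (trans (cong (_∸ 2) lam-p) (m+n∸n≡m n 2))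
  f3 : ν ! suc p ≡ λ' ! p ∸ 2
  f3 = trans v0 f2

union-step : ∀ ν κ ρ → Step ν ρ → IsPartition κ → (∀ x → ν ! x ≤ κ ! x) → (∀ x → ν ! x < ρ ! x → κ ! x ≡ ν ! x) → Step κ (union κ ρ)
union-step ν κ ρ sρ pκ le dj = Step-transfer sρ pκ (union-part pκ (proj₁ (proj₂ sρ))) p q
  where
  p : ∀ x → ν ! x < ρ ! x → (κ ! x ≡ ν ! x) × (union κ ρ ! x ≡ ρ ! x)
  p x l = dj x l , trans (union-row κ ρ x) (trans (cong (_⊔ ρ ! x) (dj x l)) (m≤n⇒m⊔n≡n (<⇒≤ l)))
  q : ∀ x → ¬ (ν ! x < ρ ! x) → union κ ρ ! x ≡ κ ! x
  q x nl = trans (union-row κ ρ x) (trans (cong (κ ! x ⊔_) (≤-antisym (≮⇒≥ nl) (Step-le sρ x))) (m≥n⇒m⊔n≡m (le x)))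

strict-step : ∀ {ν κ} → LeD ν κ → ν ≢ κ → Step ν κ
strict-step (inj₁ e) ne = ⊥-elim (ne e)
strict-step (inj₂ s) ne = s

no-shared-cell : ∀ ν κ ρ → sharedRow ν κ ρ ≡ nothing → ∀ x → ν ! x < κ ! x → ν ! x < ρ ! x → ⊥
no-shared-cell ν κ ρ eq x l1 l2 with x <? (length κ ⊔ length ρ)
... | yes lt with ∧-false _ _ (fw-nothing-inv _ (λ z → z) (length κ ⊔ length ρ) eq x lt)
... | inj₁ e = t≢f (trans (sym (<ᵇ-true _ _ l1)) e)
... | inj₂ e = t≢f (trans (sym (<ᵇ-true _ _ l2)) e)
no-shared-cell ν κ ρ eq x l1 l2 | no nlt = n≮0 (subst (ν ! x <_) (row-beyond κ x (≤-trans (m≤m⊔n (length κ) (length ρ)) (≮⇒≥ nlt))) l1)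

HV-contra : ∀ {ν κ ρ b} → IsPartition κ → HStep ν κ (suc b) → VStep ν ρ b → ⊥
HV-contra {ν} {κ} {ρ} {b} pκ (mkH h1 h2) (mkV v0 _ _ _) =
  <⇒≱ (subst₂ _<_ (trans v0 (sym (h2 b (n≢1+n b)))) (sym h1) (m<m+n (ν ! suc b) {2} z<s)) (decr (partition-decr pκ) b)

VV-contra : ∀ {ν κ ρ a} → IsPartition ρ → VStep ν κ a → VStep ν ρ (suc a) → ⊥
VV-contra {ν} {κ} {ρ} {a} pρ (mkV v0 _ _ _) (mkV w0 w1 w2 w3) =
  <⇒≱ (subst₂ _<_ (trans v0 (sym (w3 a (n≢1+n a) (n≢2+n a)))) (sym w1) (n<1+n _)) (decr (partition-decr pρ) a)

HStep-unique-target : ∀ {ν κ ρ a} → IsPartition κ → IsPartition ρ → HStep ν κ a → HStep ν ρ a → κ ≡ ρ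
HStep-unique-target {ν} {κ} {ρ} {a} pκ pρ (mkH h1 h2) (mkH k1 k2) = partition-ext pκ pρ f
  where
  f : ∀ x → κ ! x ≡ ρ ! x
  f x with x ≟ a
  ... | yes refl = trans h1 (sym k1)
  ... | no ne = trans (h2 x ne) (sym (k2 x ne))

VStep-unique-target : ∀ {ν κ ρ a} → IsPartition κ → IsPartition ρ → VStep ν κ a → VStep ν ρ a → κ ≡ ρ
VStep-unique-target {ν} {κ} {ρ} {a} pκ pρ (mkV _ h1 h2 h3) (mkV _ k1 k2 k3) = partition-ext pκ pρ f
  where
  f : ∀ x → κ ! x ≡ ρ ! x
  f x with x ≟ a | x ≟ suc a
  ... | yes refl | _ = trans h1 (sym k1)
  ... | no _ | yes refl = trans h2 (sym k2)
  ... | no n1 | no n2 = trans (h3 x n1 n2) (sym (k3 x n1 n2))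

Step-target : ∀ {a b} → Step a b → IsPartition b
Step-target s = proj₁ (proj₂ s)

rule-case-same : ∀ ν κ → IsPartition ν → IsPartition κ → Step ν κ → RuleCase zer ν κ κ (sameRule ν κ)
rule-case-same ν κ pν pκ s@(_ , _ , inj₁ (a , h)) rewrite sameRule-horizontal ν κ a h =
  c-sameH refl refl a s h (proj₁ A) (proj₂ A)
  where
  A = addH-spec κ (suc a) pκ (λ r' e → subst (λ z → κ ! suc a + 2 ≤ κ ! z) (suc-injective e)
        (subst₂ _≤_ (cong (_+ 2) (sym (HStep.hs2 h (suc a) 1+n≢n))) (sym (HStep.hs1 h)) (+-monoˡ-≤ 2 (decr (partition-decr pν) a))))
rule-case-same ν κ pν pκ s@(_ , _ , inj₂ (a , v)) rewrite sameRule-vertical ν κ a v =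
  c-sameV refl refl a (colHeight (κ ! a) κ) s v (proj₁ A) (proj₂ A) (proj₁ C)
  where
  C = colHeight-at κ a (κ ! a) pκ refl (trans (VStep.vs2 v) (sym (VStep.vs1 v)))
  A = addV-spec κ (κ ! a) pκ (proj₁ C) (proj₂ C)

meet-rows : ∀ ν κ ρ → Step ν κ → Step ν ρ → (∀ x → ν ! x < κ ! x → ν ! x < ρ ! x → ⊥) → ∀ x → ν ! x ≡ κ ! x ⊓ ρ ! x
meet-rows ν κ ρ sκ sρ ns x with ν ! x <? κ ! x
... | yes l = trans (sym (m≥n⇒m⊓n≡n (Step-le sκ x))) (cong (κ ! x ⊓_) (≤-antisym (Step-le sρ x) (≮⇒≥ (ns x l))))
... | no nl = trans (sym (m≤n⇒m⊓n≡m (Step-le sρ x))) (cong (_⊓ ρ ! x) (≤-antisym (Step-le sκ x) (≮⇒≥ nl)))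

union-no-overlap : ∀ κ ρ x → κ ! x < union κ ρ ! x → ρ ! x < union κ ρ ! x → ⊥
union-no-overlap κ ρ x l1 l2 with ⊔-sel (κ ! x) (ρ ! x)
... | inj₁ e = <-irrefl (sym (trans (union-row κ ρ x) e)) l1
... | inj₂ e = <-irrefl (sym (trans (union-row κ ρ x) e)) l2

rule-case-distinct : ∀ ν κ ρ → IsPartition ν → κ ≢ ρ → Step ν κ → Step ν ρ → RuleCase zer ν κ ρ (unionPlus ν κ ρ (sharedRow ν κ ρ))
rule-case-distinct ν κ ρ pν n3 sκ sρ with sharedRow ν κ ρ in eq
... | nothing = c-union refl n3 sκ sρ stκ stρ (meet-rows ν κ ρ sκ sρ ns) (union-no-overlap κ ρ)
  where
  ns = no-shared-cell ν κ ρ eq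
  pκ = Step-target sκ
  pρ = Step-target sρ
  stκ : Step κ (union κ ρ)
  stκ = union-step ν κ ρ sρ pκ (Step-le sκ) (λ x l → ≤-antisym (≮⇒≥ (λ l2 → ns x l2 l)) (Step-le sκ x))
  stρ : Step ρ (union κ ρ)
  stρ = subst (Step ρ) (union-comm ρ κ) (union-step ν ρ κ sκ pρ (Step-le sρ) (λ x l → ≤-antisym (≮⇒≥ (λ l2 → ns x l l2)) (Step-le sρ x)))
... | just p with fw-just-inv _ (λ z → z) (length κ ⊔ length ρ) p eq
... | .p , refl , _ , pt , _ with ∧-true _ _ pt
... | t1 , t2 = go sκ sρ
  where
  l1 : ν ! p < κ ! p
  l1 = <ᵇ-sound _ _ t1
  l2 : ν ! p < ρ ! p
  l2 = <ᵇ-sound _ _ t2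
  pκ = Step-target sκ
  pρ = Step-target sρ
  go : Step ν κ → Step ν ρ → RuleCase zer ν κ ρ (addCell (suc p) (suc (ν ! p)) (union κ ρ))
  go (_ , _ , inj₁ (a , h)) (_ , _ , inj₁ (b , k)) with HStep-rows h p l1 | HStep-rows k p l2
  ... | refl | refl = ⊥-elim (n3 (HStep-unique-target pκ pρ h k))
  go (_ , _ , inj₁ (a , h)) (_ , _ , inj₂ (b , v)) with HStep-rows h p l1 | VStep-rows v p l2
  ... | refl | inj₁ refl = c-shared refl n3 sκ sρ (sharedCell-rule ν κ ρ p pν sκ sρ h v)
  ... | refl | inj₂ refl = ⊥-elim (HV-contra pκ h v)
  go (_ , _ , inj₂ (a , v)) (_ , _ , inj₁ (b , h)) with HStep-rows h p l2 | VStep-rows v p l1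
  ... | refl | inj₁ refl = c-shared refl n3 sκ sρ (subst (SharedCell ν κ ρ) (cong (addCell _ _) (union-comm ρ κ)) (SharedCell-swap (sharedCell-rule ν ρ κ p pν sρ sκ h v)))
  ... | refl | inj₂ refl = ⊥-elim (HV-contra pρ h v)
  go (_ , _ , inj₂ (a , v)) (_ , _ , inj₂ (b , w)) with VStep-rows v p l1 | VStep-rows w p l2
  ... | inj₁ refl | inj₁ refl = ⊥-elim (n3 (VStep-unique-target pκ pρ v w))
  ... | inj₂ refl | inj₂ refl = ⊥-elim (n3 (VStep-unique-target pκ pρ v w))
  ... | inj₁ refl | inj₂ refl = ⊥-elim (VV-contra pκ w v)
  ... | inj₂ refl | inj₁ refl = ⊥-elim (VV-contra pρ v w)

rule-case : ∀ e ν κ ρ → Valid e ν κ ρ → RuleCase e ν κ ρ (local e ν κ ρ)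
rule-case one ν κ ρ (_ , _ , _ , _ , _ , inj₁ ())
rule-case one ν .ν .ν (pν , _ , _ , _ , _ , inj₂ (refl , refl)) = c-one refl refl refl (proj₁ A) (proj₂ A)
  where A = addH-spec ν 0 pν (λ r' ())
rule-case mone ν κ ρ (_ , _ , _ , _ , _ , inj₁ ())
rule-case mone ν .ν .ν (pν , _ , _ , _ , _ , inj₂ (refl , refl)) = c-mone refl refl refl (colHeight 0 ν) (proj₁ A) (proj₂ A) (proj₁ C)
  where
  C = colHeight-zero ν pν
  A = addV-spec ν 0 pν (proj₁ C) (proj₂ C)
rule-case zer ν κ ρ (pν , pκ , pρ , lκ , lρ , _) with ν ≟P κ | ν ≟P ρ | κ ≟P ρ
... | yes refl | _ | _ = c-eqκ refl refl refl
... | no n1 | yes refl | _ = c-eqρ refl refl n1 refl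
... | no n1 | no n2 | yes refl = rule-case-same ν κ pν pκ (strict-step lκ n1)
... | no n1 | no n2 | no n3 = rule-case-distinct ν κ ρ pν n3 (strict-step lκ n1) (strict-step lρ n2)

HStep-row-unique : ∀ {κ λ' r r'} → HStep κ λ' r → HStep κ λ' r' → r ≡ r'
HStep-row-unique {κ} {λ'} {r} {r'} h h' = HStep-rows h' r (subst (κ ! r <_) (sym (HStep.hs1 h)) (m<m+n (κ ! r) {2} z<s))

VStep-grows : ∀ {κ λ' h} → VStep κ λ' h → κ ! h < λ' ! h
VStep-grows v = subst (_ <_) (sym (VStep.vs1 v)) (n<1+n _)

VStep-row-unique : ∀ {κ λ' h h'} → VStep κ λ' h → VStep κ λ' h' → h ≡ h'
VStep-row-unique {κ} {λ'} {h} {h'} v w with VStep-rows w h (VStep-grows v) | VStep-rows v h' (VStep-grows w)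
... | inj₁ e | _ = e
... | inj₂ e | inj₁ e2 = sym e2
... | inj₂ refl | inj₂ e2 = ⊥-elim (n≢2+n h' e2)

HStep-not-VStep : ∀ {κ λ' r h} → HStep κ λ' r → VStep κ λ' h → ⊥
HStep-not-VStep {κ} {λ'} {r} {h} (mkH h1 h2) v with h ≟ r
... | yes refl = n≢1+n _ (suc-injective (trans (trans (sym (VStep.vs1 v)) h1) (+2≡suc-suc _)))
... | no ne = 1+n≢n (trans (sym (VStep.vs1 v)) (h2 h ne))

HStep-unique-source : ∀ {ν ν' κ r} → IsPartition ν → IsPartition ν' → HStep ν κ r → HStep ν' κ r → ν ≡ ν'
HStep-unique-source {ν} {ν'} {κ} {r} pν pν' (mkH h1 h2) (mkH k1 k2) = partition-ext pν pν' f
  where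
  f : ∀ x → ν ! x ≡ ν' ! x
  f x with x ≟ r
  ... | yes refl = +-cancelʳ-≡ 2 _ _ (trans (sym h1) k1)
  ... | no ne = trans (sym (h2 x ne)) (k2 x ne)

VStep-unique-source : ∀ {ν ν' κ r} → IsPartition ν → IsPartition ν' → VStep ν κ r → VStep ν' κ r → ν ≡ ν'
VStep-unique-source {ν} {ν'} {κ} {r} pν pν' (mkV h0 h1 h2 h3) (mkV k0 k1 k2 k3) = partition-ext pν pν' f
  where
  f : ∀ x → ν ! x ≡ ν' ! x
  f x with x ≟ r | x ≟ suc r
  ... | yes refl | _ = suc-injective (trans (sym h1) k1)
  ... | no _ | yes refl = trans h0 (trans (suc-injective (trans (sym h1) k1)) (sym k0))
  ... | no n1 | no n2 = trans (sym (h3 x n1 n2)) (k3 x n1 n2)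

VStep-below : ∀ {ν κ a} → IsPartition ν → VStep ν κ a → κ ! suc (suc a) < κ ! a
VStep-below {ν} {κ} {a} pν (mkV h0 h1 h2 h3) =
  subst₂ _<_ (sym (h3 (suc (suc a)) (λ e → n≢2+n a (sym e)) (λ e → n≢1+n (suc a) (sym e)))) (sym h1)
    (s≤s (≤-trans (decr (partition-decr pν) (suc a)) (≤-reflexive h0)))

VStep-column-unique : ∀ {ν ν' κ a a'} → IsPartition κ → IsPartition ν → IsPartition ν' → VStep ν κ a → VStep ν' κ a' → κ ! a ≡ κ ! a' → a ≡ a'
VStep-column-unique {ν} {ν'} {κ} {a} {a'} pκ pν pν' v w e with <-cmp a a'
... | tri≈ _ q _ = q
... | tri< lt _ _ = ⊥-elim (<-irrefl refl (<-≤-trans (≤-trans (s≤s (decr-antitone (partition-decr pκ) (s≤s lt))) (VStep-below pν v)) (≤-reflexive (trans e (trans (VStep.vs1 w) (sym (VStep.vs2 w)))))))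
... | tri> _ _ gt = ⊥-elim (<-irrefl refl (<-≤-trans (≤-trans (s≤s (decr-antitone (partition-decr pκ) (s≤s gt))) (VStep-below pν' w)) (≤-reflexive (trans (sym e) (trans (VStep.vs1 v) (sym (VStep.vs2 v)))))))

rule-injective-strict : ∀ {e e' ν ν' κ ρ λ'} → IsPartition ν → IsPartition ν' → IsPartition κ → λ' ≢ ρ → λ' ≢ κ
     → RuleCase e ν κ ρ λ' → RuleCase e' ν' κ ρ λ' → (ν ≡ ν') × (e ≡ e')
rule-injective-strict _ _ _ nr nk (c-eqκ _ _ l) _ = ⊥-elim (nr l)
rule-injective-strict _ _ _ nr nk (c-eqρ _ _ _ l) _ = ⊥-elim (nk l)
rule-injective-strict _ _ _ nr nk _ (c-eqκ _ _ l) = ⊥-elim (nr l)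
rule-injective-strict _ _ _ nr nk _ (c-eqρ _ _ _ l) = ⊥-elim (nk l)
rule-injective-strict {ν = ν} {ν'} {κ} {ρ} pν pν' _ _ _ (c-union refl _ _ _ _ _ m1 _) (c-union refl _ _ _ _ _ m2 _) = partition-ext pν pν' (λ x → trans (m1 x) (sym (m2 x))) , refl
rule-injective-strict _ _ _ _ _ (c-union _ _ _ _ _ _ _ nov) (c-shared _ _ _ _ d) = ⊥-elim (nov _ (SharedCell.o1 d) (SharedCell.o2 d))
rule-injective-strict _ _ _ _ _ (c-shared _ _ _ _ d) (c-union _ _ _ _ _ _ _ nov) = ⊥-elim (nov _ (SharedCell.o1 d) (SharedCell.o2 d))
rule-injective-strict {ν = ν} {ν'} {κ} {ρ} {λ'} pν pν' _ _ _ (c-shared refl _ _ _ d) (c-shared refl _ _ _ d') with suc-injective (SharedCell.ou d _ (SharedCell.o1 d') (SharedCell.o2 d'))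
... | refl = partition-ext pν pν' f , refl
  where
  p = SharedCell.p d
  f : ∀ x → ν ! x ≡ ν' ! x
  f x with x ≟ p | x ≟ suc p
  ... | yes refl | _ = trans (SharedCell.f2 d) (sym (SharedCell.f2 d'))
  ... | no _ | yes refl = trans (SharedCell.f3 d) (sym (SharedCell.f3 d'))
  ... | no n1 | no n2 = trans (SharedCell.f1 d x n1 n2) (sym (SharedCell.f1 d' x n1 n2))
rule-injective-strict _ _ _ _ _ (c-union _ n3 _ _ _ _ _ _) (c-sameH _ e _ _ _ _ _) = ⊥-elim (n3 e)
rule-injective-strict _ _ _ _ _ (c-union _ n3 _ _ _ _ _ _) (c-sameV _ e _ _ _ _ _ _ _) = ⊥-elim (n3 e)
rule-injective-strict _ _ _ _ _ (c-union _ n3 _ _ _ _ _ _) (c-one _ a b _ _) = ⊥-elim (n3 (trans (sym a) b))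
rule-injective-strict _ _ _ _ _ (c-union _ n3 _ _ _ _ _ _) (c-mone _ a b _ _ _ _) = ⊥-elim (n3 (trans (sym a) b))
rule-injective-strict _ _ _ _ _ (c-shared _ n3 _ _ _) (c-sameH _ e _ _ _ _ _) = ⊥-elim (n3 e)
rule-injective-strict _ _ _ _ _ (c-shared _ n3 _ _ _) (c-sameV _ e _ _ _ _ _ _ _) = ⊥-elim (n3 e)
rule-injective-strict _ _ _ _ _ (c-shared _ n3 _ _ _) (c-one _ a b _ _) = ⊥-elim (n3 (trans (sym a) b))
rule-injective-strict _ _ _ _ _ (c-shared _ n3 _ _ _) (c-mone _ a b _ _ _ _) = ⊥-elim (n3 (trans (sym a) b))
rule-injective-strict _ _ _ _ _ (c-sameH _ e _ _ _ _ _) (c-union _ n3 _ _ _ _ _ _) = ⊥-elim (n3 e)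
rule-injective-strict _ _ _ _ _ (c-sameV _ e _ _ _ _ _ _ _) (c-union _ n3 _ _ _ _ _ _) = ⊥-elim (n3 e)
rule-injective-strict _ _ _ _ _ (c-one _ a b _ _) (c-union _ n3 _ _ _ _ _ _) = ⊥-elim (n3 (trans (sym a) b))
rule-injective-strict _ _ _ _ _ (c-mone _ a b _ _ _ _) (c-union _ n3 _ _ _ _ _ _) = ⊥-elim (n3 (trans (sym a) b))
rule-injective-strict _ _ _ _ _ (c-sameH _ e _ _ _ _ _) (c-shared _ n3 _ _ _) = ⊥-elim (n3 e)
rule-injective-strict _ _ _ _ _ (c-sameV _ e _ _ _ _ _ _ _) (c-shared _ n3 _ _ _) = ⊥-elim (n3 e)
rule-injective-strict _ _ _ _ _ (c-one _ a b _ _) (c-shared _ n3 _ _ _) = ⊥-elim (n3 (trans (sym a) b))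
rule-injective-strict _ _ _ _ _ (c-mone _ a b _ _ _ _) (c-shared _ n3 _ _ _) = ⊥-elim (n3 (trans (sym a) b))
rule-injective-strict pν pν' _ _ _ (c-sameH refl _ r s h _ h2) (c-sameH refl _ r' s' h' _ h2') with suc-injective (HStep-row-unique h2 h2')
... | refl = HStep-unique-source pν pν' h h' , refl
rule-injective-strict _ _ _ _ _ (c-sameH _ _ _ _ _ _ h2) (c-sameV _ _ _ _ _ _ _ v _) = ⊥-elim (HStep-not-VStep h2 v)
rule-injective-strict _ _ _ _ _ (c-sameH _ _ _ _ _ _ h2) (c-one _ _ _ _ h) with HStep-row-unique h2 h
... | ()
rule-injective-strict _ _ _ _ _ (c-sameH _ _ _ _ _ _ h2) (c-mone _ _ _ _ _ v _) = ⊥-elim (HStep-not-VStep h2 v)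
rule-injective-strict _ _ _ _ _ (c-sameV _ _ _ _ _ _ _ v _) (c-sameH _ _ _ _ _ _ h2) = ⊥-elim (HStep-not-VStep h2 v)
rule-injective-strict _ _ _ _ _ (c-one _ _ _ _ h) (c-sameH _ _ _ _ _ _ h2) with HStep-row-unique h2 h
... | ()
rule-injective-strict _ _ _ _ _ (c-mone _ _ _ _ _ v _) (c-sameH _ _ _ _ _ _ h2) = ⊥-elim (HStep-not-VStep h2 v)
rule-injective-strict pν pν' pκ _ _ (c-sameV refl _ a h s v _ w e1) (c-sameV refl _ a' h' s' v' _ w' e2) with VStep-row-unique w w'
... | refl with VStep-column-unique pκ pν pν' v v' (trans (sym e1) e2)
... | refl = VStep-unique-source pν pν' v v' , refl
rule-injective-strict _ _ _ _ _ (c-sameV _ _ _ _ _ _ _ v _) (c-one _ _ _ _ h) = ⊥-elim (HStep-not-VStep h v)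
rule-injective-strict _ _ _ _ _ (c-one _ _ _ _ h) (c-sameV _ _ _ _ _ _ _ v _) = ⊥-elim (HStep-not-VStep h v)
rule-injective-strict _ _ _ _ _ (c-sameV _ _ a h _ v _ w e1) (c-mone _ _ _ h' _ w' e2) with VStep-row-unique w w'
... | refl = ⊥-elim (0≢1+n (trans (sym e2) (trans e1 (VStep.vs1 v))))
rule-injective-strict _ _ _ _ _ (c-mone _ _ _ h' _ w' e2) (c-sameV _ _ a h _ v _ w e1) with VStep-row-unique w w'
... | refl = ⊥-elim (0≢1+n (trans (sym e2) (trans e1 (VStep.vs1 v))))
rule-injective-strict _ _ _ _ _ (c-one refl a _ _ _) (c-one refl a' _ _ _) = trans a (sym a') , refl
rule-injective-strict _ _ _ _ _ (c-one _ _ _ _ h) (c-mone _ _ _ _ _ v _) = ⊥-elim (HStep-not-VStep h v)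
rule-injective-strict _ _ _ _ _ (c-mone _ _ _ _ _ v _) (c-one _ _ _ _ h) = ⊥-elim (HStep-not-VStep h v)
rule-injective-strict _ _ _ _ _ (c-mone refl a _ _ _ _ _) (c-mone refl a' _ _ _ _ _) = trans a (sym a') , refl

rule-injective : ∀ {e e' ν ν' κ ρ λ'} → IsPartition ν → IsPartition ν' → IsPartition κ
     → RuleCase e ν κ ρ λ' → RuleCase e' ν' κ ρ λ' → (ν ≡ ν') × (e ≡ e')
rule-injective {κ = κ} {ρ} {λ'} pν pν' pκ F F' with λ' ≟P ρ | λ' ≟P κ
... | no nr | no nk = rule-injective-strict pν pν' pκ nr nk F F'
... | yes l | _ = isA F l F'
  where
  isA : ∀ {e e' ν ν'} → RuleCase e ν κ ρ λ' → λ' ≡ ρ → RuleCase e' ν' κ ρ λ' → (ν ≡ ν') × (e ≡ e')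
  isA {ν = ν} (c-eqκ e1 n1 _) l (c-eqκ e2 n2 _) = trans n1 (sym n2) , trans e1 (sym e2)
  isA (c-eqκ _ _ _) l (c-eqρ _ n2 ne l2) = ⊥-elim (ne (trans n2 (trans (sym l) l2)))
  isA (c-eqρ _ n2 ne l2) l _ = ⊥-elim (ne (trans n2 (trans (sym l) l2)))
  isA (c-union _ _ _ _ _ s _ _) l _ = ⊥-elim (Step-ne s (sym l))
  isA (c-shared _ _ _ _ d) l _ = ⊥-elim (Step-ne (SharedCell.sρ d) (sym l))
  isA (c-sameH _ e _ _ _ s _) l _ = ⊥-elim (Step-ne s (trans e (sym l)))
  isA (c-sameV _ e _ _ _ _ s _ _) l _ = ⊥-elim (Step-ne s (trans e (sym l)))
  isA (c-one _ a b s _) l _ = ⊥-elim (Step-ne s (trans (trans (sym a) b) (sym l)))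
  isA (c-mone _ a b _ s _ _) l _ = ⊥-elim (Step-ne s (trans (trans (sym a) b) (sym l)))
  isA _ l (c-union _ _ _ _ _ s _ _) = ⊥-elim (Step-ne s (sym l))
  isA _ l (c-shared _ _ _ _ d) = ⊥-elim (Step-ne (SharedCell.sρ d) (sym l))
  isA _ l (c-sameH _ e _ _ _ s _) = ⊥-elim (Step-ne s (trans e (sym l)))
  isA _ l (c-sameV _ e _ _ _ _ s _ _) = ⊥-elim (Step-ne s (trans e (sym l)))
  isA _ l (c-one _ a b s _) = ⊥-elim (Step-ne s (trans (trans (sym a) b) (sym l)))
  isA _ l (c-mone _ a b _ s _ _) = ⊥-elim (Step-ne s (trans (trans (sym a) b) (sym l)))
... | no nr | yes k = isB F F'
  where
  isB : ∀ {e e' ν ν'} → RuleCase e ν κ ρ λ' → RuleCase e' ν' κ ρ λ' → (ν ≡ ν') × (e ≡ e')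
  isB (c-eqρ e1 n1 _ _) (c-eqρ e2 n2 _ _) = trans n1 (sym n2) , trans e1 (sym e2)
  isB (c-eqκ _ _ l) _ = ⊥-elim (nr l)
  isB (c-union _ _ _ _ s _ _ _) _ = ⊥-elim (Step-ne s (sym k))
  isB (c-shared _ _ _ _ d) _ = ⊥-elim (Step-ne (SharedCell.sκ d) (sym k))
  isB (c-sameH _ _ _ _ _ s _) _ = ⊥-elim (Step-ne s (sym k))
  isB (c-sameV _ _ _ _ _ _ s _ _) _ = ⊥-elim (Step-ne s (sym k))
  isB (c-one _ _ _ s _) _ = ⊥-elim (Step-ne s (sym k))
  isB (c-mone _ _ _ _ s _ _) _ = ⊥-elim (Step-ne s (sym k))
  isB _ (c-eqκ _ _ l) = ⊥-elim (nr l)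
  isB _ (c-union _ _ _ _ s _ _ _) = ⊥-elim (Step-ne s (sym k))
  isB _ (c-shared _ _ _ _ d) = ⊥-elim (Step-ne (SharedCell.sκ d) (sym k))
  isB _ (c-sameH _ _ _ _ _ s _) = ⊥-elim (Step-ne s (sym k))
  isB _ (c-sameV _ _ _ _ _ _ s _ _) = ⊥-elim (Step-ne s (sym k))
  isB _ (c-one _ _ _ s _) = ⊥-elim (Step-ne s (sym k))
  isB _ (c-mone _ _ _ _ s _ _) = ⊥-elim (Step-ne s (sym k))

local-comm : ∀ {e ν κ ρ} → Valid e ν κ ρ → local e ν κ ρ ≡ local e ν ρ κ
local-comm {zer} {ν} {κ} {ρ} _ = localZero-comm ν κ ρ
local-comm {one} (_ , _ , _ , _ , _ , inj₁ ())
local-comm {one} (_ , _ , _ , _ , _ , inj₂ (refl , refl)) = refl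
local-comm {mone} (_ , _ , _ , _ , _ , inj₁ ())
local-comm {mone} (_ , _ , _ , _ , _ , inj₂ (refl , refl)) = refl

local-cancel : ∀ {e ν κ ρ e' ν'} → Valid e ν κ ρ → Valid e' ν' κ ρ → local e ν κ ρ ≡ local e' ν' κ ρ → (ν ≡ ν') × (e ≡ e')
local-cancel {e} {ν} {κ} {ρ} {e'} {ν'} v v' eq =
  rule-injective (proj₁ v) (proj₁ v') (proj₁ (proj₂ v)) (rule-case e ν κ ρ v) (subst (RuleCase e' ν' κ ρ) (sym eq) (rule-case e' ν' κ ρ v'))

localZero-ν≡κ : ∀ ν ρ → localZero ν ν ρ ≡ ρ
localZero-ν≡κ ν ρ with ν ≟P ν
... | yes _ = refl
... | no q = ⊥-elim (q refl)

localZero-ν≡ρ : ∀ ν κ → localZero ν κ ν ≡ κ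
localZero-ν≡ρ ν κ with ν ≟P κ | ν ≟P ν
... | yes refl | _ = refl
... | no _ | yes _ = refl
... | no _ | no q = ⊥-elim (q refl)

localZero-same : ∀ ν κ → ν ≢ κ → localZero ν κ κ ≡ sameRule ν κ
localZero-same ν κ ne with ν ≟P κ | κ ≟P κ
... | yes e | _ = ⊥-elim (ne e)
... | no _ | yes _ = refl
... | no _ | no q = ⊥-elim (q refl)

localZero-distinct : ∀ ν κ ρ → ν ≢ κ → ν ≢ ρ → κ ≢ ρ → localZero ν κ ρ ≡ unionPlus ν κ ρ (sharedRow ν κ ρ)
localZero-distinct ν κ ρ n1 n2 n3 with ν ≟P κ | ν ≟P ρ | κ ≟P ρ
... | yes e | _ | _ = ⊥-elim (n1 e)
... | no _ | yes e | _ = ⊥-elim (n2 e)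
... | no _ | no _ | yes e = ⊥-elim (n3 e)
... | no _ | no _ | no _ = refl

rule-partition : ∀ {e ν κ ρ λ'} → IsPartition κ → IsPartition ρ → RuleCase e ν κ ρ λ' → IsPartition λ'
rule-partition pκ pρ (c-eqκ _ _ refl) = pρ
rule-partition pκ pρ (c-eqρ _ _ _ refl) = pκ
rule-partition pκ pρ (c-union _ _ _ _ s _ _ _) = Step-target s
rule-partition pκ pρ (c-shared _ _ _ _ d) = Step-target (SharedCell.sκ d)
rule-partition pκ pρ (c-sameH _ _ _ _ _ s _) = Step-target s
rule-partition pκ pρ (c-sameV _ _ _ _ _ _ s _ _) = Step-target s
rule-partition pκ pρ (c-one _ _ _ s _) = Step-target s
rule-partition pκ pρ (c-mone _ _ _ _ s _ _) = Step-target s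

-- The local rule is surjective: for κ, ρ ≤_d λ we construct ν (and e).  In
-- the disjoint case ν = κ ∩ ρ; otherwise ν is λ with one or two rows
-- shortened (lowerRows).

inter : Part → Part → Part
inter (x ∷ a) (y ∷ b) = (x ⊓ y) ∷ inter a b
inter _ _ = []

inter-row : ∀ a b x → inter a b ! x ≡ a ! x ⊓ b ! x
inter-row [] b x = refl
inter-row (y ∷ a) [] zero = sym (⊓-zeroʳ y)
inter-row (y ∷ a) [] (suc x) = sym (⊓-zeroʳ _)
inter-row (y ∷ a) (z ∷ b) zero = refl
inter-row (y ∷ a) (z ∷ b) (suc x) = inter-row a b x

inter-part : ∀ {a b} → IsPartition a → IsPartition b → IsPartition (inter a b)
inter-part {a} {b} pa pb = ip (proj₁ pa) (proj₁ pb) , decr→linked (mkDecr λ x → subst₂ _≤_ (sym (inter-row a b (suc x))) (sym (inter-row a b x)) (⊓-mono-≤ (decr (partition-decr pa) x) (decr (partition-decr pb) x)))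
  where
  ip : ∀ {a b} → All (0 <_) a → All (0 <_) b → All (0 <_) (inter a b)
  ip [] _ = []
  ip (p ∷ pa) [] = []
  ip {x ∷ a} {y ∷ b} (p ∷ pa) (q ∷ pb) = ⊓-glb p q ∷ ip pa pb

inter-comm : ∀ a b → inter a b ≡ inter b a
inter-comm [] [] = refl
inter-comm [] (x ∷ b) = refl
inter-comm (x ∷ a) [] = refl
inter-comm (x ∷ a) (y ∷ b) = cong₂ _∷_ (⊓-comm x y) (inter-comm a b)

Preimage : Part → Part → Part → Set
Preimage κ ρ λ' = Σ Part λ ν → Σ Entry λ e → Valid e ν κ ρ × local e ν κ ρ ≡ λ'

Preimage-swap : ∀ {κ ρ λ'} → Preimage ρ κ λ' → Preimage κ ρ λ'
Preimage-swap (ν , zer , (pν , pρ , pκ , lρ , lκ , v) , eq) = ν , zer , (pν , pκ , pρ , lκ , lρ , inj₁ refl) , trans (localZero-comm ν _ _) eq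
Preimage-swap (ν , one , (pν , pρ , pκ , lρ , lκ , inj₁ ()) , eq)
Preimage-swap (ν , one , (pν , pρ , pκ , lρ , lκ , inj₂ (refl , refl)) , eq) = ν , one , (pν , pκ , pρ , lκ , lρ , inj₂ (refl , refl)) , eq
Preimage-swap (ν , mone , (pν , pρ , pκ , lρ , lκ , inj₁ ()) , eq)
Preimage-swap (ν , mone , (pν , pρ , pκ , lρ , lκ , inj₂ (refl , refl)) , eq) = ν , mone , (pν , pκ , pρ , lκ , lρ , inj₂ (refl , refl)) , eq

preimage-disjoint : ∀ κ ρ λ' → Step κ λ' → Step ρ λ' → κ ≢ ρ → (∀ x → κ ! x < λ' ! x → ρ ! x < λ' ! x → ⊥) → Preimage κ ρ λ'
preimage-disjoint κ ρ λ' sκ sρ n3 dj = ν , zer , (pν , pκ , pρ , inj₂ stκ , inj₂ stρ , inj₁ refl) , eq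
  where
  pκ = proj₁ sκ
  pρ = proj₁ sρ
  pλ = Step-target sκ
  ν = inter κ ρ
  pν = inter-part pκ pρ
  keq : ∀ x → ρ ! x < λ' ! x → κ ! x ≡ λ' ! x
  keq x l = ≤-antisym (Step-le sκ x) (≮⇒≥ (λ l2 → dj x l2 l))
  req : ∀ x → κ ! x < λ' ! x → ρ ! x ≡ λ' ! x
  req x l = ≤-antisym (Step-le sρ x) (≮⇒≥ (λ l2 → dj x l l2))
  stκ : Step ν κ
  stκ = Step-transfer sρ pν pκ
         (λ x l → trans (inter-row κ ρ x) (trans (cong (_⊓ ρ ! x) (keq x l)) (m≥n⇒m⊓n≡n (Step-le sρ x))) , keq x l)
         (λ x nl → sym (trans (inter-row κ ρ x) (m≤n⇒m⊓n≡m (≤-trans (Step-le sκ x) (≮⇒≥ nl)))))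
  stρ : Step ν ρ
  stρ = Step-transfer sκ pν pρ
         (λ x l → trans (inter-row κ ρ x) (trans (cong (κ ! x ⊓_) (req x l)) (m≤n⇒m⊓n≡m (Step-le sκ x))) , req x l)
         (λ x nl → sym (trans (inter-row κ ρ x) (m≥n⇒m⊓n≡n (≤-trans (Step-le sρ x) (≮⇒≥ nl)))))
  sh : sharedRow ν κ ρ ≡ nothing
  sh = fw-nothing _ (λ z → z) _ f
    where
    f : ∀ y → y < (length κ ⊔ length ρ) → (((ν ! y) <ᵇ (κ ! y)) ∧ ((ν ! y) <ᵇ (ρ ! y))) ≡ false
    f y _ with ⊓-sel (κ ! y) (ρ ! y)
    ... | inj₁ e rewrite <ᵇ-false (ν ! y) (κ ! y) (λ l → <-irrefl (trans (inter-row κ ρ y) e) l) = refl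
    ... | inj₂ e rewrite <ᵇ-false (ν ! y) (ρ ! y) (λ l → <-irrefl (trans (inter-row κ ρ y) e) l) = ∧-zeroʳ _
  ueq : union κ ρ ≡ λ'
  ueq = partition-ext (union-part pκ pρ) pλ f
    where
    f : ∀ x → union κ ρ ! x ≡ λ' ! x
    f x with κ ! x <? λ' ! x
    ... | yes l = trans (union-row κ ρ x) (trans (cong (κ ! x ⊔_) (req x l)) (m≤n⇒m⊔n≡n (Step-le sκ x)))
    ... | no nl = trans (union-row κ ρ x) (trans (cong (_⊔ ρ ! x) (≤-antisym (Step-le sκ x) (≮⇒≥ nl))) (m≥n⇒m⊔n≡m (Step-le sρ x)))
  eq : localZero ν κ ρ ≡ λ'
  eq = trans (localZero-distinct ν κ ρ (Step-ne stκ) (Step-ne stρ) n3) (trans (cong (unionPlus ν κ ρ) sh) ueq)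

lowerRows : (ℕ → Bool) → ℕ → Part → ℕ → ℕ
lowerRows s d l x = if s x then l ! x ∸ d else l ! x

lowerRows-hit : ∀ s d l x → s x ≡ true → lowerRows s d l x ≡ l ! x ∸ d
lowerRows-hit s d l x e rewrite e = refl

lowerRows-miss : ∀ s d l x → s x ≡ false → lowerRows s d l x ≡ l ! x
lowerRows-miss s d l x e rewrite e = refl

lowerRows-≤ : ∀ s d l x → lowerRows s d l x ≤ l ! x
lowerRows-≤ s d l x with s x
... | true = m∸n≤m _ d
... | false = ≤-refl

lowerRows-partition : ∀ s d l → (∀ x → lowerRows s d l (suc x) ≤ lowerRows s d l x)
           → (∀ x → fromFun (lowerRows s d l) (length l) ! x ≡ lowerRows s d l x) × IsPartition (fromFun (lowerRows s d l) (length l))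
lowerRows-partition s d l a = proj₁ (fromFun-spec _ _ a z) , fromFun-part _ _ a z
  where
  z : ∀ x → length l ≤ x → lowerRows s d l x ≡ 0
  z x le = n≤0⇒n≡0 (≤-trans (lowerRows-≤ s d l x) (≤-reflexive (row-beyond l x le)))

twoRows : ℕ → ℕ → Bool
twoRows b x = (x ≡ᵇ b) ∨ (x ≡ᵇ suc b)

twoRows-first : ∀ b → twoRows b b ≡ true
twoRows-first b rewrite ≡ᵇ-true b b refl = refl

twoRows-second : ∀ b → twoRows b (suc b) ≡ true
twoRows-second b rewrite ≡ᵇ-true (suc b) (suc b) refl = ∨-zeroʳ _

twoRows-other : ∀ b x → x ≢ b → x ≢ suc b → twoRows b x ≡ false
twoRows-other b x n1 n2 rewrite ≡ᵇ-false x b n1 | ≡ᵇ-false x (suc b) n2 = refl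

oneRow : ℕ → ℕ → Bool
oneRow r x = x ≡ᵇ r

oneRow-hit : ∀ r → oneRow r r ≡ true
oneRow-hit r = ≡ᵇ-true r r refl

oneRow-other : ∀ r x → x ≢ r → oneRow r x ≡ false
oneRow-other r x ne = ≡ᵇ-false x r ne

-- The shared-cell case: λ/κ horizontal in row b+1, λ/ρ vertical in rows
-- b, b+1.  The preimage ν is λ with rows b, b+1 shortened by 2; below, ν is
-- built (ν-partition), shown to sit under κ and ρ by a horizontal and a
-- vertical domino in row b (ν-horizontal, ν-vertical), and the rule is
-- evaluated through sharedRow ν κ ρ = just b.
module SharedPreimage (κ ρ λ' : Part) (b : ℕ) (pκ : IsPartition κ) (pρ : IsPartition ρ) (pλ : IsPartition λ')
                      (n3 : κ ≢ ρ) (hs : HStep κ λ' (suc b)) (vs : VStep ρ λ' b) where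
  open HStep hs renaming (hs1 to h1; hs2 to h2)
  open VStep vs renaming (vs0 to v0; vs1 to v1; vs2 to v2; vs3 to v3)

  q = κ ! suc b
  Lb1 : λ' ! suc b ≡ suc (suc q)
  Lb1 = trans h1 (+2≡suc-suc q)
  Lb : λ' ! b ≡ suc (suc q)
  Lb = trans v1 (trans (sym v2) Lb1)
  κb : κ ! b ≡ suc (suc q)
  κb = trans (sym (h2 b (n≢1+n b))) Lb
  ρb : ρ ! b ≡ suc q
  ρb = suc-injective (trans (sym v1) Lb)
  ρb1 : ρ ! suc b ≡ suc q
  ρb1 = trans v0 ρb
  f = lowerRows (twoRows b) 2 λ'
  fb : f b ≡ q
  fb = trans (lowerRows-hit (twoRows b) 2 λ' b (twoRows-first b)) (cong (_∸ 2) Lb)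
  fb1 : f (suc b) ≡ q
  fb1 = trans (lowerRows-hit (twoRows b) 2 λ' (suc b) (twoRows-second b)) (cong (_∸ 2) Lb1)
  fo : ∀ x → x ≢ b → x ≢ suc b → f x ≡ λ' ! x
  fo x n1 n2 = lowerRows-miss (twoRows b) 2 λ' x (twoRows-other b x n1 n2)
  fa : ∀ x → f (suc x) ≤ f x
  fa x with suc x ≟ b | x ≟ b | x ≟ suc b
  ... | yes refl | _ | _ = subst₂ _≤_ (sym fb) (sym (fo x (n≢1+n x) (n≢2+n x))) (≤-trans (≤-trans (n≤1+n q) (n≤1+n (suc q))) (≤-trans (≤-reflexive (sym Lb)) (decr (partition-decr pλ) x)))
  ... | no _ | yes refl | _ = ≤-reflexive (trans fb1 (sym fb))
  ... | no _ | no _ | yes refl = subst (_≤ f (suc b)) (sym (fo (suc (suc b)) (λ e → n≢2+n b (sym e)) (λ e → n≢1+n (suc b) (sym e))))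
           (subst (λ z → λ' ! suc (suc b) ≤ z) (sym fb1) (subst (_≤ q) (sym (h2 (suc (suc b)) (λ e → n≢1+n (suc b) (sym e)))) (decr (partition-decr pκ) (suc b))))
  ... | no n0 | no n1 | no n2 = subst₂ _≤_ (sym (fo (suc x) n0 (λ e → n1 (suc-injective e)))) (sym (fo x n1 n2)) (decr (partition-decr pλ) x)
  LS = lowerRows-partition (twoRows b) 2 λ' fa
  ν = fromFun f (length λ')
  ν-partition : IsPartition ν
  ν-partition = proj₂ LS
  νf : ∀ x → ν ! x ≡ f x
  νf = proj₁ LS
  ν-horizontal : HStep ν κ b
  ν-horizontal = mkH (trans κb (trans (sym (+2≡suc-suc q)) (cong (_+ 2) (sym (trans (νf b) fb))))) g
    where
    g : ∀ x → x ≢ b → κ ! x ≡ ν ! x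
    g x ne with x ≟ suc b
    ... | yes refl = sym (trans (νf (suc b)) fb1)
    ... | no ne2 = trans (sym (h2 x ne2)) (sym (trans (νf x) (fo x ne ne2)))
  ν-vertical : VStep ν ρ b
  ν-vertical = mkV (trans (νf (suc b)) (trans fb1 (sym (trans (νf b) fb)))) (trans ρb (cong suc (sym (trans (νf b) fb))))
            (trans ρb1 (cong suc (sym (trans (νf b) fb)))) (λ x n1 n2 → trans (sym (v3 x n1 n2)) (sym (trans (νf x) (fo x n1 n2))))
  stκ : Step ν κ
  stκ = ν-partition , pκ , inj₁ (b , ν-horizontal)
  stρ : Step ν ρ
  stρ = ν-partition , pρ , inj₂ (b , ν-vertical)
  valid : Valid zer ν κ ρ
  valid = ν-partition , pκ , pρ , inj₂ stκ , inj₂ stρ , inj₁ refl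
  νb : ν ! b ≡ q
  νb = trans (νf b) fb
  shared-row : sharedRow ν κ ρ ≡ just b
  shared-row = fw-just _ (λ z → z) _ b (<-≤-trans (row-inside κ b (subst (0 <_) (sym κb) z<s)) (m≤m⊔n _ _)) tb fy
    where
    tb : (((ν ! b) <ᵇ (κ ! b)) ∧ ((ν ! b) <ᵇ (ρ ! b))) ≡ true
    tb rewrite <ᵇ-true (ν ! b) (κ ! b) (subst₂ _<_ (sym νb) (sym κb) (≤-trans (n<1+n q) (n≤1+n (suc q))))
             | <ᵇ-true (ν ! b) (ρ ! b) (subst₂ _<_ (sym νb) (sym ρb) (n<1+n q)) = refl
    fy : ∀ y → y < b → (((ν ! y) <ᵇ (κ ! y)) ∧ ((ν ! y) <ᵇ (ρ ! y))) ≡ false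
    fy y l rewrite <ᵇ-false (ν ! y) (κ ! y) (λ l2 → <-irrefl (trans (νf y) (trans (fo y (<⇒≢ l) (<⇒≢ (m<n⇒m<1+n l))) (h2 y (<⇒≢ (m<n⇒m<1+n l))))) l2) = refl
  pw : ∀ x → addCell (suc b) (suc (ν ! b)) (union κ ρ) ! x ≡ λ' ! x
  pw x with x ≟ suc b
  ... | yes refl = trans (raiseRow-here (suc b) _ (union κ ρ))
        (trans (cong₂ _⊔_ (trans (union-row κ ρ (suc b)) (trans (cong₂ _⊔_ refl ρb1) (m≤n⇒m⊔n≡n (n≤1+n q)))) (cong (λ z → suc (suc z)) νb))
          (trans (m≤n⇒m⊔n≡n (n≤1+n (suc q))) (sym Lb1)))
  ... | no ne = trans (raiseRow-elsewhere (suc b) _ (union κ ρ) x ne) (trans (union-row κ ρ x) g)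
    where
    g : κ ! x ⊔ ρ ! x ≡ λ' ! x
    g with x ≟ b
    ... | yes refl = trans (cong₂ _⊔_ κb ρb) (trans (m≥n⇒m⊔n≡m (n≤1+n (suc q))) (sym Lb))
    ... | no ne2 = trans (cong₂ _⊔_ (sym (h2 x ne)) (sym (v3 x ne2 ne))) (⊔-idem _)
  Lform : localZero ν κ ρ ≡ addCell (suc b) (suc (ν ! b)) (union κ ρ)
  Lform = trans (localZero-distinct ν κ ρ (Step-ne stκ) (Step-ne stρ) n3) (cong (unionPlus ν κ ρ) shared-row)
  rule-value : localZero ν κ ρ ≡ λ'
  rule-value = partition-ext (rule-partition pκ pρ (rule-case zer ν κ ρ valid)) pλ (λ x → trans (cong (λ l → l ! x) Lform) (pw x))

preimage-shared : ∀ κ ρ λ' b → IsPartition κ → IsPartition ρ → IsPartition λ' → κ ≢ ρ → HStep κ λ' (suc b) → VStep ρ λ' b → Preimage κ ρ λ'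
preimage-shared κ ρ λ' b pκ pρ pλ n3 hs vs = ν , zer , valid , rule-value
  where open SharedPreimage κ ρ λ' b pκ pρ pλ n3 hs vs

VStep-above : ∀ {κ λ' h} → IsPartition λ' → VStep κ λ' h → ∀ y → y < h → suc (κ ! h) ≤ κ ! y
VStep-above {κ} {λ'} {h} pλ (mkV v0 v1 v2 v3) y l =
  subst₂ _≤_ v1 (v3 y (<⇒≢ l) (<⇒≢ (m<n⇒m<1+n l))) (decr-antitone (partition-decr pλ) (<⇒≤ l))

remove-horizontal : ∀ κ r → IsPartition κ → κ ! suc r + 2 ≤ κ ! r → Σ Part λ ν → IsPartition ν × HStep ν κ r
remove-horizontal κ r pκ big = ν , pν , hsν
  where
  two : 2 ≤ κ ! r
  two = ≤-trans (m≤n+m 2 _) big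
  f = lowerRows (oneRow r) 2 κ
  fr : f r ≡ κ ! r ∸ 2
  fr = lowerRows-hit (oneRow r) 2 κ r (oneRow-hit r)
  fo : ∀ x → x ≢ r → f x ≡ κ ! x
  fo x ne = lowerRows-miss (oneRow r) 2 κ x (oneRow-other r x ne)
  fa : ∀ x → f (suc x) ≤ f x
  fa x with suc x ≟ r | x ≟ r
  ... | yes refl | _ = subst₂ _≤_ (sym fr) (sym (fo x (n≢1+n x))) (≤-trans (m∸n≤m _ 2) (decr (partition-decr pκ) x))
  ... | no _ | yes refl = subst₂ _≤_ (sym (fo (suc r) 1+n≢n)) (sym fr) (m+n≤o⇒m≤o∸n (κ ! suc r) big)
  ... | no n1 | no n2 = subst₂ _≤_ (sym (fo (suc x) n1)) (sym (fo x n2)) (decr (partition-decr pκ) x)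
  LS = lowerRows-partition (oneRow r) 2 κ fa
  ν = fromFun f (length κ)
  pν = proj₂ LS
  νf = proj₁ LS
  hsν : HStep ν κ r
  hsν = mkH (sym (trans (cong (_+ 2) (trans (νf r) fr)) (m∸n+n≡m two))) (λ x ne → sym (trans (νf x) (fo x ne)))

remove-vertical : ∀ κ g c → IsPartition κ → κ ! g ≡ suc c → κ ! suc g ≡ suc c → κ ! suc (suc g) ≤ c
                → Σ Part λ ν → IsPartition ν × VStep ν κ g
remove-vertical κ g c pκ kg kg1 kt = ν , pν , vsν
  where
  f = lowerRows (twoRows g) 1 κ
  fg : f g ≡ c
  fg = trans (lowerRows-hit (twoRows g) 1 κ g (twoRows-first g)) (cong (_∸ 1) kg)
  fg1 : f (suc g) ≡ c
  fg1 = trans (lowerRows-hit (twoRows g) 1 κ (suc g) (twoRows-second g)) (cong (_∸ 1) kg1)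
  fo : ∀ x → x ≢ g → x ≢ suc g → f x ≡ κ ! x
  fo x n1 n2 = lowerRows-miss (twoRows g) 1 κ x (twoRows-other g x n1 n2)
  fa : ∀ x → f (suc x) ≤ f x
  fa x with suc x ≟ g | x ≟ g | x ≟ suc g
  ... | yes refl | _ | _ = subst₂ _≤_ (sym fg) (sym (fo x (n≢1+n x) (n≢2+n x))) (≤-trans (n≤1+n c) (≤-trans (≤-reflexive (sym kg)) (decr (partition-decr pκ) x)))
  ... | no _ | yes refl | _ = ≤-reflexive (trans fg1 (sym fg))
  ... | no _ | no _ | yes refl = subst₂ _≤_ (sym (fo (suc (suc g)) (λ e → n≢2+n g (sym e)) (λ e → n≢1+n (suc g) (sym e)))) (sym fg1) kt
  ... | no n0 | no n1 | no n2 = subst₂ _≤_ (sym (fo (suc x) n0 (λ e → n1 (suc-injective e)))) (sym (fo x n1 n2)) (decr (partition-decr pκ) x)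
  LS = lowerRows-partition (twoRows g) 1 κ fa
  ν = fromFun f (length κ)
  pν = proj₂ LS
  νf = proj₁ LS
  νg : ν ! g ≡ c
  νg = trans (νf g) fg
  vsν : VStep ν κ g
  vsν = mkV (trans (trans (νf (suc g)) fg1) (sym νg)) (trans kg (cong suc (sym νg))) (trans kg1 (cong suc (sym νg)))
            (λ x n1 n2 → sym (trans (νf x) (fo x n1 n2)))

-- κ = ρ and λ/κ vertical, not in column 0: ν is κ with a vertical domino
-- removed from the previous column.
preimage-same-vertical : ∀ κ λ' → IsPartition κ → IsPartition λ' → ∀ h c → VStep κ λ' h → κ ! h ≡ suc c → Preimage κ κ λ'
preimage-same-vertical κ λ' pκ pλ h c v eh = go (colHeight c κ) refl
  where
  sp = colHeight-spec c κ (proj₂ pκ)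
  eh1 : κ ! suc h ≡ suc c
  eh1 = trans (VStep.vs0 v) eh
  go : ∀ t → t ≡ colHeight c κ → Preimage κ κ λ'
  go zero e = ⊥-elim (<⇒≱ (subst (c <_) (sym eh) (n<1+n c)) (≤-trans (decr-antitone (partition-decr pκ) z≤n) (subst (λ z → κ ! z ≤ c) (sym e) (proj₂ sp))))
  go (suc zero) e = ⊥-elim (<⇒≱ (subst (c <_) (sym eh1) (n<1+n c)) (≤-trans (decr-antitone (partition-decr pκ) (s≤s z≤n)) (subst (λ z → κ ! z ≤ c) (sym e) (proj₂ sp))))
  go (suc (suc g)) e = ν , zer , valid , eq
    where
    tl : ∀ y → y < suc (suc g) → c < κ ! y
    tl y l = proj₁ sp y (subst (y <_) e l)
    kt : κ ! suc (suc g) ≤ c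
    kt = subst (λ z → κ ! z ≤ c) (sym e) (proj₂ sp)
    hg : h ≤ g
    hg with h ≤? g
    ... | yes q = q
    ... | no q = ⊥-elim (<⇒≱ (subst (c <_) (sym eh1) (n<1+n c)) (≤-trans (decr-antitone (partition-decr pκ) (s≤s (≰⇒> q))) kt))
    kg : κ ! g ≡ suc c
    kg = ≤-antisym (subst (κ ! g ≤_) eh (decr-antitone (partition-decr pκ) hg)) (tl g (≤-trans (n<1+n g) (n≤1+n (suc g))))
    kg1 : κ ! suc g ≡ suc c
    kg1 = ≤-antisym (subst (κ ! suc g ≤_) eh (decr-antitone (partition-decr pκ) (≤-trans hg (n≤1+n g)))) (tl (suc g) (n<1+n (suc g)))
    R = remove-vertical κ g c pκ kg kg1 kt
    ν = proj₁ R
    pν = proj₁ (proj₂ R)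
    vsν = proj₂ (proj₂ R)
    stν : Step ν κ
    stν = pν , pκ , inj₂ (g , vsν)
    valid : Valid zer ν κ κ
    valid = pν , pκ , pκ , inj₂ stν , inj₂ stν , inj₁ refl
    hh : h ≡ colHeight (suc c) κ
    hh = colHeight-unique (suc c) κ h (partition-decr pκ) (λ y l → subst (λ z → suc z ≤ κ ! y) eh (VStep-above pλ v y l)) (≤-reflexive eh)
    C = colHeight-at κ h (suc c) pκ eh eh1
    A = addV-spec κ (suc c) pκ (proj₁ C) (proj₂ C)
    vs' : VStep κ (addV (suc c) κ) h
    vs' = subst (VStep κ (addV (suc c) κ)) (sym hh) (proj₂ A)
    eq : localZero ν κ κ ≡ λ'
    eq = trans (localZero-same ν κ (Step-ne stν)) (trans (sameRule-vertical ν κ g vsν) (trans (cong (λ z → addV z κ) kg) (VStep-unique-target (proj₁ (proj₂ (proj₁ A))) pλ vs' v)))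

-- The case κ = ρ (so λ/κ comes from an entry ±1 or from sameRule).
preimage-same : ∀ κ λ' → IsPartition κ → IsPartition λ' → Step κ λ' → Preimage κ κ λ'
preimage-same κ λ' pκ pλ (_ , _ , inj₁ (zero , h)) = κ , one , (pκ , pκ , pκ , inj₁ refl , inj₁ refl , inj₂ (refl , refl)) ,
  HStep-unique-target (proj₁ (proj₂ (proj₁ A))) pλ (proj₂ A) h
  where A = addH-spec κ 0 pκ (λ r' ())
preimage-same κ λ' pκ pλ (_ , _ , inj₁ (suc r , h@(mkH h1 h2))) = ν , zer , valid , eq
  where
  big : κ ! suc r + 2 ≤ κ ! r
  big = subst₂ _≤_ h1 (h2 r (n≢1+n r)) (decr (partition-decr pλ) r)
  R = remove-horizontal κ r pκ big
  ν = proj₁ R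
  pν = proj₁ (proj₂ R)
  hsν = proj₂ (proj₂ R)
  stν : Step ν κ
  stν = pν , pκ , inj₁ (r , hsν)
  valid : Valid zer ν κ κ
  valid = pν , pκ , pκ , inj₂ stν , inj₂ stν , inj₁ refl
  A = addH-spec κ (suc r) pκ (λ r' e → subst (λ z → κ ! suc r + 2 ≤ κ ! z) (suc-injective e) big)
  eq : localZero ν κ κ ≡ λ'
  eq = trans (localZero-same ν κ (Step-ne stν)) (trans (sameRule-horizontal ν κ r hsν) (HStep-unique-target (proj₁ (proj₂ (proj₁ A))) pλ (proj₂ A) h))
preimage-same κ λ' pκ pλ (_ , _ , inj₂ (h , v)) with κ ! h in eh
... | zero = κ , mone , (pκ , pκ , pκ , inj₁ refl , inj₁ refl , inj₂ (refl , refl)) , VStep-unique-target (proj₁ (proj₂ (proj₁ A))) pλ vs' v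
  where
  C = colHeight-zero κ pκ
  A = addV-spec κ 0 pκ (proj₁ C) (proj₂ C)
  hh : h ≡ colHeight 0 κ
  hh = colHeight-unique 0 κ h (partition-decr pκ) (λ y l → ≤-trans (s≤s z≤n) (VStep-above pλ v y l)) (≤-reflexive eh)
  vs' : VStep κ (addV 0 κ) h
  vs' = subst (VStep κ (addV 0 κ)) (sym hh) (proj₂ A)
... | suc c = preimage-same-vertical κ λ' pκ pλ h c v eh

HVb-contra : ∀ {κ ρ λ' b} → IsPartition κ → HStep κ λ' b → VStep ρ λ' b → ⊥
HVb-contra {κ} {ρ} {λ'} {b} pκ (mkH h1 h2) (mkV v0 v1 v2 v3) =
  <⇒≱ (subst (κ ! b <_) (sym E) (m<m+n (κ ! b) {2} z<s)) (decr (partition-decr pκ) b)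
  where
  E : κ ! suc b ≡ κ ! b + 2
  E = trans (sym (h2 (suc b) 1+n≢n)) (trans v2 (trans (sym v1) h1))

VVb-contra : ∀ {κ ρ λ' a} → IsPartition κ → VStep κ λ' a → VStep ρ λ' (suc a) → ⊥
VVb-contra {κ} {ρ} {λ'} {a} pκ (mkV v0 v1 v2 v3) (mkV w0 w1 w2 w3) =
  <⇒≱ (subst (κ ! suc a <_) (sym E) (n<1+n _)) (decr (partition-decr pκ) (suc a))
  where
  E : κ ! suc (suc a) ≡ suc (κ ! suc a)
  E = trans (sym (v3 (suc (suc a)) (λ e → n≢2+n a (sym e)) (λ e → n≢1+n (suc a) (sym e))))
       (trans w2 (trans (sym w1) (trans v2 (cong suc (sym v0)))))

preimage-mixed : ∀ κ ρ λ' a b → IsPartition κ → IsPartition ρ → IsPartition λ' → κ ≢ ρ → Step κ λ' → Step ρ λ' → HStep κ λ' a → VStep ρ λ' b → Preimage κ ρ λ'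
preimage-mixed κ ρ λ' a b pκ pρ pλ n3 sκ sρ h v with a ≟ b | a ≟ suc b
... | yes refl | _ = ⊥-elim (HVb-contra pκ h v)
... | no _ | yes refl = preimage-shared κ ρ λ' b pκ pρ pλ n3 h v
... | no n1 | no n2 = preimage-disjoint κ ρ λ' sκ sρ n3 dj
  where
  dj : ∀ x → κ ! x < λ' ! x → ρ ! x < λ' ! x → ⊥
  dj x l1 l2 with HStep-rows h x l1 | VStep-rows v x l2
  ... | refl | inj₁ e = n1 e
  ... | refl | inj₂ e = n2 e

preimage-distinct : ∀ κ ρ λ' → IsPartition κ → IsPartition ρ → IsPartition λ' → κ ≢ ρ → Step κ λ' → Step ρ λ' → Preimage κ ρ λ'
preimage-distinct κ ρ λ' pκ pρ pλ n3 sκ@(_ , _ , inj₁ (a , h)) sρ@(_ , _ , inj₁ (b , k)) with a ≟ b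
... | yes refl = ⊥-elim (n3 (HStep-unique-source pκ pρ h k))
... | no ne = preimage-disjoint κ ρ λ' sκ sρ n3 (λ x l1 l2 → ne (trans (sym (HStep-rows h x l1)) (HStep-rows k x l2)))
preimage-distinct κ ρ λ' pκ pρ pλ n3 sκ@(_ , _ , inj₁ (a , h)) sρ@(_ , _ , inj₂ (b , v)) = preimage-mixed κ ρ λ' a b pκ pρ pλ n3 sκ sρ h v
preimage-distinct κ ρ λ' pκ pρ pλ n3 sκ@(_ , _ , inj₂ (a , v)) sρ@(_ , _ , inj₁ (b , h)) = Preimage-swap (preimage-mixed ρ κ λ' b a pρ pκ pλ (λ e → n3 (sym e)) sρ sκ h v)
preimage-distinct κ ρ λ' pκ pρ pλ n3 sκ@(_ , _ , inj₂ (a , v)) sρ@(_ , _ , inj₂ (b , w)) with a ≟ b | b ≟ suc a | a ≟ suc b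
... | yes refl | _ | _ = ⊥-elim (n3 (VStep-unique-source pκ pρ v w))
... | no _ | yes refl | _ = ⊥-elim (VVb-contra pκ v w)
... | no _ | no _ | yes refl = ⊥-elim (VVb-contra pρ w v)
... | no n1 | no n2 | no n4 = preimage-disjoint κ ρ λ' sκ sρ n3 dj
  where
  dj : ∀ x → κ ! x < λ' ! x → ρ ! x < λ' ! x → ⊥
  dj x l1 l2 with VStep-rows v x l1 | VStep-rows w x l2
  ... | inj₁ refl | inj₁ e = n1 e
  ... | inj₁ refl | inj₂ e = n4 e
  ... | inj₂ refl | inj₁ e = n2 (sym e)
  ... | inj₂ refl | inj₂ e = n1 (suc-injective e)

local-surjective : ∀ κ ρ λ' → IsPartition κ → IsPartition ρ → IsPartition λ' → LeD κ λ' → LeD ρ λ' → Preimage κ ρ λ'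
local-surjective κ ρ λ' pκ pρ pλ lκ lρ with κ ≟P λ' | ρ ≟P λ'
... | yes refl | _ = ρ , zer , (pρ , pκ , pρ , lρ , inj₁ refl , inj₁ refl) , localZero-ν≡ρ ρ κ
... | no nk | yes refl = κ , zer , (pκ , pκ , pρ , inj₁ refl , lκ , inj₁ refl) , localZero-ν≡κ κ ρ
... | no nk | no nr with κ ≟P ρ
... | yes refl = preimage-same κ λ' pκ pλ (strict-step lκ nk)
... | no n3 = preimage-distinct κ ρ λ' pκ pρ pλ n3 (strict-step lκ nk) (strict-step lρ nr)

Preimage-swap-data : ∀ {κ ρ λ'} (Y : Preimage ρ κ λ') → (proj₁ (Preimage-swap Y) ≡ proj₁ Y) × (proj₁ (proj₂ (Preimage-swap Y)) ≡ proj₁ (proj₂ Y))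
Preimage-swap-data (ν , zer , v , eq) = refl , refl
Preimage-swap-data (ν , one , (_ , _ , _ , _ , _ , inj₁ ()) , eq)
Preimage-swap-data (ν , one , (_ , _ , _ , _ , _ , inj₂ (refl , refl)) , eq) = refl , refl
Preimage-swap-data (ν , mone , (_ , _ , _ , _ , _ , inj₁ ()) , eq)
Preimage-swap-data (ν , mone , (_ , _ , _ , _ , _ , inj₂ (refl , refl)) , eq) = refl , refl

preimage-unique : ∀ {κ ρ λ'} (X Y : Preimage κ ρ λ') → (proj₁ X ≡ proj₁ Y) × (proj₁ (proj₂ X) ≡ proj₁ (proj₂ Y))
preimage-unique (ν , e , v , eq) (ν' , e' , v' , eq') = local-cancel v v' (trans eq (sym eq'))

preimage-unique-swapped : ∀ {κ ρ λ' κ' ρ' λ''} → κ ≡ ρ' → ρ ≡ κ' → λ' ≡ λ'' → (X : Preimage κ ρ λ') (Y : Preimage κ' ρ' λ'')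
      → (proj₁ X ≡ proj₁ Y) × (proj₁ (proj₂ X) ≡ proj₁ (proj₂ Y))
preimage-unique-swapped refl refl refl X Y with preimage-unique X (Preimage-swap Y) | Preimage-swap-data Y
... | a , b | c , d = trans a c , trans b d

λ≡ρ⇒ν≡κ : ∀ {e ν κ ρ λ'} → RuleCase e ν κ ρ λ' → λ' ≡ ρ → (e ≡ zer) × (ν ≡ κ)
λ≡ρ⇒ν≡κ (c-eqκ a b _) l = a , b
λ≡ρ⇒ν≡κ (c-eqρ _ b ne k) l = ⊥-elim (ne (trans b (trans (sym l) k)))
λ≡ρ⇒ν≡κ (c-union _ _ _ _ _ s _ _) l = ⊥-elim (Step-ne s (sym l))
λ≡ρ⇒ν≡κ (c-shared _ _ _ _ d) l = ⊥-elim (Step-ne (SharedCell.sρ d) (sym l))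
λ≡ρ⇒ν≡κ (c-sameH _ e _ _ _ s _) l = ⊥-elim (Step-ne s (trans e (sym l)))
λ≡ρ⇒ν≡κ (c-sameV _ e _ _ _ _ s _ _) l = ⊥-elim (Step-ne s (trans e (sym l)))
λ≡ρ⇒ν≡κ (c-one _ a b s _) l = ⊥-elim (Step-ne s (trans (trans (sym a) b) (sym l)))
λ≡ρ⇒ν≡κ (c-mone _ a b _ s _ _) l = ⊥-elim (Step-ne s (trans (trans (sym a) b) (sym l)))

λ≡κ⇒ν≡ρ : ∀ {e ν κ ρ λ'} → RuleCase e ν κ ρ λ' → λ' ≡ κ → (e ≡ zer) × (ν ≡ ρ)
λ≡κ⇒ν≡ρ (c-eqκ a b l) k = a , trans b (trans (sym k) l)
λ≡κ⇒ν≡ρ (c-eqρ a b _ _) k = a , b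
λ≡κ⇒ν≡ρ (c-union _ _ _ _ s _ _ _) l = ⊥-elim (Step-ne s (sym l))
λ≡κ⇒ν≡ρ (c-shared _ _ _ _ d) l = ⊥-elim (Step-ne (SharedCell.sκ d) (sym l))
λ≡κ⇒ν≡ρ (c-sameH _ e _ _ _ s _) l = ⊥-elim (Step-ne s (sym l))
λ≡κ⇒ν≡ρ (c-sameV _ e _ _ _ _ s _ _) l = ⊥-elim (Step-ne s (sym l))
λ≡κ⇒ν≡ρ (c-one _ a b s _) l = ⊥-elim (Step-ne s (sym l))
λ≡κ⇒ν≡ρ (c-mone _ a b _ s _ _) l = ⊥-elim (Step-ne s (sym l))

ν≡κ⇒λ≡ρ : ∀ {e ν κ ρ λ'} → RuleCase e ν κ ρ λ' → e ≡ zer → ν ≡ κ → λ' ≡ ρ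
ν≡κ⇒λ≡ρ (c-eqκ _ _ l) _ _ = l
ν≡κ⇒λ≡ρ (c-eqρ _ _ ne _) _ q = ⊥-elim (ne q)
ν≡κ⇒λ≡ρ (c-union _ _ s _ _ _ _ _) _ q = ⊥-elim (Step-ne s q)
ν≡κ⇒λ≡ρ (c-shared _ _ s _ _) _ q = ⊥-elim (Step-ne s q)
ν≡κ⇒λ≡ρ (c-sameH _ _ _ s _ _ _) _ q = ⊥-elim (Step-ne s q)
ν≡κ⇒λ≡ρ (c-sameV _ _ _ _ s _ _ _ _) _ q = ⊥-elim (Step-ne s q)
ν≡κ⇒λ≡ρ (c-one () _ _ _ _) refl _
ν≡κ⇒λ≡ρ (c-mone () _ _ _ _ _ _) refl _

ν≡ρ⇒λ≡κ : ∀ {e ν κ ρ λ'} → RuleCase e ν κ ρ λ' → e ≡ zer → ν ≡ ρ → λ' ≡ κ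
ν≡ρ⇒λ≡κ (c-eqκ _ a l) _ q = trans l (trans (sym q) a)
ν≡ρ⇒λ≡κ (c-eqρ _ _ _ l) _ _ = l
ν≡ρ⇒λ≡κ (c-union _ _ _ s _ _ _ _) _ q = ⊥-elim (Step-ne s q)
ν≡ρ⇒λ≡κ (c-shared _ _ _ s _) _ q = ⊥-elim (Step-ne s q)
ν≡ρ⇒λ≡κ (c-sameH _ e _ s _ _ _) _ q = ⊥-elim (Step-ne s (trans q (sym e)))
ν≡ρ⇒λ≡κ (c-sameV _ e _ _ s _ _ _ _) _ q = ⊥-elim (Step-ne s (trans q (sym e)))
ν≡ρ⇒λ≡κ (c-one () _ _ _ _) refl _
ν≡ρ⇒λ≡κ (c-mone () _ _ _ _ _ _) refl _

rule-edges : ∀ {e ν κ ρ λ'} → LeD ν κ → LeD ν ρ → RuleCase e ν κ ρ λ' → LeD κ λ' × LeD ρ λ'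
rule-edges lκ lρ (c-eqκ _ a l) = subst₂ LeD a (sym l) lρ , inj₁ (sym l)
rule-edges lκ lρ (c-eqρ _ b _ l) = inj₁ (sym l) , subst₂ LeD b (sym l) lκ
rule-edges _ _ (c-union _ _ _ _ s t _ _) = inj₂ s , inj₂ t
rule-edges _ _ (c-shared _ _ _ _ d) = inj₂ (SharedCell.sκ d) , inj₂ (SharedCell.sρ d)
rule-edges _ _ (c-sameH _ e _ _ _ s _) = inj₂ s , subst (λ z → LeD z _) e (inj₂ s)
rule-edges _ _ (c-sameV _ e _ _ _ _ s _ _) = inj₂ s , subst (λ z → LeD z _) e (inj₂ s)
rule-edges _ _ (c-one _ a b s _) = inj₂ s , subst (λ z → LeD z _) (trans (sym a) b) (inj₂ s)
rule-edges _ _ (c-mone _ a b _ s _ _) = inj₂ s , subst (λ z → LeD z _) (trans (sym a) b) (inj₂ s)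

module CellFacts {e ν κ ρ} (v : Valid e ν κ ρ) where
  F : RuleCase e ν κ ρ (local e ν κ ρ)
  F = rule-case e ν κ ρ v
  pλ : IsPartition (local e ν κ ρ)
  pλ = rule-partition (proj₁ (proj₂ v)) (proj₁ (proj₂ (proj₂ v))) F
  le : LeD κ (local e ν κ ρ) × LeD ρ (local e ν κ ρ)
  le = rule-edges (proj₁ (proj₂ (proj₂ (proj₂ v)))) (proj₁ (proj₂ (proj₂ (proj₂ (proj₂ v))))) F

-- Edge a b F packages a ≤_d b together with
-- "a = b iff F", where F says that a nonzero entry lies below (CF) or to the
-- right of (RF) the edge.

Edge : Part → Part → Set → Set
Edge a b F = LeD a b × (a ≡ b → F) × (F → a ≡ b)

isNZ-or-zero : ∀ e → (isNZ e ≡ true) ⊎ (e ≡ zer)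
isNZ-or-zero one = inj₁ refl
isNZ-or-zero mone = inj₁ refl
isNZ-or-zero zer = inj₂ refl

module Growth (n : ℕ) (E : ℕ → ℕ → Entry) (top colL : ℕ → Part) where

  G : ℕ → ℕ → Part
  G zero k = top k
  G (suc i) zero = colL (suc i)
  G (suc i) (suc k) = local (E i k) (G i k) (G i (suc k)) (G (suc i) k)

  NZ : ℕ → ℕ → Set
  NZ i k = isNZ (E i k) ≡ true

  CF : ℕ → ℕ → Set
  CF i k = Σ ℕ λ i' → (i ≤ i') × (i' < n) × NZ i' k

  RF : ℕ → ℕ → Set
  RF i k = Σ ℕ λ k' → (k ≤ k') × (k' < n) × NZ i k'

  record Boundary : Set where
    field
      colU : ∀ i i' k → i < n → i' < n → k < n → NZ i k → NZ i' k → i ≡ i'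
      rowU : ∀ i k k' → i < n → k < n → k' < n → NZ i k → NZ i k' → k ≡ k'
      ptop : ∀ k → k ≤ n → IsPartition (G 0 k)
      pleft : ∀ i → i ≤ n → IsPartition (G i 0)
      etop : ∀ k → k < n → Edge (G 0 k) (G 0 (suc k)) (CF 0 k)
      eleft : ∀ i → i < n → Edge (G i 0) (G (suc i) 0) (RF i 0)

  module Forward (H : Boundary) where
    open Boundary H

    cell-step : ∀ i k → i < n → k < n → IsPartition (G i k) → IsPartition (G i (suc k)) → IsPartition (G (suc i) k)
         → Edge (G i k) (G i (suc k)) (CF i k) → Edge (G i k) (G (suc i) k) (RF i k)
         → IsPartition (G (suc i) (suc k)) × Edge (G i (suc k)) (G (suc i) (suc k)) (RF i (suc k))
           × Edge (G (suc i) k) (G (suc i) (suc k)) (CF (suc i) k)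
    cell-step i k il kl pν pκ pρ (lκ , hκ1 , hκ2) (lρ , hρ1 , hρ2) = C.pλ , (proj₁ C.le , r1 , r2) , (proj₂ C.le , c1 , c2)
      where
      e = E i k
      vd : (e ≡ zer) ⊎ ((G i k ≡ G i (suc k)) × (G i k ≡ G (suc i) k))
      vd with isNZ-or-zero e
      ... | inj₂ z = inj₁ z
      ... | inj₁ t = inj₂ (hκ2 (i , ≤-refl , il , t) , hρ2 (k , ≤-refl , kl , t))
      v : Valid e (G i k) (G i (suc k)) (G (suc i) k)
      v = pν , pκ , pρ , lκ , lρ , vd
      module C = CellFacts v
      r1 : G i (suc k) ≡ G (suc i) (suc k) → RF i (suc k)
      r1 eq with λ≡κ⇒ν≡ρ C.F (sym eq)
      ... | z , q with hρ1 q
      ... | k' , kk , kn , t with k ≟ k'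
      ... | yes refl = ⊥-elim (t≢f (trans (sym t) (cong isNZ z)))
      ... | no ne = k' , ≤∧≢⇒< kk ne , kn , t
      r2 : RF i (suc k) → G i (suc k) ≡ G (suc i) (suc k)
      r2 (k' , kk , kn , t) = sym (ν≡ρ⇒λ≡κ C.F z (hρ2 (k' , ≤-trans (n≤1+n k) kk , kn , t)))
        where
        z : e ≡ zer
        z with isNZ-or-zero e
        ... | inj₂ q = q
        ... | inj₁ t0 = ⊥-elim (<-irrefl (rowU i k k' il kl kn t0 t) (<-≤-trans (n<1+n k) kk))
      c1 : G (suc i) k ≡ G (suc i) (suc k) → CF (suc i) k
      c1 eq with λ≡ρ⇒ν≡κ C.F (sym eq)
      ... | z , q with hκ1 q
      ... | i' , ii , i'n , t with i ≟ i'
      ... | yes refl = ⊥-elim (t≢f (trans (sym t) (cong isNZ z)))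
      ... | no ne = i' , ≤∧≢⇒< ii ne , i'n , t
      c2 : CF (suc i) k → G (suc i) k ≡ G (suc i) (suc k)
      c2 (i' , ii , i'n , t) = sym (ν≡κ⇒λ≡ρ C.F z (hκ2 (i' , ≤-trans (n≤1+n i) ii , i'n , t)))
        where
        z : e ≡ zer
        z with isNZ-or-zero e
        ... | inj₂ q = q
        ... | inj₁ t0 = ⊥-elim (<-irrefl (colU i i' k il i'n kl t0 t) (<-≤-trans (n<1+n i) ii))

    RowInv : ℕ → Set
    RowInv i = (∀ k → k ≤ n → IsPartition (G i k)) × (∀ k → k < n → Edge (G i k) (G i (suc k)) (CF i k))

    next-row : ∀ i → i < n → RowInv i → ∀ k → k ≤ n → IsPartition (G (suc i) k) × Edge (G i k) (G (suc i) k) (RF i k)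
    next-row i il R zero _ = pleft (suc i) il , eleft i il
    next-row i il R (suc k) kl with next-row i il R k (≤-trans (n≤1+n k) kl)
    ... | pρ , eρ with cell-step i k il kl (proj₁ R k (≤-trans (n≤1+n k) kl)) (proj₁ R (suc k) kl) pρ (proj₂ R k kl) eρ
    ... | c1 , c2 , c3 = c1 , c2

    rowStep : ∀ i → i < n → RowInv i → RowInv (suc i)
    rowStep i il R = (λ k kl → proj₁ (next-row i il R k kl)) , he
      where
      he : ∀ k → k < n → Edge (G (suc i) k) (G (suc i) (suc k)) (CF (suc i) k)
      he k kl with next-row i il R k (<⇒≤ kl)
      ... | pρ , eρ with cell-step i k il kl (proj₁ R k (<⇒≤ kl)) (proj₁ R (suc k) kl) pρ (proj₂ R k kl) eρ
      ... | c1 , c2 , c3 = c3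

    row-invariant : ∀ i → i ≤ n → RowInv i
    row-invariant zero _ = ptop , etop
    row-invariant (suc i) il = rowStep i il (row-invariant i (≤-trans (n≤1+n i) il))

    grid-partition : ∀ i k → i ≤ n → k ≤ n → IsPartition (G i k)
    grid-partition i k il kl = proj₁ (row-invariant i il) k kl

    hEdge : ∀ i k → i ≤ n → k < n → Edge (G i k) (G i (suc k)) (CF i k)
    hEdge i k il kl = proj₂ (row-invariant i il) k kl

    vEdge : ∀ i k → i < n → k ≤ n → Edge (G i k) (G (suc i) k) (RF i k)
    vEdge i k il kl = proj₂ (next-row i il (row-invariant i (<⇒≤ il)) k kl)

    validAt : ∀ i k → i < n → k < n → Valid (E i k) (G i k) (G i (suc k)) (G (suc i) k)
    validAt i k il kl = grid-partition i k (<⇒≤ il) (<⇒≤ kl) , grid-partition i (suc k) (<⇒≤ il) kl , grid-partition (suc i) k il (<⇒≤ kl)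
                      , proj₁ (hEdge i k (<⇒≤ il) kl) , proj₁ (vEdge i k il (<⇒≤ kl)) , vd
      where
      vd : (E i k ≡ zer) ⊎ ((G i k ≡ G i (suc k)) × (G i k ≡ G (suc i) k))
      vd with isNZ-or-zero (E i k)
      ... | inj₂ z = inj₁ z
      ... | inj₁ t = inj₂ (proj₂ (proj₂ (hEdge i k (<⇒≤ il) kl)) (i , ≤-refl , il , t) , proj₂ (proj₂ (vEdge i k il (<⇒≤ kl))) (k , ≤-refl , kl , t))

    bottom-step : ∀ k → k < n → Step (G n k) (G n (suc k))
    bottom-step k kl with hEdge n k ≤-refl kl
    ... | l , f , _ = strict-step l (λ e → let (i' , a , b , _) = f e in <-irrefl refl (<-≤-trans b a))

module SymmetricGrowth (n : ℕ) (E : ℕ → ℕ → Entry) (top colL : ℕ → Part) (H : Growth.Boundary n E top colL)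
           (tl : ∀ k → k ≤ n → top k ≡ colL k) (es : ∀ i k → i < n → k < n → E i k ≡ E k i) where
  open Growth n E top colL
  open Forward H

  grid-symmetric : ∀ i k → i ≤ n → k ≤ n → G i k ≡ G k i
  grid-symmetric zero zero _ _ = refl
  grid-symmetric zero (suc k) _ kl = tl (suc k) kl
  grid-symmetric (suc i) zero il _ = sym (tl (suc i) il)
  grid-symmetric (suc i) (suc k) il kl = begin
    local (E i k) (G i k) (G i (suc k)) (G (suc i) k)
      ≡⟨ local-comm (validAt i k il kl) ⟩
    local (E i k) (G i k) (G (suc i) k) (G i (suc k))
      ≡⟨ cong₂ (λ e ν → local e ν (G (suc i) k) (G i (suc k))) (es i k il kl) (grid-symmetric i k i≤n k≤n) ⟩
    local (E k i) (G k i) (G (suc i) k) (G i (suc k))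
      ≡⟨ cong₂ (local (E k i) (G k i)) (grid-symmetric (suc i) k il k≤n) (grid-symmetric i (suc k) i≤n kl) ⟩
    local (E k i) (G k i) (G k (suc i)) (G (suc k) i) ∎
    where
    open ≡-Reasoning
    i≤n = ≤-trans (n≤1+n i) il
    k≤n = ≤-trans (n≤1+n k) kl

-- Indices
-- a, b count from the bottom-right corner (i = n ∸ a, k = n ∸ b).

suc-∸-suc : ∀ n a → a < n → suc (n ∸ suc a) ≡ n ∸ a
suc-∸-suc (suc n) zero _ = refl
suc-∸-suc (suc n) (suc a) (s≤s l) = suc-∸-suc n a l

-- Two valid grids with the same bottom row and right column are equal, and
-- so are their entries: induction from the bottom-right corner using
-- local-cancel.
module BoundaryDetermines (n : ℕ) (E E' : ℕ → ℕ → Entry) (top colL top' colL' : ℕ → Part)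
           (H : Growth.Boundary n E top colL) (H' : Growth.Boundary n E' top' colL')
           (bot : ∀ k → k ≤ n → Growth.G n E top colL n k ≡ Growth.G n E' top' colL' n k)
           (rgt : ∀ i → i ≤ n → Growth.G n E top colL i n ≡ Growth.G n E' top' colL' i n) where
  module A = Growth n E top colL
  module B = Growth n E' top' colL'
  module FA = A.Forward H
  module FB = B.Forward H'

  fromCorner : ∀ a b → a ≤ n → b ≤ n → A.G (n ∸ a) (n ∸ b) ≡ B.G (n ∸ a) (n ∸ b)
  fromCorner zero b _ bl = bot (n ∸ b) (m∸n≤m n b)
  fromCorner (suc a) zero al _ = rgt (n ∸ suc a) (m∸n≤m n (suc a))
  fromCorner (suc a) (suc b) al bl = proj₁ (local-cancel (FA.validAt i k il kl) vB' lam)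
    where
    i = n ∸ suc a
    k = n ∸ suc b
    ei : suc i ≡ n ∸ a
    ei = suc-∸-suc n a al
    ek : suc k ≡ n ∸ b
    ek = suc-∸-suc n b bl
    il : i < n
    il = subst (_≤ n) (sym ei) (m∸n≤m n a)
    kl : k < n
    kl = subst (_≤ n) (sym ek) (m∸n≤m n b)
    κe : A.G i (suc k) ≡ B.G i (suc k)
    κe = subst (λ y → A.G i y ≡ B.G i y) (sym ek) (fromCorner (suc a) b al (≤-trans (n≤1+n b) bl))
    ρe : A.G (suc i) k ≡ B.G (suc i) k
    ρe = subst (λ x → A.G x k ≡ B.G x k) (sym ei) (fromCorner a (suc b) (≤-trans (n≤1+n a) al) bl)
    λe : A.G (suc i) (suc k) ≡ B.G (suc i) (suc k)
    λe = subst₂ (λ x y → A.G x y ≡ B.G x y) (sym ei) (sym ek) (fromCorner a b (≤-trans (n≤1+n a) al) (≤-trans (n≤1+n b) bl))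
    vB' : Valid (E' i k) (B.G i k) (A.G i (suc k)) (A.G (suc i) k)
    vB' = subst₂ (Valid (E' i k) (B.G i k)) (sym κe) (sym ρe) (FB.validAt i k il kl)
    lam : local (E i k) (A.G i k) (A.G i (suc k)) (A.G (suc i) k) ≡ local (E' i k) (B.G i k) (A.G i (suc k)) (A.G (suc i) k)
    lam = trans λe (cong₂ (local (E' i k) (B.G i k)) (sym κe) (sym ρe))

  grid-equal : ∀ i k → i ≤ n → k ≤ n → A.G i k ≡ B.G i k
  grid-equal i k il kl = subst₂ (λ x y → A.G x y ≡ B.G x y) (m∸[m∸n]≡n il) (m∸[m∸n]≡n kl) (fromCorner (n ∸ i) (n ∸ k) (m∸n≤m n i) (m∸n≤m n k))

  entries-equal : ∀ i k → i < n → k < n → E i k ≡ E' i k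
  entries-equal i k il kl = proj₂ (local-cancel (FA.validAt i k il kl) vB' lam)
    where
    κe = grid-equal i (suc k) (<⇒≤ il) kl
    ρe = grid-equal (suc i) k il (<⇒≤ kl)
    vB' : Valid (E' i k) (B.G i k) (A.G i (suc k)) (A.G (suc i) k)
    vB' = subst₂ (Valid (E' i k) (B.G i k)) (sym κe) (sym ρe) (FB.validAt i k il kl)
    lam : local (E i k) (A.G i k) (A.G i (suc k)) (A.G (suc i) k) ≡ local (E' i k) (B.G i k) (A.G i (suc k)) (A.G (suc i) k)
    lam = trans (grid-equal (suc i) (suc k) il kl) (cong₂ (local (E' i k) (B.G i k)) (sym κe) (sym ρe))

chain-reversed : ∀ n (f : ℕ → Part) → (∀ j → j < n → Step (f j) (f (suc j))) → ∀ a → LeD (f (n ∸ suc a)) (f (n ∸ a))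
chain-reversed n f s a with a <? n
... | yes l = inj₂ (subst (λ z → Step (f (n ∸ suc a)) (f z)) (suc-∸-suc n a l) (s (n ∸ suc a) (<-≤-trans (subst (n ∸ suc a <_) (suc-∸-suc n a l) (n<1+n _)) (m∸n≤m n a))))
... | no nl = inj₁ (cong f (trans (m≤n⇒m∸n≡0 (≤-trans (≮⇒≥ nl) (n≤1+n a))) (sym (m≤n⇒m∸n≡0 (≮⇒≥ nl)))))

-- Backward growth: given domino chains B (bottom row) and Rc (right column)
-- meeting at a common corner, Hd a b is filled in from the corner by
-- local-surjective, simultaneously proving that the shapes are partitions
-- (pp) and the edges are ≤_d steps (od, or).
module Backward (n : ℕ) (B Rc : ℕ → Part)
          (pB : ∀ k → k ≤ n → IsPartition (B k)) (pR : ∀ i → i ≤ n → IsPartition (Rc i))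
          (sB : ∀ k → k < n → Step (B k) (B (suc k))) (sR : ∀ i → i < n → Step (Rc i) (Rc (suc i)))
          (corner : B n ≡ Rc n) where

  mutual
    Hd : ℕ → ℕ → Part
    Hd zero b = B (n ∸ b)
    Hd (suc a) zero = Rc (n ∸ suc a)
    Hd (suc a) (suc b) = proj₁ (X a b)

    OD : ℕ → ℕ → Set
    OD zero b = ⊤
    OD (suc a) b = LeD (Hd (suc a) b) (Hd a b)

    OR : ℕ → ℕ → Set
    OR a zero = ⊤
    OR a (suc b) = LeD (Hd a (suc b)) (Hd a b)

    pp : ∀ a b → IsPartition (Hd a b)
    pp zero b = pB (n ∸ b) (m∸n≤m n b)
    pp (suc a) zero = pR (n ∸ suc a) (m∸n≤m n (suc a))
    pp (suc a) (suc b) = proj₁ (proj₁ (proj₂ (proj₂ (X a b))))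

    od : ∀ a b → OD a b
    od zero b = tt
    od (suc zero) zero = subst (LeD (Rc (n ∸ 1))) (sym corner) (chain-reversed n Rc sR 0)
    od (suc (suc a)) zero = chain-reversed n Rc sR (suc a)
    od (suc a) (suc b) = proj₁ (proj₂ (proj₂ (proj₂ (proj₂ (proj₁ (proj₂ (proj₂ (X a b))))))))

    or : ∀ a b → OR a b
    or a zero = tt
    or zero (suc b) = chain-reversed n B sB b
    or (suc a) (suc b) = proj₁ (proj₂ (proj₂ (proj₂ (proj₁ (proj₂ (proj₂ (X a b)))))))

    X : ∀ a b → Preimage (Hd (suc a) b) (Hd a (suc b)) (Hd a b)
    X a b = local-surjective (Hd (suc a) b) (Hd a (suc b)) (Hd a b) (pp (suc a) b) (pp a (suc b)) (pp a b) (od (suc a) b) (or a (suc b))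

  -- The entries of the backward grid (zer on the boundary).
  Ed : ℕ → ℕ → Entry
  Ed zero b = zer
  Ed (suc a) zero = zer
  Ed (suc a) (suc b) = proj₁ (proj₂ (X a b))

  vX : ∀ a b → Valid (Ed (suc a) (suc b)) (Hd (suc a) (suc b)) (Hd (suc a) b) (Hd a (suc b))
  vX a b = proj₁ (proj₂ (proj₂ (X a b)))

  eX : ∀ a b → local (Ed (suc a) (suc b)) (Hd (suc a) (suc b)) (Hd (suc a) b) (Hd a (suc b)) ≡ Hd a b
  eX a b = proj₂ (proj₂ (proj₂ (X a b)))

  Hn : ℕ → ℕ → Part
  Hn i k = Hd (n ∸ i) (n ∸ k)

  En : ℕ → ℕ → Entry
  En i k = Ed (n ∸ i) (n ∸ k)

  n∸i : ∀ i → i < n → n ∸ i ≡ suc (n ∸ suc i)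
  n∸i i l = sym (suc-∸-suc n i l)

  cellN : ∀ i k → i < n → k < n → Valid (En i k) (Hn i k) (Hn i (suc k)) (Hn (suc i) k)
          × (local (En i k) (Hn i k) (Hn i (suc k)) (Hn (suc i) k) ≡ Hn (suc i) (suc k))
  cellN i k il kl = subst₂ P (sym (n∸i i il)) (sym (n∸i k kl)) (vX a b , eX a b)
    where
    a = n ∸ suc i
    b = n ∸ suc k
    P : ℕ → ℕ → Set
    P x y = Valid (Ed x y) (Hd x y) (Hd x b) (Hd a y) × (local (Ed x y) (Hd x y) (Hd x b) (Hd a y) ≡ Hd a b)

  pN : ∀ i k → IsPartition (Hn i k)
  pN i k = pp (n ∸ i) (n ∸ k)

  HnB : ∀ k → k ≤ n → Hn n k ≡ B k
  HnB k kl rewrite n∸n≡0 n = cong B (m∸[m∸n]≡n kl)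

  HnR : ∀ i → i ≤ n → Hn i n ≡ Rc i
  HnR i il rewrite n∸n≡0 n = go (n ∸ i) refl
    where
    go : ∀ x → x ≡ n ∸ i → Hd x 0 ≡ Rc i
    go zero e = trans corner (cong Rc (sym (trans (sym (m∸[m∸n]≡n il)) (trans (cong (n ∸_) (sym e)) refl))))
    go (suc a) e = cong Rc (trans (cong (n ∸_) e) (m∸[m∸n]≡n il))

  module GB = Growth n En (Hn 0) (λ i → Hn i 0)
  open GB using (CF; RF; NZ) renaming (G to Gb)

  Gb≡ : ∀ i k → i ≤ n → k ≤ n → Gb i k ≡ Hn i k
  Gb≡ zero k _ _ = refl
  Gb≡ (suc i) zero _ _ = refl
  Gb≡ (suc i) (suc k) il kl =
    trans (cong₂ (λ x y → local (En i k) x y (Gb (suc i) k)) (Gb≡ i k (≤-trans (n≤1+n i) il) (≤-trans (n≤1+n k) kl)) (Gb≡ i (suc k) (≤-trans (n≤1+n i) il) kl))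
     (trans (cong (local (En i k) (Hn i k) (Hn i (suc k))) (Gb≡ (suc i) k il (≤-trans (n≤1+n k) kl))) (proj₂ (cellN i k il kl)))

  horizontal-flags : ∀ a k → a ≤ n → k < n → Edge (Hn (n ∸ a) k) (Hn (n ∸ a) (suc k)) (CF (n ∸ a) k)
  horizontal-flags zero k _ kl = subst₂ LeD (sym (HnB k (<⇒≤ kl))) (sym (HnB (suc k) kl)) (inj₂ (sB k kl))
                  , (λ e → ⊥-elim (Step-ne (sB k kl) (trans (sym (HnB k (<⇒≤ kl))) (trans e (HnB (suc k) kl)))))
                  , (λ { (i' , a , b , _) → ⊥-elim (<-irrefl refl (<-≤-trans b a)) })
  horizontal-flags (suc a) k al kl = proj₁ (proj₂ (proj₂ (proj₂ v))) , f1 , f2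
    where
    i = n ∸ suc a
    ei : suc i ≡ n ∸ a
    ei = suc-∸-suc n a al
    il : i < n
    il = subst (_≤ n) (sym ei) (m∸n≤m n a)
    C = cellN i k il kl
    v = proj₁ C
    F = subst (RuleCase (En i k) (Hn i k) (Hn i (suc k)) (Hn (suc i) k)) (proj₂ C) (rule-case _ _ _ _ v)
    IH : Edge (Hn (suc i) k) (Hn (suc i) (suc k)) (CF (suc i) k)
    IH = subst (λ x → Edge (Hn x k) (Hn x (suc k)) (CF x k)) (sym ei) (horizontal-flags a k (≤-trans (n≤1+n a) al) kl)
    f1 : Hn i k ≡ Hn i (suc k) → CF i k
    f1 eq with isNZ-or-zero (En i k)
    ... | inj₁ t = i , ≤-refl , il , t
    ... | inj₂ z with proj₁ (proj₂ IH) (sym (ν≡κ⇒λ≡ρ F z eq))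
    ... | i' , ii , i'n , t = i' , ≤-trans (n≤1+n i) ii , i'n , t
    f2 : CF i k → Hn i k ≡ Hn i (suc k)
    f2 (i' , ii , i'n , t) with i ≟ i'
    ... | yes refl with proj₂ (proj₂ (proj₂ (proj₂ (proj₂ v))))
    ... | inj₁ z = ⊥-elim (t≢f (trans (sym t) (cong isNZ z)))
    ... | inj₂ (q , _) = q
    f2 (i' , ii , i'n , t) | no ne = proj₂ (λ≡ρ⇒ν≡κ F (sym (proj₂ (proj₂ IH) (i' , ≤∧≢⇒< ii ne , i'n , t))))

  vertical-flags : ∀ i b → i < n → b ≤ n → Edge (Hn i (n ∸ b)) (Hn (suc i) (n ∸ b)) (RF i (n ∸ b))
  vertical-flags i zero il _ = subst₂ LeD (sym (HnR i (<⇒≤ il))) (sym (HnR (suc i) il)) (inj₂ (sR i il))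
                  , (λ e → ⊥-elim (Step-ne (sR i il) (trans (sym (HnR i (<⇒≤ il))) (trans e (HnR (suc i) il)))))
                  , (λ { (k' , a , b , _) → ⊥-elim (<-irrefl refl (<-≤-trans b a)) })
  vertical-flags i (suc b) il bl = proj₁ (proj₂ (proj₂ (proj₂ (proj₂ v)))) , f1 , f2
    where
    k = n ∸ suc b
    ek : suc k ≡ n ∸ b
    ek = suc-∸-suc n b bl
    kl : k < n
    kl = subst (_≤ n) (sym ek) (m∸n≤m n b)
    C = cellN i k il kl
    v = proj₁ C
    F = subst (RuleCase (En i k) (Hn i k) (Hn i (suc k)) (Hn (suc i) k)) (proj₂ C) (rule-case _ _ _ _ v)
    IH : Edge (Hn i (suc k)) (Hn (suc i) (suc k)) (RF i (suc k))
    IH = subst (λ x → Edge (Hn i x) (Hn (suc i) x) (RF i x)) (sym ek) (vertical-flags i b il (≤-trans (n≤1+n b) bl))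
    f1 : Hn i k ≡ Hn (suc i) k → RF i k
    f1 eq with isNZ-or-zero (En i k)
    ... | inj₁ t = k , ≤-refl , kl , t
    ... | inj₂ z with proj₁ (proj₂ IH) (sym (ν≡ρ⇒λ≡κ F z eq))
    ... | k' , kk , k'n , t = k' , ≤-trans (n≤1+n k) kk , k'n , t
    f2 : RF i k → Hn i k ≡ Hn (suc i) k
    f2 (k' , kk , k'n , t) with k ≟ k'
    ... | yes refl with proj₂ (proj₂ (proj₂ (proj₂ (proj₂ v))))
    ... | inj₁ z = ⊥-elim (t≢f (trans (sym t) (cong isNZ z)))
    ... | inj₂ (_ , q) = q
    f2 (k' , kk , k'n , t) | no ne = proj₂ (λ≡κ⇒ν≡ρ F (sym (proj₂ (proj₂ IH) (k' , ≤∧≢⇒< kk ne , k'n , t))))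

  hE : ∀ i k → i ≤ n → k < n → Edge (Hn i k) (Hn i (suc k)) (CF i k)
  hE i k il kl = subst (λ x → Edge (Hn x k) (Hn x (suc k)) (CF x k)) (m∸[m∸n]≡n il) (horizontal-flags (n ∸ i) k (m∸n≤m n i) kl)

  vE : ∀ i k → i < n → k ≤ n → Edge (Hn i k) (Hn (suc i) k) (RF i k)
  vE i k il kl = subst (λ x → Edge (Hn i x) (Hn (suc i) x) (RF i x)) (m∸[m∸n]≡n kl) (vertical-flags i (n ∸ k) il (m∸n≤m n k))

  -- GB satisfies the Boundary hypotheses; in particular its entries form a
  -- PPM, since a second nonzero entry would force a repetition where the
  -- rule creates a domino.
  backward-boundary : GB.Boundary
  backward-boundary = record
    { colU = cu
    ; rowU = ru
    ; ptop = λ k _ → pN 0 k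
    ; pleft = λ i il → subst IsPartition (sym (Gb≡ i 0 il z≤n)) (pN i 0)
    ; etop = λ k kl → hE 0 k z≤n kl
    ; eleft = λ i il → subst₂ (λ x y → Edge x y (RF i 0)) (sym (Gb≡ i 0 (<⇒≤ il) z≤n)) (sym (Gb≡ (suc i) 0 il z≤n)) (vE i 0 il z≤n)
    }
    where
    ncell : ∀ i k → i < n → k < n → NZ i k → CF (suc i) k → ⊥
    ncell i k il kl t cf = ⊥-elim (t≢f (trans (sym t) (cong isNZ (proj₁ (λ≡ρ⇒ν≡κ F (sym (proj₂ (proj₂ (hE (suc i) k il kl)) cf)))))))
      where
      C = cellN i k il kl
      F = subst (RuleCase (En i k) (Hn i k) (Hn i (suc k)) (Hn (suc i) k)) (proj₂ C) (rule-case _ _ _ _ (proj₁ C))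
    nrow : ∀ i k → i < n → k < n → NZ i k → RF i (suc k) → ⊥
    nrow i k il kl t rf = ⊥-elim (t≢f (trans (sym t) (cong isNZ (proj₁ (λ≡κ⇒ν≡ρ F (sym (proj₂ (proj₂ (vE i (suc k) il kl)) rf)))))))
      where
      C = cellN i k il kl
      F = subst (RuleCase (En i k) (Hn i k) (Hn i (suc k)) (Hn (suc i) k)) (proj₂ C) (rule-case _ _ _ _ (proj₁ C))
    cu : ∀ i i' k → i < n → i' < n → k < n → NZ i k → NZ i' k → i ≡ i'
    cu i i' k il i'l kl t t' with <-cmp i i'
    ... | tri≈ _ e _ = e
    ... | tri< lt _ _ = ⊥-elim (ncell i k il kl t (i' , lt , i'l , t'))
    ... | tri> _ _ gt = ⊥-elim (ncell i' k i'l kl t' (i , gt , il , t))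
    ru : ∀ i k k' → i < n → k < n → k' < n → NZ i k → NZ i k' → k ≡ k'
    ru i k k' il kl k'l t t' with <-cmp k k'
    ... | tri≈ _ e _ = e
    ... | tri< lt _ _ = ⊥-elim (nrow i k il kl t (k' , lt , k'l , t'))
    ... | tri> _ _ gt = ⊥-elim (nrow i k' il k'l t' (k , gt , kl , t))

module BackwardSymmetric (n : ℕ) (B Rc : ℕ → Part)
          (pB : ∀ k → k ≤ n → IsPartition (B k)) (pR : ∀ i → i ≤ n → IsPartition (Rc i))
          (sB : ∀ k → k < n → Step (B k) (B (suc k))) (sR : ∀ i → i < n → Step (Rc i) (Rc (suc i)))
          (corner : B n ≡ Rc n) (BR : ∀ j → j ≤ n → B j ≡ Rc j) where
  open Backward n B Rc pB pR sB sR corner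

  backward-symmetric : ∀ a b → (Hd a b ≡ Hd b a) × (Ed a b ≡ Ed b a)
  backward-symmetric zero zero = refl , refl
  backward-symmetric zero (suc b) = BR (n ∸ suc b) (m∸n≤m n (suc b)) , refl
  backward-symmetric (suc a) zero = sym (BR (n ∸ suc a) (m∸n≤m n (suc a))) , refl
  backward-symmetric (suc a) (suc b) = preimage-unique-swapped (proj₁ (backward-symmetric (suc a) b)) (proj₁ (backward-symmetric a (suc b))) (proj₁ (backward-symmetric a b)) (X a b) (X b a)

  symHn : ∀ i k → Hn i k ≡ Hn k i
  symHn i k = proj₁ (backward-symmetric (n ∸ i) (n ∸ k))

  symEn : ∀ i k → En i k ≡ En k i
  symEn i k = proj₂ (backward-symmetric (n ∸ i) (n ∸ k))

at : {A : Set} → A → List A → ℕ → A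
at d [] _ = d
at d (x ∷ l) zero = x
at d (x ∷ l) (suc k) = at d l k

fromAt : {A : Set} (d : A) (l : List A) → l ≡ applyUpTo (at d l) (length l)
fromAt d [] = refl
fromAt d (x ∷ l) = cong (x ∷_) (fromAt d l)

fromAt' : {A : Set} (d : A) (l : List A) (m : ℕ) → length l ≡ m → l ≡ applyUpTo (at d l) m
fromAt' d l m refl = fromAt d l

at-up : {A : Set} (d : A) (f : ℕ → A) (m k : ℕ) → k < m → at d (applyUpTo f m) k ≡ f k
at-up d f (suc m) zero _ = refl
at-up d f (suc m) (suc k) (s≤s l) = at-up d (λ z → f (suc z)) m k l

up-cong : {A : Set} (f g : ℕ → A) (m : ℕ) → (∀ k → k < m → f k ≡ g k) → applyUpTo f m ≡ applyUpTo g m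
up-cong f g zero h = refl
up-cong f g (suc m) h = cong₂ _∷_ (h 0 z<s) (up-cong (λ z → f (suc z)) (λ z → g (suc z)) m (λ k l → h (suc k) (s≤s l)))

up-inj : {A : Set} (f g : ℕ → A) (m : ℕ) → applyUpTo f m ≡ applyUpTo g m → ∀ k → k < m → f k ≡ g k
up-inj f g m e k l = trans (sym (at-up (f 0) f m k l)) (trans (cong (λ z → at (f 0) z k) e) (at-up (f 0) g m k l))

lastOr-up : {A : Set} (d : A) (f : ℕ → A) (m : ℕ) → lastOr d (applyUpTo f (suc m)) ≡ f m
lastOr-up d f zero = refl
lastOr-up d f (suc m) = lastOr-up (f 0) (λ z → f (suc z)) m

nextRow-up : ∀ (top bot : ℕ → Part) (e : ℕ → Entry) (d : ℕ)
           → (∀ j → bot (suc j) ≡ local (e j) (top j) (top (suc j)) (bot j))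
           → nextRow (applyUpTo top (suc d)) (bot 0) (applyUpTo e d) ≡ applyUpTo (λ j → bot (suc j)) d
nextRow-up top bot e zero h = refl
nextRow-up top bot e (suc d) h =
  cong₂ _∷_ (sym (h 0)) (trans (cong (λ z → nextRow (applyUpTo (λ j → top (suc j)) (suc d)) z (applyUpTo (λ j → e (suc j)) d)) (sym (h 0)))
    (nextRow-up (λ j → top (suc j)) (λ j → bot (suc j)) (λ j → e (suc j)) d (λ j → h (suc j))))

gridRows-up : ∀ (G : ℕ → ℕ → Part) (E : ℕ → ℕ → Entry) (m n : ℕ)
            → (∀ i k → G (suc i) (suc k) ≡ local (E i k) (G i k) (G i (suc k)) (G (suc i) k))
            → gridRows (applyUpTo (G 0) (suc m)) (applyUpTo (λ i → G (suc i) 0) n) (applyUpTo (λ i → applyUpTo (E i) m) n)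
              ≡ applyUpTo (λ i → applyUpTo (G i) (suc m)) (suc n)
gridRows-up G E m zero h = refl
gridRows-up G E m (suc n) h = cong (applyUpTo (G 0) (suc m) ∷_)
  (trans (cong (λ z → gridRows (G 1 0 ∷ z) (applyUpTo (λ i → G (suc (suc i)) 0) n) (applyUpTo (λ i → applyUpTo (E (suc i)) m) n))
            (nextRow-up (G 0) (G 1) (E 0) m (λ j → h 0 j)))
         (gridRows-up (λ i k → G (suc i) k) (λ i k → E (suc i) k) m n (λ i k → h (suc i) k)))

orUp : (ℕ → Bool) → ℕ → Bool
orUp f d = foldr _∨_ false (applyUpTo f d)

orUp-t : ∀ f d → orUp f d ≡ true → Σ ℕ λ k → (k < d) × (f k ≡ true)
orUp-t f (suc d) e with f 0 in eq
... | true = 0 , z<s , eq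
... | false with orUp-t (λ z → f (suc z)) d e
... | k , l , t = suc k , s≤s l , t

orUp-i : ∀ f d k → k < d → f k ≡ true → orUp f d ≡ true
orUp-i f (suc d) zero _ t rewrite t = refl
orUp-i f (suc d) (suc k) (s≤s l) t rewrite orUp-i (λ z → f (suc z)) d k l t = ∨-zeroʳ (f 0)

countF : List Bool → ℕ
countF [] = 0
countF (true ∷ fs) = countF fs
countF (false ∷ fs) = suc (countF fs)

countT : List Bool → ℕ
countT [] = 0
countT (true ∷ fs) = suc (countT fs)
countT (false ∷ fs) = countT fs

countTF : ∀ fs → countT fs + countF fs ≡ length fs
countTF [] = refl
countTF (true ∷ fs) = cong suc (countTF fs)
countTF (false ∷ fs) = trans (+-suc (countT fs) (countF fs)) (cong suc (countTF fs))

MultichainStep : List Bool → List Part → ℕ → Set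
MultichainStep fs L k = (at false fs k ≡ true → at [] L k ≡ at [] L (suc k)) × (at false fs k ≡ false → Step (at [] L k) (at [] L (suc k)))

record MultichainFacts (fs : List Bool) (L : List Part) (μ α : Part) : Set where
  field
    h0 : at [] L 0 ≡ μ
    hn : at [] L (length fs) ≡ α
    step : ∀ k → k < length fs → MultichainStep fs L k
    parts : ∀ k → k ≤ length fs → IsPartition (at [] L k)

chain-last-part : ∀ {μ α} U → IsPartition μ → DominoChain μ U α → IsPartition α
chain-last-part [] pμ refl = pμ
chain-last-part (γ ∷ U) pμ (s , c) = chain-last-part U (proj₁ (proj₂ s)) c

multichain-facts : ∀ fs μ U α → IsPartition μ → DominoChain μ U α → countF fs ≡ length U → MultichainFacts fs (multichain μ U fs) μ α
multichain-facts [] μ [] α pμ refl _ = record { h0 = refl ; hn = refl ; step = λ k () ; parts = λ { zero _ → pμ } }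
multichain-facts (true ∷ fs) μ U α pμ c cnt = record { h0 = refl ; hn = MultichainFacts.hn R ; step = st ; parts = pt }
  where
  R = multichain-facts fs μ U α pμ c cnt
  st : ∀ k → k < suc (length fs) → MultichainStep (true ∷ fs) (μ ∷ multichain μ U fs) k
  st zero _ = (λ _ → sym (MultichainFacts.h0 R)) , (λ ())
  st (suc k) (s≤s l) = MultichainFacts.step R k l
  pt : ∀ k → k ≤ suc (length fs) → IsPartition (at [] (μ ∷ multichain μ U fs) k)
  pt zero _ = pμ
  pt (suc k) (s≤s l) = MultichainFacts.parts R k l
multichain-facts (false ∷ fs) μ [] α pμ c ()
multichain-facts (false ∷ fs) μ (γ ∷ U) α pμ (s , c) cnt = record { h0 = refl ; hn = MultichainFacts.hn R ; step = st ; parts = pt }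
  where
  R = multichain-facts fs γ U α (proj₁ (proj₂ s)) c (suc-injective cnt)
  st : ∀ k → k < suc (length fs) → MultichainStep (false ∷ fs) (μ ∷ multichain γ U fs) k
  st zero _ = (λ ()) , (λ _ → subst (Step μ) (sym (MultichainFacts.h0 R)) (<d⇒Step s))
  st (suc k) (s≤s l) = MultichainFacts.step R k l
  pt : ∀ k → k ≤ suc (length fs) → IsPartition (at [] (μ ∷ multichain γ U fs) k)
  pt zero _ = pμ
  pt (suc k) (s≤s l) = MultichainFacts.parts R k l

multichain-length : ∀ fs μ U → length (multichain μ U fs) ≡ suc (length fs)
multichain-length [] μ U = refl
multichain-length (true ∷ fs) μ U = cong suc (multichain-length fs μ U)
multichain-length (false ∷ fs) μ [] = cong suc (multichain-length fs μ [])
multichain-length (false ∷ fs) μ (γ ∷ U) = cong suc (multichain-length fs γ U)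

multichain-injective : ∀ fs μ μ' U U' → countF fs ≡ length U → countF fs ≡ length U' → multichain μ U fs ≡ multichain μ' U' fs → (μ ≡ μ') × (U ≡ U')
multichain-injective [] μ μ' [] [] _ _ e = proj₁ (∷-injective e) , refl
multichain-injective [] μ μ' [] (_ ∷ _) _ ()
multichain-injective [] μ μ' (_ ∷ _) _ ()
multichain-injective (true ∷ fs) μ μ' U U' c c' e = multichain-injective fs μ μ' U U' c c' (proj₂ (∷-injective e))
multichain-injective (false ∷ fs) μ μ' [] U' ()
multichain-injective (false ∷ fs) μ μ' (γ ∷ U) [] _ ()
multichain-injective (false ∷ fs) μ μ' (γ ∷ U) (γ' ∷ U') c c' e with multichain-injective fs γ γ' U U' (suc-injective c) (suc-injective c') (proj₂ (∷-injective e))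
... | refl , refl = proj₁ (∷-injective e) , refl

multichain-surjective : ∀ fs (T : ℕ → Part) → (∀ k → k < length fs → (at false fs k ≡ true → T k ≡ T (suc k)) × (at false fs k ≡ false → T k <d T (suc k)))
        → Σ (List Part) λ U → (multichain (T 0) U fs ≡ applyUpTo T (suc (length fs))) × DominoChain (T 0) U (T (length fs)) × (length U ≡ countF fs)
multichain-surjective [] T h = [] , refl , refl , refl
multichain-surjective (true ∷ fs) T h with multichain-surjective fs (λ z → T (suc z)) (λ k l → h (suc k) (s≤s l))
... | U , e , c , ln = U , cong (T 0 ∷_) (subst (λ z → multichain z U fs ≡ applyUpTo (λ z → T (suc z)) (suc (length fs))) (sym e0) e) ,
        subst (λ z → DominoChain z U (T (suc (length fs)))) (sym e0) c , ln
  where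
  e0 : T 0 ≡ T 1
  e0 = proj₁ (h 0 z<s) refl
multichain-surjective (false ∷ fs) T h with multichain-surjective fs (λ z → T (suc z)) (λ k l → h (suc k) (s≤s l))
... | U , e , c , ln = T 1 ∷ U , cong (T 0 ∷_) e , (proj₂ (h 0 z<s) refl , c) , cong suc ln

rowsL : ∀ {n m} → Mat n m → List (List Entry)
rowsL M = toList (Data.Vec.map toList M)

entryAt : ∀ {n m} → Mat n m → ℕ → ℕ → Entry
entryAt M i k = at zer (at [] (rowsL M) i) k

at-toList : ∀ {A : Set} {n} (d : A) (v : Vec A n) (i : Fin n) → at d (toList v) (toℕ i) ≡ lookup v i
at-toList d (x Data.Vec.∷ v) fzero = refl
at-toList d (x Data.Vec.∷ v) (fsuc i) = at-toList d v i

row-at : ∀ {n m} (M : Mat n m) (i : Fin n) → at [] (rowsL M) (toℕ i) ≡ toList (lookup M i)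
row-at M i = trans (at-toList [] (Data.Vec.map toList M) i) (lookup-map i toList M)

entry-entryAt : ∀ {n m} (M : Mat n m) i k → entry M i k ≡ entryAt M (toℕ i) (toℕ k)
entry-entryAt M i k = sym (trans (cong (λ r → at zer r (toℕ k)) (row-at M i)) (at-toList zer (lookup M i) k))

entryAt-entry : ∀ {n m} (M : Mat n m) i k (il : i < n) (kl : k < m) → entryAt M i k ≡ entry M (fromℕ< il) (fromℕ< kl)
entryAt-entry M i k il kl = sym (trans (entry-entryAt M (fromℕ< il) (fromℕ< kl)) (cong₂ (entryAt M) (toℕ-fromℕ< il) (toℕ-fromℕ< kl)))

rows-len : ∀ {n m} (M : Mat n m) i → i < n → length (at [] (rowsL M) i) ≡ m
rows-len {n} {m} M i l = subst (λ j → length (at [] (rowsL M) j) ≡ m) (toℕ-fromℕ< l)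
  (trans (cong length (row-at M (fromℕ< l))) (length-toList (lookup M (fromℕ< l))))

rowsL-up : ∀ {n m} (M : Mat n m) → rowsL M ≡ applyUpTo (λ i → applyUpTo (entryAt M i) m) n
rowsL-up {n} {m} M = trans (fromAt' [] (rowsL M) n (length-toList (Data.Vec.map toList M)))
  (up-cong _ _ n (λ i l → fromAt' zer (at [] (rowsL M) i) m (rows-len M i l)))

anyNZ' : List Entry → Bool
anyNZ' l = foldr _∨_ false (map isNZ l)

rowFlags : ∀ {n m} → Mat n m → List Bool
rowFlags M = toList (Data.Vec.map anyNZ M)

rowFlags-up : ∀ {n m} (M : Mat n m) → rowFlags M ≡ applyUpTo (λ i → orUp (λ k → isNZ (entryAt M i k)) m) n
rowFlags-up {n} {m} M = trans e1 (trans (cong (map anyNZ') (rowsL-up M)) (trans (map-applyUpTo _ anyNZ' n) (up-cong _ _ n (λ i l → cong (foldr _∨_ false) (map-applyUpTo (entryAt M i) isNZ m)))))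
  where
  e1 : rowFlags M ≡ map anyNZ' (rowsL M)
  e1 = trans (toList-map anyNZ M) (trans (mapcomp (toList M)) (cong (map anyNZ') (sym (toList-map toList M))))
    where
    mapcomp : ∀ (l : List (Vec Entry m)) → map anyNZ l ≡ map anyNZ' (map toList l)
    mapcomp [] = refl
    mapcomp (x ∷ l) = cong (anyNZ' (toList x) ∷_) (mapcomp l)

lookup-transpose : ∀ {n m} (M : Mat n m) (k : Fin m) → lookup (transpose M) k ≡ Data.Vec.map (λ r → lookup r k) M
lookup-transpose {m = m} Data.Vec.[] k = lookup-replicate k Data.Vec.[]
lookup-transpose {m = m} (as Data.Vec.∷ ass) k =
  trans (lookup-⊛ k (replicate m Data.Vec._∷_ ⊛ as) (transpose ass))
    (cong₂ (λ f x → f x) (trans (lookup-⊛ k (replicate m Data.Vec._∷_) as) (cong (λ f → f (lookup as k)) (lookup-replicate k Data.Vec._∷_))) (lookup-transpose ass k))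

vec-ext : ∀ {A : Set} {n} (u v : Vec A n) → (∀ i → lookup u i ≡ lookup v i) → u ≡ v
vec-ext u v h = trans (sym (tabulate∘lookup u)) (trans (tabulate-cong h) (tabulate∘lookup v))

-- A symmetric matrix is its own transpose (so column flags = row flags).
transpose-sym : ∀ {n} (M : Mat n n) → IsSymmetric M → transpose M ≡ M
transpose-sym M s = vec-ext _ _ (λ k → trans (lookup-transpose M k) (vec-ext _ _ (λ i → trans (lookup-map i (λ r → lookup r k) M) (s i k))))

matrix : ∀ n → (ℕ → ℕ → Entry) → Mat n n
matrix n f = tabulate (λ i → tabulate (λ k → f (toℕ i) (toℕ k)))

matrix-entry : ∀ n f i k → entry (matrix n f) i k ≡ f (toℕ i) (toℕ k)
matrix-entry n f i k = trans (cong (λ r → lookup r k) (lookup∘tabulate _ i)) (lookup∘tabulate _ k)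

matrix-entryAt : ∀ n f i k → i < n → k < n → entryAt (matrix n f) i k ≡ f i k
matrix-entryAt n f i k il kl = trans (entryAt-entry (matrix n f) i k il kl) (trans (matrix-entry n f _ _) (cong₂ f (toℕ-fromℕ< il) (toℕ-fromℕ< kl)))

countNZ-up : ∀ (f : ℕ → Entry) d → (∀ k k' → k < d → k' < d → isNZ (f k) ≡ true → isNZ (f k') ≡ true → k ≡ k')
           → countNZ (applyUpTo f d) ≡ (if orUp (λ k → isNZ (f k)) d then 1 else 0)
countNZ-up f zero u = refl
countNZ-up f (suc d) u with isNZ (f 0) in eq
... | true = cong suc rest0
  where
  rest-false : orUp (λ k → isNZ (f (suc k))) d ≡ false
  rest-false with orUp (λ k → isNZ (f (suc k))) d in e2
  ... | false = refl
  ... | true with orUp-t (λ k → isNZ (f (suc k))) d e2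
  ... | k , l , t with u 0 (suc k) z<s (s≤s l) eq t
  ... | ()
  rest0 : countNZ (applyUpTo (λ z → f (suc z)) d) ≡ 0
  rest0 = trans (countNZ-up (λ z → f (suc z)) d (λ k k' l l' a b → suc-injective (u (suc k) (suc k') (s≤s l) (s≤s l') a b))) (cong (λ b → if b then 1 else 0) rest-false)
... | false = countNZ-up (λ z → f (suc z)) d (λ k k' l l' a b → suc-injective (u (suc k) (suc k') (s≤s l) (s≤s l') a b))

sum-ind : ∀ (b : ℕ → Bool) d → sum (applyUpTo (λ i → if b i then 1 else 0) d) ≡ countT (applyUpTo b d)
sum-ind b zero = refl
sum-ind b (suc d) with b 0
... | true = cong suc (sum-ind (λ z → b (suc z)) d)
... | false = sum-ind (λ z → b (suc z)) d

nzCount-rowFlags : ∀ {n m} (M : Mat n m) → (∀ i k k' → i < n → k < m → k' < m → isNZ (entryAt M i k) ≡ true → isNZ (entryAt M i k') ≡ true → k ≡ k')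
           → nzCount M ≡ countT (rowFlags M)
nzCount-rowFlags {n} {m} M u = trans e1 (trans (cong sum (trans (map-applyUpTo _ countNZ n) (up-cong _ _ n (λ i l → countNZ-up (entryAt M i) m (λ k k' a b → u i k k' l a b)))))
  (trans (sum-ind _ n) (cong countT (sym (rowFlags-up M)))))
  where
  e1 : nzCount M ≡ sum (map countNZ (applyUpTo (λ i → applyUpTo (entryAt M i) m) n))
  e1 = cong sum (trans (toList-map' (toList M)) (cong (map countNZ) (trans (sym (toList-map toList M)) (rowsL-up M))))
    where
    toList-map' : ∀ (l : List (Vec Entry m)) → map (λ row → countNZ (toList row)) l ≡ map countNZ (map toList l)
    toList-map' [] = refl
    toList-map' (x ∷ l) = cong (countNZ (toList x) ∷_) (toList-map' l)

chain-up : ∀ (f : ℕ → Part) d → (∀ k → k < d → Step (f k) (f (suc k))) → DominoChain (f 0) (applyUpTo (λ k → f (suc k)) d) (f d)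
chain-up f zero h = refl
chain-up f (suc d) h = Step⇒<d (h 0 z<s) , chain-up (λ k → f (suc k)) d (λ k l → h (suc k) (s≤s l))

rowFlags-length : ∀ {n m} (M : Mat n m) → length (rowFlags M) ≡ n
rowFlags-length M = length-toList (Data.Vec.map anyNZ M)

countF-rowFlags : ∀ {n} (M : Mat n n) (U : List Part) → length U ≡ n ∸ nzCount M → nzCount M ≡ countT (rowFlags M) → countF (rowFlags M) ≡ length U
countF-rowFlags {n} M U l nz = sym (trans l (trans (cong (n ∸_) nz) (trans (cong (_∸ countT (rowFlags M)) (trans (sym (rowFlags-length M)) (sym (countTF (rowFlags M))))) (m+n∸m≡n (countT (rowFlags M)) (countF (rowFlags M))))))

module SymmetricΦ (α : Part) (pα : IsPartition α) (n : ℕ) (μ : Part) (U : List Part) (M : Mat n n) (dom : InDom α n (μ , U , M)) where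
  sdt : IsSDT μ α U
  sdt = proj₁ dom
  lenU : length U ≡ n ∸ nzCount M
  lenU = proj₁ (proj₂ dom)
  ppm : IsPPM M
  ppm = proj₁ (proj₂ (proj₂ dom))
  symM : IsSymmetric M
  symM = proj₂ (proj₂ (proj₂ dom))

  E : ℕ → ℕ → Entry
  E = entryAt M

  fs : List Bool
  fs = rowFlags M
  Lst : List Part
  Lst = multichain μ U fs
  T : ℕ → Part
  T = at [] Lst

  Esym : ∀ i k → i < n → k < n → E i k ≡ E k i
  Esym i k il kl = trans (entryAt-entry M i k il kl) (trans (symM _ _) (sym (entryAt-entry M k i kl il)))

  rowU' : ∀ i k k' → i < n → k < n → k' < n → isNZ (E i k) ≡ true → isNZ (E i k') ≡ true → k ≡ k'
  rowU' i k k' il kl k'l a b = trans (sym (toℕ-fromℕ< kl)) (trans (cong toℕ (proj₁ ppm (fromℕ< il) (fromℕ< kl) (fromℕ< k'l)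
        (subst (λ z → isNZ z ≡ true) (entryAt-entry M i k il kl) a) (subst (λ z → isNZ z ≡ true) (entryAt-entry M i k' il k'l) b))) (toℕ-fromℕ< k'l))

  colU' : ∀ i i' k → i < n → i' < n → k < n → isNZ (E i k) ≡ true → isNZ (E i' k) ≡ true → i ≡ i'
  colU' i i' k il i'l kl a b = trans (sym (toℕ-fromℕ< il)) (trans (cong toℕ (proj₂ ppm (fromℕ< il) (fromℕ< i'l) (fromℕ< kl)
        (subst (λ z → isNZ z ≡ true) (entryAt-entry M i k il kl) a) (subst (λ z → isNZ z ≡ true) (entryAt-entry M i' k i'l kl) b))) (toℕ-fromℕ< i'l))

  nzc : nzCount M ≡ countT fs
  nzc = nzCount-rowFlags M rowU'

  cnt : countF fs ≡ length U
  cnt = countF-rowFlags M U lenU nzc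

  mcp : MultichainFacts fs Lst μ α
  mcp = multichain-facts fs μ U α (proj₁ sdt) (proj₂ sdt) cnt

  Lst-up : Lst ≡ applyUpTo T (suc n)
  Lst-up = fromAt' [] Lst (suc n) (trans (multichain-length fs μ U) (cong suc (rowFlags-length M)))

  fs-at : ∀ k → k < n → at false fs k ≡ orUp (λ k' → isNZ (E k k')) n
  fs-at k l = trans (cong (λ z → at false z k) (rowFlags-up M)) (at-up false _ n k l)

  module GM = Growth n E T T
  open GM using (G; CF; RF; NZ)

  step' : ∀ k → k < n → MultichainStep fs Lst k
  step' k l = MultichainFacts.step mcp k (subst (k <_) (sym (rowFlags-length M)) l)

  rf→t : ∀ i → i < n → RF i 0 → at false fs i ≡ true
  rf→t i il (k' , _ , k'l , t) = trans (fs-at i il) (orUp-i _ n k' k'l t)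

  t→rf : ∀ i → i < n → at false fs i ≡ true → RF i 0
  t→rf i il e with orUp-t _ n (trans (sym (fs-at i il)) e)
  ... | k' , l , t = k' , z≤n , l , t

  edgeT : ∀ k → k < n → Edge (T k) (T (suc k)) (RF k 0)
  edgeT k l with at false fs k in eq
  ... | true = inj₁ (proj₁ (step' k l) eq) , (λ _ → t→rf k l eq) , (λ _ → proj₁ (step' k l) eq)
  ... | false = inj₂ (proj₂ (step' k l) eq) , (λ e → ⊥-elim (Step-ne (proj₂ (step' k l) eq) e)) , (λ r → ⊥-elim (t≢f (trans (sym (rf→t k l r)) eq)))

  rf→cf : ∀ k → k < n → RF k 0 → CF 0 k
  rf→cf k kl (k' , _ , k'l , t) = k' , z≤n , k'l , subst (λ z → isNZ z ≡ true) (Esym k k' kl k'l) t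

  cf→rf : ∀ k → k < n → CF 0 k → RF k 0
  cf→rf k kl (i' , _ , i'l , t) = i' , z≤n , i'l , subst (λ z → isNZ z ≡ true) (Esym i' k i'l kl) t

  Gi0 : ∀ i → G i 0 ≡ T i
  Gi0 zero = refl
  Gi0 (suc i) = refl

  partsT : ∀ k → k ≤ n → IsPartition (T k)
  partsT k l = MultichainFacts.parts mcp k (subst (k ≤_) (sym (rowFlags-length M)) l)

  hyp : GM.Boundary
  hyp = record
    { colU = colU'
    ; rowU = rowU'
    ; ptop = partsT
    ; pleft = λ i l → subst IsPartition (sym (Gi0 i)) (partsT i l)
    ; etop = λ k l → let (a , b , c) = edgeT k l in a , (λ e → rf→cf k l (b e)) , (λ x → c (cf→rf k l x))
    ; eleft = λ i l → subst₂ (λ x y → Edge x y (RF i 0)) (sym (Gi0 i)) (sym (Gi0 (suc i))) (edgeT i l)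
    }

  module F = GM.Forward hyp
  module S = SymmetricGrowth n E T T hyp (λ k _ → refl) Esym

  Tn : T n ≡ α
  Tn = trans (cong T (sym (rowFlags-length M))) (MultichainFacts.hn mcp)

  Gn0 : G n 0 ≡ α
  Gn0 = trans (Gi0 n) Tn

  G0n : G 0 n ≡ α
  G0n = Tn

  rows≡ : gridRows (multichain μ U (toList (Data.Vec.map anyNZ (transpose M)))) (tailL (multichain μ U fs)) (rowsL M)
        ≡ applyUpTo (λ i → applyUpTo (G i) (suc n)) (suc n)
  rows≡ = trans (cong₃' (trans (cong (λ z → multichain μ U (toList (Data.Vec.map anyNZ z))) (transpose-sym M symM)) Lst-up) (cong tailL Lst-up) (rowsL-up M))
                (gridRows-up G E n n (λ i k → refl))
    where
    cong₃' : ∀ {a b c a' b' c'} → a ≡ a' → b ≡ b' → c ≡ c' → gridRows a b c ≡ gridRows a' b' c'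
    cong₃' refl refl refl = refl

  Pf : proj₁ (ΦU (μ , U , M)) ≡ applyUpTo (λ k → G n (suc k)) n
  Pf = trans (cong (λ z → tailL (lastOr [] z)) rows≡) (cong tailL (lastOr-up [] (λ i → applyUpTo (G i) (suc n)) n))

  Qf : proj₂ (ΦU (μ , U , M)) ≡ applyUpTo (λ i → G (suc i) n) n
  Qf = trans (cong (λ z → tailL (map (lastOr []) z)) rows≡)
        (trans (cong tailL (map-applyUpTo (λ i → applyUpTo (G i) (suc n)) (lastOr []) (suc n))) (up-cong (λ i → lastOr [] (applyUpTo (G (suc i)) (suc n))) (λ i → G (suc i) n) n (λ i l → lastOr-up [] (G (suc i)) n)))

  Q≡P : proj₂ (ΦU (μ , U , M)) ≡ proj₁ (ΦU (μ , U , M))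
  Q≡P = trans Qf (trans (up-cong _ _ n (λ i l → S.grid-symmetric (suc i) n l ≤-refl)) (sym Pf))

  Φsym-codomain : InCod α n (Φsym (μ , U , M))
  Φsym-codomain = G n n , (pα , subst (λ z → DominoChain z (proj₁ (ΦU (μ , U , M))) (G n n)) Gn0
                    (subst (λ z → DominoChain (G n 0) z (G n n)) (sym Pf) (chain-up (G n) n F.bottom-step)))
        , trans (cong length Pf) (length-applyUpTo _ n)

gridCong : ∀ n (E E' : ℕ → ℕ → Entry) (top colL top' colL' : ℕ → Part)
         → (∀ i k → i < n → k < n → E i k ≡ E' i k) → (∀ k → k ≤ n → top k ≡ top' k) → (∀ i → suc i ≤ n → colL (suc i) ≡ colL' (suc i))
         → ∀ i k → i ≤ n → k ≤ n → Growth.G n E top colL i k ≡ Growth.G n E' top' colL' i k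
gridCong n E E' top colL top' colL' he ht hl zero k il kl = ht k kl
gridCong n E E' top colL top' colL' he ht hl (suc i) zero il kl = hl i il
gridCong n E E' top colL top' colL' he ht hl (suc i) (suc k) il kl =
  trans (cong₂ (λ x y → local x y (Growth.G n E top colL i (suc k)) (Growth.G n E top colL (suc i) k)) (he i k il kl) (R i k (≤-trans (n≤1+n i) il) (≤-trans (n≤1+n k) kl)))
        (cong₂ (local (E' i k) (Growth.G n E' top' colL' i k)) (R i (suc k) (≤-trans (n≤1+n i) il) kl) (R (suc i) k il (≤-trans (n≤1+n k) kl)))
  where
  R = gridCong n E E' top colL top' colL' he ht hl

chain-at : ∀ μ U α' → IsPartition μ → DominoChain μ U α'
         → (∀ k → k < length U → at [] (μ ∷ U) k <d at [] (μ ∷ U) (suc k)) × (∀ k → k ≤ length U → IsPartition (at [] (μ ∷ U) k)) × (at [] (μ ∷ U) (length U) ≡ α')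
chain-at μ [] α' pμ refl = (λ k ()) , (λ { zero _ → pμ }) , refl
chain-at μ (γ ∷ U) α' pμ (s , c) with chain-at γ U α' (proj₁ (proj₂ s)) c
... | a , b , e = (λ { zero _ → s ; (suc k) (s≤s l) → a k l }) , (λ { zero _ → pμ ; (suc k) (s≤s l) → b k l }) , e

-- Surjectivity: for P ∈ 𝒟(λ/α) with n dominoes, grow a grid backwards whose
-- bottom row and right column are both the chain α, P (Backward).  Its
-- entries form a symmetric PPM M, its top row is the multichain of some
-- (μ , U), and the forward grid of (μ , U , M) is this grid, so Φsym gives P.
module FromTableau (α : Part) (pα : IsPartition α) (n : ℕ) (P : List Part) (λ' : Part)
                   (ch : DominoChain α P λ') (lenP : length P ≡ n) where
  Bf : ℕ → Part
  Bf = at [] (α ∷ P)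
  CA : (∀ k → k < length P → Bf k <d Bf (suc k)) × (∀ k → k ≤ length P → IsPartition (Bf k)) × (Bf (length P) ≡ λ')
  CA = chain-at α P λ' pα ch
  pB : ∀ k → k ≤ n → IsPartition (Bf k)
  pB k l = proj₁ (proj₂ CA) k (subst (k ≤_) (sym lenP) l)
  sB : ∀ k → k < n → Step (Bf k) (Bf (suc k))
  sB k l = <d⇒Step (proj₁ CA k (subst (k <_) (sym lenP) l))
  open Backward n Bf Bf pB pB sB sB refl
  module SY = BackwardSymmetric n Bf Bf pB pB sB sB refl (λ _ _ → refl)

  M : Mat n n
  M = matrix n En
  T : ℕ → Part
  T = Hn 0
  fs : List Bool
  fs = rowFlags M
  EmEn : ∀ i k → i < n → k < n → entryAt M i k ≡ En i k
  EmEn = matrix-entryAt n En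
  fs-at : ∀ k → k < n → at false fs k ≡ orUp (λ k' → isNZ (entryAt M k k')) n
  fs-at k l = trans (cong (λ z → at false z k) (rowFlags-up M)) (at-up false _ n k l)
  cf : ∀ k → k < n → at false fs k ≡ true → GB.CF 0 k
  cf k kl e with orUp-t _ n (trans (sym (fs-at k kl)) e)
  ... | k' , l , t = k' , z≤n , l , subst (λ z → isNZ z ≡ true) (trans (EmEn k k' kl l) (SY.symEn k k')) t
  ncf : ∀ k → k < n → at false fs k ≡ false → GB.CF 0 k → ⊥
  ncf k kl e (i' , _ , i'l , t) = t≢f (trans (sym (trans (fs-at k kl) (orUp-i _ n i' i'l (subst (λ z → isNZ z ≡ true) (sym (trans (EmEn k i' kl i'l) (SY.symEn k i'))) t)))) e)
  h : ∀ k → k < length fs → (at false fs k ≡ true → T k ≡ T (suc k)) × (at false fs k ≡ false → T k <d T (suc k))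
  h k l' = (λ e → proj₂ (proj₂ (hE 0 k z≤n kl)) (cf k kl e)) ,
           (λ e → Step⇒<d (strict-step (proj₁ (hE 0 k z≤n kl)) (λ q → ncf k kl e (proj₁ (proj₂ (hE 0 k z≤n kl)) q))))
    where
    kl : k < n
    kl = subst (k <_) (rowFlags-length M) l'
  MS : Σ (List Part) λ U → (multichain (T 0) U fs ≡ applyUpTo T (suc (length fs))) × DominoChain (T 0) U (T (length fs)) × (length U ≡ countF fs)
  MS = multichain-surjective fs T h
  U : List Part
  U = proj₁ MS
  μ : Part
  μ = T 0
  mcE : multichain μ U fs ≡ applyUpTo T (suc n)
  mcE = subst (λ z → multichain μ U fs ≡ applyUpTo T (suc z)) (rowFlags-length M) (proj₁ (proj₂ MS))
  Tn : T n ≡ α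
  Tn = HnR 0 z≤n
  chU : DominoChain μ U α
  chU = subst (DominoChain μ U) (trans (cong T (rowFlags-length M)) Tn) (proj₁ (proj₂ (proj₂ MS)))
  rowU'' : ∀ i k k' → i < n → k < n → k' < n → isNZ (entryAt M i k) ≡ true → isNZ (entryAt M i k') ≡ true → k ≡ k'
  rowU'' i k k' il kl k'l a b = GB.Boundary.rowU backward-boundary i k k' il kl k'l (subst (λ z → isNZ z ≡ true) (EmEn i k il kl) a) (subst (λ z → isNZ z ≡ true) (EmEn i k' il k'l) b)
  lenU : length U ≡ n ∸ nzCount M
  lenU = trans (proj₂ (proj₂ (proj₂ MS))) (sym (trans (cong (n ∸_) (nzCount-rowFlags M rowU''))
           (trans (cong (_∸ countT fs) (trans (sym (rowFlags-length M)) (sym (countTF fs)))) (m+n∸m≡n (countT fs) (countF fs)))))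
  ppm : IsPPM M
  ppm = (λ i k k' a b → toℕ-injective (GB.Boundary.rowU backward-boundary (toℕ i) (toℕ k) (toℕ k') (toℕ<n i) (toℕ<n k) (toℕ<n k')
               (subst (λ z → isNZ z ≡ true) (matrix-entry n En i k) a) (subst (λ z → isNZ z ≡ true) (matrix-entry n En i k') b)))
      , (λ i i' k a b → toℕ-injective (GB.Boundary.colU backward-boundary (toℕ i) (toℕ i') (toℕ k) (toℕ<n i) (toℕ<n i') (toℕ<n k)
               (subst (λ z → isNZ z ≡ true) (matrix-entry n En i k) a) (subst (λ z → isNZ z ≡ true) (matrix-entry n En i' k) b)))
  symM : IsSymmetric M
  symM i k = trans (matrix-entry n En i k) (trans (SY.symEn (toℕ i) (toℕ k)) (sym (matrix-entry n En k i)))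
  dom : InDom α n (μ , U , M)
  dom = (pN 0 0 , chU) , lenU , ppm , symM

  module DD = SymmetricΦ α pα n μ U M dom
  Tq : ∀ k → k ≤ n → DD.T k ≡ T k
  Tq k l = up-inj DD.T T (suc n) (trans (sym DD.Lst-up) mcE) k (s≤s l)
  grids-agree : ∀ i k → i ≤ n → k ≤ n → DD.GM.G i k ≡ GB.G i k
  grids-agree = gridCong n (entryAt M) En DD.T DD.T (Hn 0) (λ i → Hn i 0) EmEn Tq (λ i l → trans (Tq (suc i) l) (SY.symHn 0 (suc i)))
  phi : Φsym (μ , U , M) ≡ P
  phi = trans DD.Pf (trans (up-cong _ _ n (λ k l → trans (grids-agree n (suc k) ≤-refl l) (trans (Gb≡ n (suc k) ≤-refl l) (HnB (suc k) l))))
          (sym (fromAt' [] P n lenP)))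

module Bijection (α : Part) (pα : IsPartition α) (n : ℕ) where

  Φsym-well-defined : (d : Dom n) → InDom α n d → proj₂ (ΦU d) ≡ proj₁ (ΦU d) × InCod α n (Φsym d)
  Φsym-well-defined (μ , U , M) dom = Q≡P , Φsym-codomain
    where open SymmetricΦ α pα n μ U M dom

  Φsym-injective : (d d' : Dom n) → InDom α n d → InDom α n d' → Φsym d ≡ Φsym d' → d ≡ d'
  Φsym-injective (μ , U , M) (μ' , U' , M') dom dom' eq = fin
    where
    module A = SymmetricΦ α pα n μ U M dom
    module B = SymmetricΦ α pα n μ' U' M' dom'
    bot : ∀ k → k ≤ n → A.GM.G n k ≡ B.GM.G n k
    bot zero _ = trans A.Gn0 (sym B.Gn0)
    bot (suc k) l = up-inj (λ k → A.GM.G n (suc k)) (λ k → B.GM.G n (suc k)) n (trans (sym A.Pf) (trans eq B.Pf)) k l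
    rgt : ∀ i → i ≤ n → A.GM.G i n ≡ B.GM.G i n
    rgt zero _ = trans A.G0n (sym B.G0n)
    rgt (suc i) l = up-inj (λ i → A.GM.G (suc i) n) (λ i → B.GM.G (suc i) n) n (trans (sym A.Qf) (trans A.Q≡P (trans eq (trans (sym B.Q≡P) B.Qf)))) i l
    module I = BoundaryDetermines n A.E B.E A.T A.T B.T B.T A.hyp B.hyp bot rgt
    Meq : M ≡ M'
    Meq = vec-ext M M' (λ i → vec-ext _ _ (λ k → trans (entry-entryAt M i k) (trans (I.entries-equal (toℕ i) (toℕ k) (toℕ<n i) (toℕ<n k)) (sym (entry-entryAt M' i k)))))
    Leq : A.Lst ≡ multichain μ' U' (rowFlags M)
    Leq = trans A.Lst-up (trans (up-cong A.T B.T (suc n) (λ k l → I.grid-equal 0 k z≤n (≤-pred l))) (sym (subst (λ z → multichain μ' U' (rowFlags z) ≡ applyUpTo B.T (suc n)) (sym Meq) B.Lst-up)))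
    fin : (μ , U , M) ≡ (μ' , U' , M')
    fin with multichain-injective (rowFlags M) μ μ' U U' A.cnt (subst (λ z → countF (rowFlags z) ≡ length U') (sym Meq) B.cnt) Leq
    ... | e1 , e2 = cong₂ _,_ e1 (cong₂ _,_ e2 Meq)

  Φsym-surjective : (P : List Part) → InCod α n P → Σ (Dom n) (λ d → InDom α n d × Φsym d ≡ P)
  Φsym-surjective P (λ' , (_ , ch) , lenP) = (μ , U , M) , dom , phi
    where open FromTableau α pα n P λ' ch lenP

corollary3p5 : (α : Part) → IsPartition α → (n : ℕ) →
    ((d : Dom n) → InDom α n d →
    proj₂ (ΦU d) ≡ proj₁ (ΦU d) × InCod α n (Φsym d))
    × ((d d′ : Dom n) → InDom α n d → InDom α n d′ → Φsym d ≡ Φsym d′ → d ≡ d′)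
    × ((P : List Part) → InCod α n P → Σ (Dom n) (λ d → InDom α n d × Φsym d ≡ P))
corollary3p5 α pα n =
  Φsym-well-defined , Φsym-injective , Φsym-surjective
  where open Bijection α pα n
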